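{- Let $k$ be an odd positive integer, and let $n,j$ be integers with $2\leq j\leq\frac{n}{2}$. Then $C_n^{\{0,2\}}$ can be embedded in $K_k^*$ if and only if $n\leq\binom{k+1}{2}-3$. When $j\geq3$, $C_n^{\{0,j\}}$ can be embedded in $K_k^*$ if and only if $n\leq\binom{k+1}{2}-1$.
   Context: $K_k^*$ denotes the complete graph $K_k$ on vertices $v_0,\dotsc,v_{k-1}$ with a loop $v_iv_i$ added at every vertex. An embedding of a graph $G$ in $K_k^*$ is a map $f:V(G)\to V(K_k^*)$ such that each edge $uv$ of $G$ is sent to the edge $f(u)f(v)$ of $K_k^*$ (a loop if $f(u)=f(v)$), and the induced map $E(G)\to E(K_k^*)$ is injective. For $2\leq j\leq n/2$, $C_n^{\{0,j\}}$ is the cycle $w_0w_1\dotsb w_{n-1}w_0$ on $n$ vertices together with one chord $w_0w_j$ (so it has $n+1$ edges). -}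

module Defs where

open import Data.Nat using (ℕ; zero; suc; _+_; _*_; _<?_)
open import Data.Fin using (Fin; zero; suc; toℕ; fromℕ<)
open import Data.Product using (Σ; _×_; _,_; ∃)
open import Data.Sum using (_⊎_; inj₁; inj₂)
open import Data.Unit using (⊤; tt)
open import Relation.Nullary using (yes; no)
open import Relation.Binary.PropositionalEquality using (_≡_)

Odd : ℕ → Set
Odd k = ∃ λ m → k ≡ suc (2 * m)

next : ∀ {n} → Fin n → Fin n
next {suc m} i with toℕ i <? m
... | yes p = suc (fromℕ< p)
... | no _  = zero

-- the vertex w₀ (Fin n is inhabited since j : Fin n)
w₀ : ∀ {n} → Fin n → Fin n
w₀ {suc m} _ = zero

-- Edges of C_n^{0,j} on vertex set Fin n (vertex i = w_i):
-- inj₁ i : cycle edge w_i w_{i+1 mod n};  inj₂ tt : chord w₀ w_j.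
CEdge : ℕ → Set
CEdge n = Fin n ⊎ ⊤

ends : ∀ {n} (j : Fin n) → CEdge n → Fin n × Fin n
ends j (inj₁ i)  = i , next i
ends j (inj₂ tt) = w₀ j , j

SameEdge : ∀ {k} → Fin k × Fin k → Fin k × Fin k → Set
SameEdge (a , b) (c , d) = (a ≡ c × b ≡ d) ⊎ (a ≡ d × b ≡ c)

EmbedsInKStar : ∀ {n} (j : Fin n) (k : ℕ) → Set
EmbedsInKStar {n} j k =
  Σ (Fin n → Fin k) λ f →
    ∀ (e e' : CEdge n) →
      SameEdge (f (Data.Product.proj₁ (ends j e)) , f (Data.Product.proj₂ (ends j e)))
               (f (Data.Product.proj₁ (ends j e')) , f (Data.Product.proj₂ (ends j e'))) →
      e ≡ e'

-- An embedding of C_n^{0,j} in K_k^* is a closed walk u₀ u₁ … uₙ = u₀ in K_k^* whose n steps and chord u₀u_j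
-- are n + 1 distinct edges (loops allowed); as K_k^* has C(k + 1, 2) edges, this bounds n. For j = 2 the chord
-- joins u₀ ≠ u₂, which have odd degree in the trail, whereas for odd k every vertex of K_k^* has even degree
-- k + 1. So the unused edges meet both u₀ and u₂ and do not include the chord: there are at least two of them.
--
-- Conversely, trails are built by induction on odd k from trails in K_5^* and K_7^* found by computer search.
-- Through any old vertex x, the 2k + 3 new edges of K_{k+2}^* contain closed walks of every length from 3 to
-- 2k + 3; splicing one in at the chord's endpoint u_j, with the chord ending before or after it, reaches every
-- admissible length in K_{k+2}^*.

module Submission where

open import Defs
open import Data.Nat
open import Data.Nat.Properties
open import Data.Nat.Combinatorics using (_C_; nCk+nC[k+1]≡[n+1]C[k+1]; nC1≡n)
open import Data.Nat.DivMod using (_%_; _/_; m≡m%n+[m/n]*n; m%n<n)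
open import Data.Nat.Tactic.RingSolver using (solve-∀)
open import Data.Bool using (true; false; T; if_then_else_)
open import Data.Empty using (⊥; ⊥-elim)
open import Data.Unit using (tt)
open import Data.Fin using (Fin; zero; suc; toℕ; fromℕ<)
open import Data.Fin.Properties using (toℕ-injective; toℕ<n; fromℕ<-toℕ; toℕ-fromℕ<)
import Data.Fin.Properties as Fin
open import Data.Product using (∃; ∃₂; _×_; _,_; proj₁; proj₂; uncurry; map₂)
open import Data.Product.Properties using (≡-dec; ,-injective)
open import Data.Sum using (_⊎_; inj₁; inj₂)
open import Data.List using (List; []; _∷_; _++_; length; map; applyUpTo)
open import Data.List.Properties using (length-map; length-++; ++-assoc; ++-identityʳ; map-++; length-applyUpTo)
open import Data.List.Relation.Unary.Any as Any using (Any; here; there; any?)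
open import Data.List.Relation.Unary.All as All using (All; []; _∷_; all?)
open import Data.List.Relation.Unary.All.Properties using (All¬⇒¬Any; ++⁺; ++⁻ˡ; ++⁻ʳ)
open import Data.List.Relation.Unary.AllPairs using ([]; _∷_)
open import Data.List.Relation.Unary.Unique.Propositional using (Unique)
import Data.List.Relation.Unary.Unique.Propositional.Properties as Unique
import Data.List.Relation.Unary.Unique.DecPropositional as UniqueDec
open import Data.List.Membership.Propositional using (_∈_; _∉_)
open import Data.List.Membership.Propositional.Properties using (∈-∃++; ∈-++⁺ˡ; ∈-++⁺ʳ; ∈-++⁻; ∈-map⁻)
open import Function.Bundles using (_⇔_; mk⇔)
open import Relation.Binary.PropositionalEquality
open import Relation.Binary.Definitions using (tri<; tri≈; tri>)
open import Relation.Nullary using (¬_; Dec; yes; no)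
open import Relation.Nullary.Decidable using (_×-dec_; _→-dec_; map′; toWitness)

edge : ℕ → ℕ → ℕ × ℕ
edge a b = if a ≤ᵇ b then (a , b) else (b , a)

steps : List ℕ → List (ℕ × ℕ)
steps [] = []
steps (a ∷ []) = []
steps (a ∷ b ∷ l) = (a , b) ∷ steps (b ∷ l)

stepEdges : List ℕ → List (ℕ × ℕ)
stepEdges U = map (uncurry edge) (steps U)

lookupOr : {A : Set} → A → List A → ℕ → A
lookupOr d [] i = d
lookupOr d (x ∷ l) zero = x
lookupOr d (x ∷ l) (suc i) = lookupOr d l i

-- Out-of-range positions read as 0.
_!_ : List ℕ → ℕ → ℕ
_!_ = lookupOr 0

chordedEdges : List ℕ → ℕ → List (ℕ × ℕ)
chordedEdges U j = edge (U ! 0) (U ! j) ∷ stepEdges U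

-- U = u₀ u₁ … uₙ is the image of w₀ w₁ … wₙ under an embedding of C_n^{0,j} (with wₙ = w₀).
record ChordedTrail (k n j : ℕ) (U : List ℕ) : Set where
  constructor chordedTrail
  field
    length≡ : length U ≡ suc n
    vertices< : All (_< k) U
    closed : U ! n ≡ U ! 0
    distinct : Unique (chordedEdges U j)

chordedTrail? : ∀ k n j U → Dec (ChordedTrail k n j U)
chordedTrail? k n j U =
  map′ (λ (a , b , c , d) → chordedTrail a b c d) (λ (chordedTrail a b c d) → a , b , c , d)
    (length U ≟ suc n ×-dec all? (_<? k) U ×-dec U ! n ≟ U ! 0 ×-dec
     UniqueDec.unique? (≡-dec _≟_ _≟_) (chordedEdges U j))

edge-≤ : ∀ {a b} → a ≤ b → edge a b ≡ (a , b)
edge-≤ {a} {b} a≤b with a ≤ᵇ b | ≤⇒≤ᵇ a≤b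
... | true | _ = refl

edge-> : ∀ {a b} → b < a → edge a b ≡ (b , a)
edge-> {a} {b} b<a with a ≤ᵇ b in eq
... | false = refl
... | true = ⊥-elim (<⇒≱ b<a (≤ᵇ⇒≤ a b (subst T (sym eq) tt)))

edge-comm : ∀ a b → edge a b ≡ edge b a
edge-comm a b with <-cmp a b
... | tri< a<b _ _ = trans (edge-≤ (<⇒≤ a<b)) (sym (edge-> a<b))
... | tri≈ _ refl _ = refl
... | tri> _ _ b<a = trans (edge-> b<a) (sym (edge-≤ (<⇒≤ b<a)))

edge-cases : ∀ a b → edge a b ≡ (a , b) ⊎ edge a b ≡ (b , a)
edge-cases a b with a ≤ᵇ b
... | true = inj₁ refl
... | false = inj₂ refl

edge-injective : ∀ {a b c d} → edge a b ≡ edge c d → (a ≡ c × b ≡ d) ⊎ (a ≡ d × b ≡ c)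
edge-injective {a} {b} {c} {d} eq with edge-cases a b | edge-cases c d
... | inj₁ x | inj₁ y = inj₁ (,-injective (trans (sym x) (trans eq y)))
... | inj₁ x | inj₂ y = inj₂ (,-injective (trans (sym x) (trans eq y)))
... | inj₂ x | inj₁ y = let a≡d , b≡c = ,-injective (trans (sym x) (trans eq y)) in inj₂ (b≡c , a≡d)
... | inj₂ x | inj₂ y = let b≡d , a≡c = ,-injective (trans (sym x) (trans eq y)) in inj₁ (a≡c , b≡d)

module _ {A : Set} where

  lookupOr-applyUpTo : ∀ {d} (φ : ℕ → A) {m i} → i < m → lookupOr d (applyUpTo φ m) i ≡ φ i
  lookupOr-applyUpTo φ {suc m} {zero} _ = refl
  lookupOr-applyUpTo φ {suc m} {suc i} i<m = lookupOr-applyUpTo (λ i → φ (suc i)) (s<s⁻¹ i<m)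

  All-lookupOr : ∀ {P : A → Set} {d} {l : List A} {i} → All P l → i < length l → P (lookupOr d l i)
  All-lookupOr {i = zero} (px ∷ _) _ = px
  All-lookupOr {i = suc i} (_ ∷ pl) i<l = All-lookupOr pl (s<s⁻¹ i<l)

  All-fromLookupOr : ∀ {P : A → Set} d (l : List A) → (∀ {i} → i < length l → P (lookupOr d l i)) → All P l
  All-fromLookupOr d [] h = []
  All-fromLookupOr d (x ∷ l) h = h z<s ∷ All-fromLookupOr d l (λ i<l → h (s<s i<l))

  Unique⇒lookupOr-injective : ∀ {d} {l : List A} → Unique l → ∀ {i i′} → i < length l → i′ < length l →
                              lookupOr d l i ≡ lookupOr d l i′ → i ≡ i′
  Unique⇒lookupOr-injective (_ ∷ _) {zero} {zero} _ _ _ = refl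
  Unique⇒lookupOr-injective (x∉ ∷ _) {zero} {suc i′} _ i′<l eq = ⊥-elim (All-lookupOr x∉ (s<s⁻¹ i′<l) eq)
  Unique⇒lookupOr-injective (x∉ ∷ _) {suc i} {zero} i<l _ eq = ⊥-elim (All-lookupOr x∉ (s<s⁻¹ i<l) (sym eq))
  Unique⇒lookupOr-injective (_ ∷ u) {suc i} {suc i′} i<l i′<l eq =
    cong suc (Unique⇒lookupOr-injective u (s<s⁻¹ i<l) (s<s⁻¹ i′<l) eq)

  lookupOr-injective⇒Unique : ∀ d (l : List A) → (∀ {i i′} → i < length l → i′ < length l →
                              lookupOr d l i ≡ lookupOr d l i′ → i ≡ i′) → Unique l
  lookupOr-injective⇒Unique d [] _ = []
  lookupOr-injective⇒Unique d (x ∷ l) inj =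
    All-fromLookupOr d l (λ i<l eq → 0≢1+n (inj z<s (s<s i<l) eq)) ∷
    lookupOr-injective⇒Unique d l (λ i<l i′<l eq → suc-injective (inj (s<s i<l) (s<s i′<l) eq))

module _ {k n j U} (T : ChordedTrail k n j U) where
  open ChordedTrail T

  position< : ∀ {i} → i ≤ n → i < length U
  position< i≤n = subst (_ <_) (sym length≡) (s≤s i≤n)

  vertex< : ∀ {i} → i ≤ n → U ! i < k
  vertex< i≤n = All-lookupOr vertices< (position< i≤n)

length-steps : ∀ {n} (U : List ℕ) → length U ≡ suc n → length (steps U) ≡ n
length-steps (a ∷ []) refl = refl
length-steps {suc n} (a ∷ b ∷ U) eq = cong suc (length-steps (b ∷ U) (suc-injective eq))

length-chordedEdges : ∀ {n} (U : List ℕ) j → length U ≡ suc n → length (chordedEdges U j) ≡ suc n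
length-chordedEdges U j eq = cong suc (trans (length-map (uncurry edge) (steps U)) (length-steps U eq))

lookupOr-stepEdges : ∀ (U : List ℕ) {i} → suc i < length U →
                     lookupOr (0 , 0) (stepEdges U) i ≡ edge (U ! i) (U ! suc i)
lookupOr-stepEdges (a ∷ []) (s≤s ())
lookupOr-stepEdges (a ∷ b ∷ U) {zero} _ = refl
lookupOr-stepEdges (a ∷ b ∷ U) {suc i} i<U = lookupOr-stepEdges (b ∷ U) (s<s⁻¹ i<U)

toℕ-next : ∀ {n} (i : Fin n) → toℕ (next i) ≡ suc (toℕ i) ⊎ (toℕ (next i) ≡ 0 × suc (toℕ i) ≡ n)
toℕ-next {suc m} i with toℕ i <? m
... | yes i<m = inj₁ (cong suc (toℕ-fromℕ< i<m))
... | no i≮m = inj₂ (refl , cong suc (≤-antisym (≤-pred (toℕ<n i)) (≮⇒≥ i≮m)))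

toℕ-w₀ : ∀ {n} (j : Fin n) → toℕ (w₀ j) ≡ 0
toℕ-w₀ {suc m} j = refl

sameEdge⇒edge≡ : ∀ {k} {a b c d : Fin k} → SameEdge (a , b) (c , d) →
                 edge (toℕ a) (toℕ b) ≡ edge (toℕ c) (toℕ d)
sameEdge⇒edge≡ (inj₁ (refl , refl)) = refl
sameEdge⇒edge≡ {a = a} {b} (inj₂ (refl , refl)) = edge-comm (toℕ a) (toℕ b)

edge≡⇒sameEdge : ∀ {k} {a b c d : Fin k} → edge (toℕ a) (toℕ b) ≡ edge (toℕ c) (toℕ d) →
                 SameEdge (a , b) (c , d)
edge≡⇒sameEdge eq with edge-injective eq
... | inj₁ (a≡c , b≡d) = inj₁ (toℕ-injective a≡c , toℕ-injective b≡d)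
... | inj₂ (a≡d , b≡c) = inj₂ (toℕ-injective a≡d , toℕ-injective b≡c)

imageEdge : ∀ {n k} (j : Fin n) → (Fin n → Fin k) → CEdge n → ℕ × ℕ
imageEdge j f e = edge (toℕ (f (proj₁ (ends j e)))) (toℕ (f (proj₂ (ends j e))))

-- The position of an edge of C_n^{0,j} in chordedEdges.
edgeIndex : ∀ {n} → CEdge n → ℕ
edgeIndex (inj₁ i) = suc (toℕ i)
edgeIndex (inj₂ tt) = 0

edgeAt : ∀ {n} p → p < suc n → CEdge n
edgeAt zero _ = inj₂ tt
edgeAt (suc i) i<n = inj₁ (fromℕ< (s<s⁻¹ i<n))

edgeIndex< : ∀ {n} (e : CEdge n) → edgeIndex e < suc n
edgeIndex< (inj₁ i) = s<s (toℕ<n i)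
edgeIndex< (inj₂ tt) = z<s

edgeIndex-injective : ∀ {n} {e e′ : CEdge n} → edgeIndex e ≡ edgeIndex e′ → e ≡ e′
edgeIndex-injective {e = inj₁ i} {inj₁ i′} eq = cong inj₁ (toℕ-injective (suc-injective eq))
edgeIndex-injective {e = inj₂ tt} {inj₂ tt} eq = refl

edgeIndex-edgeAt : ∀ {n} p (p<n : p < suc n) → edgeIndex (edgeAt p p<n) ≡ p
edgeIndex-edgeAt zero _ = refl
edgeIndex-edgeAt (suc i) _ = cong suc (toℕ-fromℕ< _)

record Traces {n k} (f : Fin n → Fin k) (U : List ℕ) : Set where
  field
    length≡ : length U ≡ suc n
    entries : ∀ i → U ! toℕ i ≡ toℕ (f i)
    closed : U ! n ≡ U ! 0

module _ {n k} (j : Fin n) {f : Fin n → Fin k} {U : List ℕ} (tr : Traces f U) where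
  open Traces tr

  private
    entry-next : ∀ i → U ! suc (toℕ i) ≡ toℕ (f (next i))
    entry-next i with toℕ-next i
    ... | inj₁ eq = trans (cong (U !_) (sym eq)) (entries (next i))
    ... | inj₂ (eq , 1+i≡n) = begin
      U ! suc (toℕ i)   ≡⟨ cong (U !_) 1+i≡n ⟩
      U ! n             ≡⟨ closed ⟩
      U ! 0             ≡⟨ cong (U !_) (sym eq) ⟩
      U ! toℕ (next i)  ≡⟨ entries (next i) ⟩
      toℕ (f (next i))  ∎
      where open ≡-Reasoning

    index< : ∀ {p} → p < suc n → p < length (chordedEdges U (toℕ j))
    index< {p} = subst (p <_) (sym (length-chordedEdges U (toℕ j) length≡))

  lookupOr-edgeIndex : ∀ e → lookupOr (0 , 0) (chordedEdges U (toℕ j)) (edgeIndex e) ≡ imageEdge j f e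
  lookupOr-edgeIndex (inj₁ i) =
    trans (lookupOr-stepEdges U (subst (suc (toℕ i) <_) (sym length≡) (s<s (toℕ<n i))))
          (cong₂ edge (entries i) (entry-next i))
  lookupOr-edgeIndex (inj₂ tt) =
    cong₂ edge (trans (cong (U !_) (sym (toℕ-w₀ j))) (entries (w₀ j))) (entries j)

  traces-distinct⇒injective : Unique (chordedEdges U (toℕ j)) →
                              ∀ e e′ → SameEdge (f (proj₁ (ends j e)) , f (proj₂ (ends j e)))
                                                (f (proj₁ (ends j e′)) , f (proj₂ (ends j e′))) → e ≡ e′
  traces-distinct⇒injective distinct e e′ same = edgeIndex-injective
    (Unique⇒lookupOr-injective distinct (index< (edgeIndex< e)) (index< (edgeIndex< e′))
      (trans (lookupOr-edgeIndex e) (trans (sameEdge⇒edge≡ same) (sym (lookupOr-edgeIndex e′)))))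

  traces-injective⇒distinct : (∀ e e′ → SameEdge (f (proj₁ (ends j e)) , f (proj₂ (ends j e)))
                                                  (f (proj₁ (ends j e′)) , f (proj₂ (ends j e′))) → e ≡ e′) →
                              Unique (chordedEdges U (toℕ j))
  traces-injective⇒distinct injective =
    lookupOr-injective⇒Unique (0 , 0) (chordedEdges U (toℕ j)) λ {p} {p′} p< p′< eq →
    let p<n = subst (p <_) (length-chordedEdges U (toℕ j) length≡) p<
        p′<n = subst (p′ <_) (length-chordedEdges U (toℕ j) length≡) p′<
        same = edge≡⇒sameEdge (trans (sym (lookupOr-edgeAt p p<n)) (trans eq (lookupOr-edgeAt p′ p′<n)))
    in trans (sym (edgeIndex-edgeAt p p<n)) (trans (cong edgeIndex (injective _ _ same)) (edgeIndex-edgeAt p′ p′<n))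
    where
    lookupOr-edgeAt : ∀ q q<n → lookupOr (0 , 0) (chordedEdges U (toℕ j)) q ≡ imageEdge j f (edgeAt q q<n)
    lookupOr-edgeAt q q<n =
      trans (cong (lookupOr (0 , 0) (chordedEdges U (toℕ j))) (sym (edgeIndex-edgeAt q q<n)))
            (lookupOr-edgeIndex (edgeAt q q<n))

chordedTrail⇒embeds : ∀ {k n} (j : Fin n) {U} → ChordedTrail k n (toℕ j) U → EmbedsInKStar j k
chordedTrail⇒embeds {k} {n} j {U} T = f , traces-distinct⇒injective j tr distinct
  where
  open ChordedTrail T
  f : Fin n → Fin k
  f i = fromℕ< (vertex< T (<⇒≤ (toℕ<n i)))
  tr : Traces f U
  tr = record { length≡ = length≡ ; entries = λ i → sym (toℕ-fromℕ< _) ; closed = closed }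

module _ {k m} (f : Fin (suc m) → Fin k) where

  private
    vertexAt : ℕ → ℕ
    vertexAt i with i <? suc m
    ... | yes i<n = toℕ (f (fromℕ< i<n))
    ... | no _ = toℕ (f zero)

    vertexAt-fin : ∀ i → vertexAt (toℕ i) ≡ toℕ (f i)
    vertexAt-fin i with toℕ i <? suc m
    ... | yes i<n = cong (λ x → toℕ (f x)) (fromℕ<-toℕ i i<n)
    ... | no i≮n = ⊥-elim (i≮n (toℕ<n i))

    vertexAt-last : vertexAt (suc m) ≡ toℕ (f zero)
    vertexAt-last with suc m <? suc m
    ... | yes n<n = ⊥-elim (n≮n (suc m) n<n)
    ... | no _ = refl

    vertexAt< : ∀ i → vertexAt i < k
    vertexAt< i with i <? suc m
    ... | yes _ = toℕ<n _
    ... | no _ = toℕ<n _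

  walkOf : List ℕ
  walkOf = applyUpTo vertexAt (suc (suc m))

  walkOf-traces : Traces f walkOf
  walkOf-traces = record
    { length≡ = length-applyUpTo vertexAt (suc (suc m))
    ; entries = λ i →
        trans (lookupOr-applyUpTo vertexAt {suc (suc m)} {toℕ i} (m<n⇒m<1+n (toℕ<n i))) (vertexAt-fin i)
    ; closed = trans (lookupOr-applyUpTo vertexAt {suc (suc m)} ≤-refl)
                 (trans vertexAt-last (sym (lookupOr-applyUpTo {d = 0} vertexAt {suc (suc m)} z<s))) }

  walkOf< : All (_< k) walkOf
  walkOf< = All-fromLookupOr 0 walkOf λ {i} i< →
    subst (_< k) (sym (lookupOr-applyUpTo vertexAt {suc (suc m)}
      (subst (i <_) (length-applyUpTo vertexAt (suc (suc m))) i<))) (vertexAt< i)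

embeds⇒chordedTrail : ∀ {k n} (j : Fin n) → EmbedsInKStar j k → ∃ (ChordedTrail k n (toℕ j))
embeds⇒chordedTrail {n = suc m} j (f , injective) =
  walkOf f , chordedTrail length≡ (walkOf< f) closed (traces-injective⇒distinct j (walkOf-traces f) injective)
  where open Traces (walkOf-traces f)

embeds⇔chordedTrail : ∀ {k n} (j : Fin n) → EmbedsInKStar j k ⇔ ∃ (ChordedTrail k n (toℕ j))
embeds⇔chordedTrail j = mk⇔ (embeds⇒chordedTrail j) (λ (U , T) → chordedTrail⇒embeds j T)

triangle : ℕ → ℕ
triangle zero = 0
triangle (suc k) = suc k + triangle k

suc[k]C2≡triangle : ∀ k → suc k C 2 ≡ triangle k
suc[k]C2≡triangle zero = refl
suc[k]C2≡triangle (suc k) =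
  trans (sym (nCk+nC[k+1]≡[n+1]C[k+1] (suc k) 1)) (cong₂ _+_ (nC1≡n (suc k)) (suc[k]C2≡triangle k))

column : ℕ → ℕ → ℕ → List (ℕ × ℕ)
column b s zero = []
column b s (suc m) = (s , b) ∷ column b (suc s) m

allEdges : ℕ → List (ℕ × ℕ)
allEdges zero = []
allEdges (suc k) = allEdges k ++ column k 0 (suc k)

length-column : ∀ b s m → length (column b s m) ≡ m
length-column b s zero = refl
length-column b s (suc m) = cong suc (length-column b (suc s) m)

length-allEdges : ∀ k → length (allEdges k) ≡ triangle k
length-allEdges zero = refl
length-allEdges (suc k) = begin
  length (allEdges k ++ column k 0 (suc k))
    ≡⟨ length-++ (allEdges k) ⟩
  length (allEdges k) + length (column k 0 (suc k))
    ≡⟨ cong₂ _+_ (length-allEdges k) (length-column k 0 (suc k)) ⟩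
  triangle k + suc k
    ≡⟨ +-comm (triangle k) (suc k) ⟩
  triangle (suc k) ∎
  where open ≡-Reasoning

∈-column⁻ : ∀ {b s m x} → x ∈ column b s m → proj₂ x ≡ b × s ≤ proj₁ x × proj₁ x < s + m
∈-column⁻ {s = s} {suc m} (here refl) = refl , ≤-refl , subst (s <_) (sym (+-suc s m)) (s≤s (m≤m+n s m))
∈-column⁻ {s = s} {suc m} {x} (there x∈) =
  let x₂≡b , 1+s≤x₁ , x₁<1+s+m = ∈-column⁻ x∈
  in x₂≡b , <⇒≤ 1+s≤x₁ , subst (proj₁ x <_) (sym (+-suc s m)) x₁<1+s+m

∈-column⁺ : ∀ {b s m a} → s ≤ a → a < s + m → (a , b) ∈ column b s m
∈-column⁺ {s = s} {zero} s≤a a<s+0 = ⊥-elim (<⇒≱ (subst (_ <_) (+-identityʳ s) a<s+0) s≤a)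
∈-column⁺ {s = s} {suc m} {a} s≤a a<s+m with s ≟ a
... | yes refl = here refl
... | no s≢a = there (∈-column⁺ (≤∧≢⇒< s≤a s≢a) (subst (a <_) (+-suc s m) a<s+m))

column-unique : ∀ b s m → Unique (column b s m)
column-unique b s zero = []
column-unique b s (suc m) =
  All.tabulate (λ x∈ eq → <-irrefl (cong proj₁ eq) (proj₁ (proj₂ (∈-column⁻ x∈)))) ∷
  column-unique b (suc s) m

∈-allEdges⁻ : ∀ {k x} → x ∈ allEdges k → proj₁ x ≤ proj₂ x × proj₂ x < k
∈-allEdges⁻ {suc k} x∈ with ∈-++⁻ (allEdges k) x∈
... | inj₁ x∈′ = let x₁≤x₂ , x₂<k = ∈-allEdges⁻ {k} x∈′ in x₁≤x₂ , m<n⇒m<1+n x₂<k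
... | inj₂ x∈′ = let x₂≡k , _ , x₁<1+k = ∈-column⁻ x∈′ in
  subst (_ ≤_) (sym x₂≡k) (≤-pred x₁<1+k) , subst (_< suc k) (sym x₂≡k) ≤-refl

allEdges-unique : ∀ k → Unique (allEdges k)
allEdges-unique zero = []
allEdges-unique (suc k) = Unique.++⁺ (allEdges-unique k) (column-unique k 0 (suc k))
  λ (x∈ , x∈′) → <-irrefl (proj₁ (∈-column⁻ x∈′)) (proj₂ (∈-allEdges⁻ x∈))

∈-allEdges⁺ : ∀ {k a b} → a ≤ b → b < k → (a , b) ∈ allEdges k
∈-allEdges⁺ {suc k} {a} {b} a≤b b<1+k with b ≟ k
... | yes refl = ∈-++⁺ʳ (allEdges k) (∈-column⁺ z≤n (s≤s a≤b))
... | no b≢k = ∈-++⁺ˡ (∈-allEdges⁺ a≤b (≤∧≢⇒< (≤-pred b<1+k) b≢k))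

edge∈allEdges : ∀ {k a b} → a < k → b < k → edge a b ∈ allEdges k
edge∈allEdges {k} {a} {b} a<k b<k with ≤-<-connex a b
... | inj₁ a≤b = subst (_∈ allEdges k) (sym (edge-≤ a≤b)) (∈-allEdges⁺ a≤b b<k)
... | inj₂ b<a = subst (_∈ allEdges k) (sym (edge-> b<a)) (∈-allEdges⁺ (<⇒≤ b<a) a<k)

hits : ℕ → ℕ → ℕ
hits v a = if a ≡ᵇ v then 1 else 0

endpointHits : ℕ → ℕ × ℕ → ℕ
endpointHits v (a , b) = hits v a + hits v b

-- A loop at v counts twice.
degree : ℕ → List (ℕ × ℕ) → ℕ
degree v [] = 0
degree v (e ∷ E) = endpointHits v e + degree v E

occurrences : ℕ → List ℕ → ℕ
occurrences v [] = 0
occurrences v (a ∷ l) = hits v a + occurrences v l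

hits-≡ : ∀ v → hits v v ≡ 1
hits-≡ v with v ≡ᵇ v | ≡⇒≡ᵇ v v refl
... | true | _ = refl

hits-≢ : ∀ {v a} → a ≢ v → hits v a ≡ 0
hits-≢ {v} {a} a≢v with a ≡ᵇ v in eq
... | false = refl
... | true = ⊥-elim (a≢v (≡ᵇ⇒≡ a v (subst T (sym eq) tt)))

hits≡0⊎hits≡1 : ∀ v a → (hits v a ≡ 0 × a ≢ v) ⊎ (hits v a ≡ 1 × a ≡ v)
hits≡0⊎hits≡1 v a with a ≟ v
... | yes refl = inj₂ (hits-≡ v , refl)
... | no a≢v = inj₁ (hits-≢ a≢v , a≢v)

degree-++ : ∀ v E F → degree v (E ++ F) ≡ degree v E + degree v F
degree-++ v [] F = refl
degree-++ v (e ∷ E) F = trans (cong (endpointHits v e +_) (degree-++ v E F)) (sym (+-assoc (endpointHits v e) _ _))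

endpointHits-edge : ∀ v a b → endpointHits v (edge a b) ≡ hits v a + hits v b
endpointHits-edge v a b with edge-cases a b
... | inj₁ eq = cong (endpointHits v) eq
... | inj₂ eq = trans (cong (endpointHits v) eq) (+-comm (hits v b) (hits v a))

degree-stepEdges : ∀ v U → degree v (stepEdges U) ≡ degree v (steps U)
degree-stepEdges v U = go (steps U)
  where
  go : ∀ E → degree v (map (uncurry edge) E) ≡ degree v E
  go [] = refl
  go ((a , b) ∷ E) = cong₂ _+_ (endpointHits-edge v a b) (go E)

rangeHits : ℕ → ℕ → ℕ → ℕ
rangeHits v s zero = 0
rangeHits v s (suc m) = hits v s + rangeHits v (suc s) m

degree-column : ∀ v b s m → degree v (column b s m) ≡ rangeHits v s m + m * hits v b
degree-column v b s zero = refl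
degree-column v b s (suc m) =
  trans (cong (hits v s + hits v b +_) (degree-column v b (suc s) m)) (reorder (hits v s) (hits v b) _ m)
  where
  reorder : ∀ a h c m → a + h + (c + m * h) ≡ a + c + (h + m * h)
  reorder = solve-∀

rangeHits-< : ∀ {v s} m → v < s → rangeHits v s m ≡ 0
rangeHits-< zero v<s = refl
rangeHits-< (suc m) v<s = cong₂ _+_ (hits-≢ (>⇒≢ v<s)) (rangeHits-< m (m<n⇒m<1+n v<s))

rangeHits-∈ : ∀ {v s} m → s ≤ v → v < s + m → rangeHits v s m ≡ 1
rangeHits-∈ {v} {s} zero s≤v v<s+0 = ⊥-elim (<⇒≱ (subst (v <_) (+-identityʳ s) v<s+0) s≤v)
rangeHits-∈ {v} {s} (suc m) s≤v v<s+m with s ≟ v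
... | yes refl = cong₂ _+_ (hits-≡ s) (rangeHits-< m ≤-refl)
... | no s≢v = cong₂ _+_ (hits-≢ s≢v) (rangeHits-∈ m (≤∧≢⇒< s≤v s≢v) (subst (v <_) (+-suc s m) v<s+m))

degree-avoiding : ∀ {v} E → All (λ e → proj₁ e ≢ v × proj₂ e ≢ v) E → degree v E ≡ 0
degree-avoiding [] [] = refl
degree-avoiding ((a , b) ∷ E) ((a≢v , b≢v) ∷ avoid) =
  cong₂ _+_ (cong₂ _+_ (hits-≢ a≢v) (hits-≢ b≢v)) (degree-avoiding E avoid)

degree-allEdges-self : ∀ v → degree v (allEdges v) ≡ 0
degree-allEdges-self v = degree-avoiding (allEdges v) (All.tabulate λ e∈ →
  let e₁≤e₂ , e₂<v = ∈-allEdges⁻ e∈ in <⇒≢ (≤-<-trans e₁≤e₂ e₂<v) , <⇒≢ e₂<v)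

degree-allEdges : ∀ {v} k → v < k → degree v (allEdges k) ≡ suc k
degree-allEdges {v} (suc k) v<1+k = begin
  degree v (allEdges k ++ column k 0 (suc k))
    ≡⟨ degree-++ v (allEdges k) _ ⟩
  degree v (allEdges k) + degree v (column k 0 (suc k))
    ≡⟨ cong (degree v (allEdges k) +_) (degree-column v k 0 (suc k)) ⟩
  degree v (allEdges k) + (rangeHits v 0 (suc k) + suc k * hits v k)
    ≡⟨ cong (λ c → degree v (allEdges k) + (c + suc k * hits v k)) (rangeHits-∈ (suc k) z≤n v<1+k) ⟩
  degree v (allEdges k) + suc (suc k * hits v k)
    ≡⟨ lastColumn (v ≟ k) ⟩
  suc (suc k) ∎
  where
  open ≡-Reasoning
  lastColumn : Dec (v ≡ k) → degree v (allEdges k) + suc (suc k * hits v k) ≡ suc (suc k)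
  lastColumn (yes refl) = trans
    (cong₂ (λ d h → d + suc (suc v * h)) (degree-allEdges-self v) (hits-≡ v))
    (cong suc (*-identityʳ (suc v)))
  lastColumn (no v≢k) = trans
    (cong₂ (λ d h → d + suc (suc k * h)) (degree-allEdges k (≤∧≢⇒< (≤-pred v<1+k) v≢k)) (hits-≢ (≢-sym v≢k)))
    (trans (cong (λ z → suc k + suc z) (*-zeroʳ (suc k))) (+-comm (suc k) 1))

module _ {X : Set} where

  All-remove : ∀ {P : X → Set} (A₁ : List X) {e A₂} → All P (A₁ ++ e ∷ A₂) → All P (A₁ ++ A₂) × P e
  All-remove [] (pe ∷ ps) = ps , pe
  All-remove (x ∷ A₁) (px ∷ ps) = let ps′ , pe = All-remove A₁ ps in (px ∷ ps′) , pe

  Unique-remove : ∀ (A₁ : List X) {e A₂} → Unique (A₁ ++ e ∷ A₂) → Unique (A₁ ++ A₂) × e ∉ A₁ ++ A₂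
  Unique-remove [] (e∉ ∷ u) = u , All¬⇒¬Any e∉
  Unique-remove (x ∷ A₁) (x∉ ∷ u) =
    let x∉′ , x≢e = All-remove A₁ x∉
        u′ , e∉ = Unique-remove A₁ u
    in (x∉′ ∷ u′) , λ { (here refl) → x≢e refl ; (there e∈) → e∉ e∈ }

  ∈-remove : ∀ (A₁ : List X) {e A₂ x} → x ∈ A₁ ++ e ∷ A₂ → x ≢ e → x ∈ A₁ ++ A₂
  ∈-remove [] (here refl) x≢e = ⊥-elim (x≢e refl)
  ∈-remove [] (there x∈) _ = x∈
  ∈-remove (y ∷ A₁) (here refl) _ = here refl
  ∈-remove (y ∷ A₁) (there x∈) x≢e = there (∈-remove A₁ x∈ x≢e)

  ∈-insert : ∀ (A₁ : List X) {e A₂ x} → x ∈ A₁ ++ A₂ → x ∈ A₁ ++ e ∷ A₂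
  ∈-insert [] x∈ = there x∈
  ∈-insert (y ∷ A₁) (here refl) = here refl
  ∈-insert (y ∷ A₁) (there x∈) = there (∈-insert A₁ x∈)

  length-insert : ∀ (A₁ : List X) {e A₂} → length (A₁ ++ e ∷ A₂) ≡ suc (length (A₁ ++ A₂))
  length-insert [] = refl
  length-insert (y ∷ A₁) = cong suc (length-insert A₁)

degree-insert : ∀ v (A₁ : List (ℕ × ℕ)) {e A₂} →
                degree v (A₁ ++ e ∷ A₂) ≡ endpointHits v e + degree v (A₁ ++ A₂)
degree-insert v [] = refl
degree-insert v (y ∷ A₁) {e} {A₂} =
  trans (cong (endpointHits v y +_) (degree-insert v A₁))
        (swap (endpointHits v y) (endpointHits v e) (degree v (A₁ ++ A₂)))
  where
  swap : ∀ a b c → a + (b + c) ≡ b + (a + c)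
  swap = solve-∀

record Complement (E A : List (ℕ × ℕ)) : Set where
  field
    rest : List (ℕ × ℕ)
    length-+ : length E + length rest ≡ length A
    degree-+ : ∀ v → degree v E + degree v rest ≡ degree v A
    rest∉E : ∀ {x} → x ∈ rest → x ∉ E
    rest⊆A : ∀ {x} → x ∈ rest → x ∈ A

complement : ∀ E A → Unique E → Unique A → (∀ {x} → x ∈ E → x ∈ A) → Complement E A
complement [] A _ _ _ = record
  { rest = A ; length-+ = refl ; degree-+ = λ _ → refl ; rest∉E = λ _ () ; rest⊆A = λ x∈ → x∈ }
complement (e ∷ E) A (e∉E ∷ uE) uA E⊆A with ∈-∃++ (E⊆A (here refl))
... | A₁ , A₂ , refl = record
  { rest = rest
  ; length-+ = trans (cong suc length-+) (sym (length-insert A₁))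
  ; degree-+ = λ v → trans (+-assoc (endpointHits v e) _ _)
                       (trans (cong (endpointHits v e +_) (degree-+ v)) (sym (degree-insert v A₁)))
  ; rest∉E = λ { x∈ (here refl) → e∉A (rest⊆A x∈) ; x∈ (there x∈E) → rest∉E x∈ x∈E }
  ; rest⊆A = λ x∈ → ∈-insert A₁ (rest⊆A x∈) }
  where
  uA′ = Unique-remove A₁ uA
  e∉A = proj₂ uA′
  E⊆A′ : ∀ {x} → x ∈ E → x ∈ A₁ ++ A₂
  E⊆A′ x∈E = ∈-remove A₁ (E⊆A (there x∈E)) (λ { refl → All¬⇒¬Any e∉E x∈E })
  open Complement (complement E (A₁ ++ A₂) uE (proj₁ uA′) E⊆A′)

steps-bounded : ∀ {k} (U : List ℕ) → All (_< k) U → All (λ p → proj₁ p < k × proj₂ p < k) (steps U)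
steps-bounded [] _ = []
steps-bounded (a ∷ []) _ = []
steps-bounded (a ∷ b ∷ U) (a<k ∷ b<k ∷ U<k) = (a<k , b<k) ∷ steps-bounded (b ∷ U) (b<k ∷ U<k)

chordedEdges⊆allEdges : ∀ {k n j U} → ChordedTrail k n j U → j ≤ n →
                        ∀ {x} → x ∈ chordedEdges U j → x ∈ allEdges k
chordedEdges⊆allEdges T j≤n (here refl) = edge∈allEdges (vertex< T z≤n) (vertex< T j≤n)
chordedEdges⊆allEdges {U = U} T j≤n (there x∈) with ∈-map⁻ (uncurry edge) x∈
... | (a , b) , ab∈ , refl = let a<k , b<k = All.lookup (steps-bounded U (ChordedTrail.vertices< T)) ab∈
                             in edge∈allEdges a<k b<k

chordedTrail-bound : ∀ {k n j U} → ChordedTrail k n j U → j ≤ n → n + 1 ≤ triangle k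
chordedTrail-bound {k} {n} {j} {U} T j≤n = begin
  n + 1                                    ≡⟨ +-comm n 1 ⟩
  suc n                                    ≡⟨ sym (length-chordedEdges U j length≡) ⟩
  length (chordedEdges U j)                ≤⟨ m≤m+n _ (length rest) ⟩
  length (chordedEdges U j) + length rest  ≡⟨ trans length-+ (length-allEdges k) ⟩
  triangle k                               ∎
  where
  open ChordedTrail T
  open Complement
    (complement (chordedEdges U j) (allEdges k) distinct (allEdges-unique k) (chordedEdges⊆allEdges T j≤n))
  open ≤-Reasoning

degree-closedWalk : ∀ v u l →
  degree v (steps (u ∷ l)) + hits v u + hits v ((u ∷ l) ! length l) ≡ 2 * occurrences v (u ∷ l)
degree-closedWalk v u [] = double (hits v u)
  where
  double : ∀ h → 0 + h + h ≡ 2 * (h + 0)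
  double = solve-∀
degree-closedWalk v u (w ∷ l) = begin
  hits v u + hits v w + D + hits v u + hits v z   ≡⟨ regroup (hits v u) (hits v w) D (hits v z) ⟩
  2 * hits v u + (D + hits v w + hits v z)        ≡⟨ cong (2 * hits v u +_) (degree-closedWalk v w l) ⟩
  2 * hits v u + 2 * occurrences v (w ∷ l)        ≡⟨ sym (*-distribˡ-+ 2 (hits v u) _) ⟩
  2 * occurrences v (u ∷ w ∷ l)                   ∎
  where
  open ≡-Reasoning
  D = degree v (steps (w ∷ l))
  z = (w ∷ l) ! length l
  regroup : ∀ a b d e → a + b + d + a + e ≡ 2 * a + (d + b + e)
  regroup = solve-∀

-- A vertex on a closed walk that also ends one extra edge has odd degree, so the degree d completing it
-- to an even total is odd.
odd-gap : ∀ D h c d e → D + h + h ≡ 2 * c → 1 + D + d ≡ 2 * e → ∀ y → d ≢ 2 * y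
odd-gap D h c d e walk total y refl = even≢odd (e + h) (c + y) (begin
  2 * (e + h)                  ≡⟨ *-distribˡ-+ 2 e h ⟩
  2 * e + 2 * h                ≡⟨ cong (_+ 2 * h) (sym total) ⟩
  1 + D + 2 * y + 2 * h        ≡⟨ regroup D h y ⟩
  1 + (D + h + h) + 2 * y      ≡⟨ cong (λ w → 1 + w + 2 * y) walk ⟩
  1 + 2 * c + 2 * y            ≡⟨ cong suc (sym (*-distribˡ-+ 2 c y)) ⟩
  suc (2 * (c + y))            ∎)
  where
  open ≡-Reasoning
  regroup : ∀ D h y → 1 + D + 2 * y + 2 * h ≡ 1 + (D + h + h) + 2 * y
  regroup = solve-∀

hits-exactly-one : ∀ v a b → (∀ y → hits v a + hits v b + 0 ≢ 2 * y) → (a ≡ v × b ≢ v) ⊎ (b ≡ v × a ≢ v)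
hits-exactly-one v a b odd with hits≡0⊎hits≡1 v a | hits≡0⊎hits≡1 v b
... | inj₁ (ha , _) | inj₁ (hb , _) = ⊥-elim (odd 0 (cong₂ (λ p q → p + q + 0) ha hb))
... | inj₂ (ha , _) | inj₂ (hb , _) = ⊥-elim (odd 1 (cong₂ (λ p q → p + q + 0) ha hb))
... | inj₂ (_ , a≡v) | inj₁ (_ , b≢v) = inj₁ (a≡v , b≢v)
... | inj₁ (_ , a≢v) | inj₂ (_ , b≡v) = inj₂ (b≡v , a≢v)

at-least-two-edges : ∀ {k u x} R → u ≢ x → (∀ y → degree u R ≢ 2 * y) → (∀ y → degree x R ≢ 2 * y) →
                     edge u x ∉ R → (∀ {e} → e ∈ R → e ∈ allEdges k) → 2 ≤ length R
at-least-two-edges [] _ odd-u _ _ _ = ⊥-elim (odd-u 0 refl)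
at-least-two-edges {k} {u} {x} ((a , b) ∷ []) u≢x odd-u odd-x ux∉ ⊆allEdges
  with hits-exactly-one u a b odd-u | hits-exactly-one x a b odd-x
... | inj₁ (a≡u , _) | inj₁ (a≡x , _) = ⊥-elim (u≢x (trans (sym a≡u) a≡x))
... | inj₂ (b≡u , _) | inj₂ (b≡x , _) = ⊥-elim (u≢x (trans (sym b≡u) b≡x))
... | inj₁ (refl , _) | inj₂ (refl , _) = ⊥-elim (ux∉ (here (edge-≤ a≤b)))
  where a≤b = proj₁ (∈-allEdges⁻ {k} (⊆allEdges (here refl)))
... | inj₂ (refl , _) | inj₁ (refl , _) = ⊥-elim (ux∉ (here (trans (edge-comm b a) (edge-≤ a≤b))))
  where a≤b = proj₁ (∈-allEdges⁻ {k} (⊆allEdges (here refl)))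
at-least-two-edges (_ ∷ _ ∷ _) _ _ _ _ _ = s≤s (s≤s z≤n)

chord2Trail-bound : ∀ m {n U} → ChordedTrail (suc (2 * m)) n 2 U → 2 ≤ n → n + 3 ≤ triangle (suc (2 * m))
chord2Trail-bound m {U = _ ∷ []} (chordedTrail refl _ _ _) ()
chord2Trail-bound m {U = _ ∷ _ ∷ []} (chordedTrail refl _ _ _) (s≤s ())
chord2Trail-bound m {n} {U@(u ∷ w ∷ x ∷ l)} T 2≤n = begin
  n + 3                                    ≡⟨ +-suc n 2 ⟩
  suc n + 2                                ≡⟨ cong (_+ 2) (sym (length-chordedEdges U 2 length≡)) ⟩
  length (chordedEdges U 2) + 2            ≤⟨ +-monoʳ-≤ (length (chordedEdges U 2)) missing ⟩
  length (chordedEdges U 2) + length rest  ≡⟨ trans length-+ (length-allEdges k) ⟩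
  triangle k                               ∎
  where
  open ≤-Reasoning
  k = suc (2 * m)
  open ChordedTrail T
  open Complement
    (complement (chordedEdges U 2) (allEdges k) distinct (allEdges-unique k) (chordedEdges⊆allEdges T 2≤n))

  u≢x : u ≢ x
  u≢x refl with distinct
  ... | _ ∷ ((uw≢wu ∷ _) ∷ _) = uw≢wu (edge-comm u w)

  walk : ∀ v → degree v (steps U) + hits v u + hits v u ≡ 2 * occurrences v U
  walk v = trans (cong (λ z → degree v (steps U) + hits v u + hits v z) (sym last≡u))
                 (degree-closedWalk v u (w ∷ x ∷ l))
    where
    last≡u : U ! length (w ∷ x ∷ l) ≡ u
    last≡u = trans (cong (U !_) (suc-injective length≡)) closed

  oddAt : ∀ v → v < k → hits v u + hits v x ≡ 1 → ∀ y → degree v rest ≢ 2 * y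
  oddAt v v<k one =
    odd-gap (degree v (steps U)) (hits v u) (occurrences v U) (degree v rest) (suc m) (walk v) (begin-equality
    1 + degree v (steps U) + degree v rest
      ≡⟨ cong₂ (λ h d → h + d + degree v rest) (sym (trans (endpointHits-edge v u x) one))
               (sym (degree-stepEdges v U)) ⟩
    degree v (chordedEdges U 2) + degree v rest
      ≡⟨ degree-+ v ⟩
    degree v (allEdges k)
      ≡⟨ degree-allEdges k v<k ⟩
    suc k
      ≡⟨ sym (*-suc 2 m) ⟩
    2 * suc m ∎)

  missing : 2 ≤ length rest
  missing = at-least-two-edges rest u≢x
    (oddAt u (vertex< T z≤n) (cong₂ _+_ (hits-≡ u) (hits-≢ (≢-sym u≢x))))
    (oddAt x (vertex< T 2≤n) (cong₂ _+_ (hits-≢ u≢x) (hits-≡ x)))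
    (λ ux∈ → rest∉E ux∈ (here refl)) rest⊆A

steps-++ : ∀ A y B → steps (A ++ y ∷ B) ≡ steps (A ++ y ∷ []) ++ steps (y ∷ B)
steps-++ [] y B = refl
steps-++ (a ∷ []) y B = refl
steps-++ (a ∷ a′ ∷ A) y B = cong ((a , a′) ∷_) (steps-++ (a′ ∷ A) y B)

stepEdges-++ : ∀ A y B → stepEdges (A ++ y ∷ B) ≡ stepEdges (A ++ y ∷ []) ++ stepEdges (y ∷ B)
stepEdges-++ A y B = trans (cong (map (uncurry edge)) (steps-++ A y B)) (map-++ (uncurry edge) (steps (A ++ y ∷ [])) _)

Unique-insert : ∀ {X : Set} (A : List X) {B M : List X} → Unique (A ++ B) → Unique M →
                (∀ {e} → e ∈ M → e ∉ A ++ B) → Unique (A ++ M ++ B)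
Unique-insert [] uB uM disjoint = Unique.++⁺ uM uB (λ (e∈M , e∈B) → disjoint e∈M e∈B)
Unique-insert (a ∷ A) {B} {M} (a∉ ∷ u) uM disjoint =
  All.tabulate a≢ ∷ Unique-insert A u uM (λ e∈M e∈ → disjoint e∈M (there e∈))
  where
  a≢ : ∀ {v} → v ∈ A ++ M ++ B → a ≢ v
  a≢ v∈ with ∈-++⁻ A v∈
  ... | inj₁ v∈A = All.lookup a∉ (∈-++⁺ˡ v∈A)
  ... | inj₂ v∈MB with ∈-++⁻ M v∈MB
  ... | inj₁ v∈M = λ { refl → disjoint v∈M (here refl) }
  ... | inj₂ v∈B = All.lookup a∉ (∈-++⁺ʳ A v∈B)

,-≢ˡ : ∀ {u v w y : ℕ} → u ≢ w → (u , v) ≢ (w , y)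
,-≢ˡ u≢w refl = u≢w refl

,-≢ʳ : ∀ {u v w y : ℕ} → v ≢ y → (u , v) ≢ (w , y)
,-≢ʳ v≢y refl = v≢y refl

-- skip x p is the p-th natural number different from x.
skip : ℕ → ℕ → ℕ
skip x p = if p <ᵇ x then p else suc p

skip-cases : ∀ x p → (skip x p ≡ p × p < x) ⊎ (skip x p ≡ suc p × x ≤ p)
skip-cases x p with p <ᵇ x in eq
... | true = inj₁ (refl , <ᵇ⇒< p x (subst T (sym eq) tt))
... | false = inj₂ (refl , ≮⇒≥ (λ p<x → subst T eq (<⇒<ᵇ p<x)))

skip-< : ∀ x {p q} → p < q → skip x p < skip x q
skip-< x {p} {q} p<q with skip-cases x p | skip-cases x q
... | inj₁ (eq₁ , _) | inj₁ (eq₂ , _) = subst₂ _<_ (sym eq₁) (sym eq₂) p<q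
... | inj₁ (eq₁ , _) | inj₂ (eq₂ , _) = subst₂ _<_ (sym eq₁) (sym eq₂) (m<n⇒m<1+n p<q)
... | inj₂ (_ , x≤p) | inj₁ (_ , q<x) = ⊥-elim (<-irrefl refl (≤-<-trans x≤p (<-trans p<q q<x)))
... | inj₂ (eq₁ , _) | inj₂ (eq₂ , _) = subst₂ _<_ (sym eq₁) (sym eq₂) (s≤s p<q)

skip-≢ : ∀ x p → skip x p ≢ x
skip-≢ x p eq with skip-cases x p
... | inj₁ (eq′ , p<x) = <-irrefl (trans (sym eq′) eq) p<x
... | inj₂ (eq′ , x≤p) = <-irrefl (sym (trans (sym eq′) eq)) (s≤s x≤p)

skip-≤ : ∀ x p → skip x p ≤ suc p
skip-≤ x p with skip-cases x p
... | inj₁ (eq , _) = subst (_≤ suc p) (sym eq) (n≤1+n p)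
... | inj₂ (eq , _) = subst (_≤ suc p) (sym eq) ≤-refl

<⇒<2+ : ∀ {y K} → y < K → y < 2 + K
<⇒<2+ {K = K} y<K = <-≤-trans y<K (m≤n+m K 2)

double-≤ : ∀ s t → 2 + 2 * s ≤ 2 * (s + suc t)
double-≤ s t = subst (2 + 2 * s ≤_) (regroup s t) (m≤m+n (2 + 2 * s) (2 * t))
  where
  regroup : ∀ s t → 2 + 2 * s + 2 * t ≡ 2 * (s + suc t)
  regroup = solve-∀

double-shift : ∀ s t → 2 * (suc s + t) ≡ 2 * (s + suc t)
double-shift s t = cong (2 *_) (sym (+-suc s t))

-- zigzag c d s t = z₀ d z₁ c z₂ d z₃ c …: from c, 4t steps alternating between the new vertices c, d
-- through the old vertices zᵢ = skip x (2s + i), which are all different from x.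
module Zigzag (K x : ℕ) where

  zigzag : ℕ → ℕ → ℕ → ℕ → List ℕ
  zigzag c d s zero = []
  zigzag c d s (suc t) = skip x (2 * s) ∷ d ∷ skip x (suc (2 * s)) ∷ c ∷ zigzag c d (suc s) t

  zigzagEdges : ℕ → ℕ → ℕ → ℕ → List (ℕ × ℕ)
  zigzagEdges c d s zero = []
  zigzagEdges c d s (suc t) =
    (skip x (2 * s) , c) ∷ (skip x (2 * s) , d) ∷ (skip x (suc (2 * s)) , d) ∷ (skip x (suc (2 * s)) , c) ∷
    zigzagEdges c d (suc s) t

  length-zigzag : ∀ c d s t → length (zigzag c d s t) ≡ 4 * t
  length-zigzag c d s zero = refl
  length-zigzag c d s (suc t) = trans (cong (4 +_) (length-zigzag c d (suc s) t)) (sym (*-suc 4 t))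

  skip<K : ∀ s t {p} → p ≤ suc (2 * s) → 2 * (s + suc t) < K → skip x p < K
  skip<K s t {p} p≤ bound = ≤-<-trans (≤-trans (skip-≤ x p) (≤-trans (s≤s p≤) (double-≤ s t))) bound

  zigzag< : ∀ c d s t → c < suc (suc K) → d < suc (suc K) → 2 * (s + t) < K →
            All (_< suc (suc K)) (zigzag c d s t)
  zigzag< c d s zero c< d< bound = []
  zigzag< c d s (suc t) c< d< bound =
    <⇒<2+ (skip<K s t (n≤1+n _) bound) ∷ d< ∷ <⇒<2+ (skip<K s t ≤-refl bound) ∷ c< ∷
    zigzag< c d (suc s) t c< d< (subst (_< K) (sym (double-shift s t)) bound)

  stepEdges-zigzag : ∀ c d s t R → K ≤ c → K ≤ d → 2 * (s + t) < K →
                     stepEdges (c ∷ zigzag c d s t ++ R) ≡ zigzagEdges c d s t ++ stepEdges (c ∷ R)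
  stepEdges-zigzag c d s zero R K≤c K≤d bound = refl
  stepEdges-zigzag c d s (suc t) R K≤c K≤d bound =
    cong₂ _∷_ (edge-> (<-≤-trans z<K K≤c)) (cong₂ _∷_ (edge-≤ (<⇒≤ (<-≤-trans z<K K≤d)))
    (cong₂ _∷_ (edge-> (<-≤-trans z′<K K≤d)) (cong₂ _∷_ (edge-≤ (<⇒≤ (<-≤-trans z′<K K≤c)))
      (stepEdges-zigzag c d (suc s) t R K≤c K≤d (subst (_< K) (sym (double-shift s t)) bound)))))
    where
    z<K = skip<K s t (n≤1+n _) bound
    z′<K = skip<K s t ≤-refl bound

  ∈-zigzagEdges⁻ : ∀ {c d s t e} → e ∈ zigzagEdges c d s t →
                   ∃ λ p → 2 * s ≤ p × p < 2 * (s + t) × proj₁ e ≡ skip x p × (proj₂ e ≡ c ⊎ proj₂ e ≡ d)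
  ∈-zigzagEdges⁻ {s = s} {suc t} (here refl) =
    2 * s , ≤-refl , <-≤-trans (n<1+n _) (<⇒≤ (double-≤ s t)) , refl , inj₁ refl
  ∈-zigzagEdges⁻ {s = s} {suc t} (there (here refl)) =
    2 * s , ≤-refl , <-≤-trans (n<1+n _) (<⇒≤ (double-≤ s t)) , refl , inj₂ refl
  ∈-zigzagEdges⁻ {s = s} {suc t} (there (there (here refl))) =
    suc (2 * s) , n≤1+n _ , double-≤ s t , refl , inj₂ refl
  ∈-zigzagEdges⁻ {s = s} {suc t} (there (there (there (here refl)))) =
    suc (2 * s) , n≤1+n _ , double-≤ s t , refl , inj₁ refl
  ∈-zigzagEdges⁻ {s = s} {suc t} (there (there (there (there e∈)))) =
    let p , lower , upper , e₁≡ , e₂≡ = ∈-zigzagEdges⁻ e∈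
    in p , ≤-trans (*-monoʳ-≤ 2 (n≤1+n s)) lower , subst (p <_) (double-shift s t) upper , e₁≡ , e₂≡

  zigzagEdges-avoid : ∀ c d s t {q} → q < 2 * s → All (λ e → proj₁ e ≢ skip x q) (zigzagEdges c d s t)
  zigzagEdges-avoid c d s t q<2s = All.tabulate λ e∈ eq →
    let p , lower , _ , e₁≡ , _ = ∈-zigzagEdges⁻ e∈
    in <-irrefl (trans (sym eq) e₁≡) (skip-< x (<-≤-trans q<2s lower))

  zigzagEdges-unique : ∀ c d s t → c ≢ d → Unique (zigzagEdges c d s t)
  zigzagEdges-unique c d s zero c≢d = []
  zigzagEdges-unique c d s (suc t) c≢d =
    (,-≢ʳ c≢d ∷ ,-≢ˡ z≢z′ ∷ ,-≢ˡ z≢z′ ∷ avoiding (zigzagEdges-avoid c d (suc s) t 2s<)) ∷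
    (,-≢ˡ z≢z′ ∷ ,-≢ˡ z≢z′ ∷ avoiding (zigzagEdges-avoid c d (suc s) t 2s<)) ∷
    (,-≢ʳ (≢-sym c≢d) ∷ avoiding (zigzagEdges-avoid c d (suc s) t 2s+1<)) ∷
    avoiding (zigzagEdges-avoid c d (suc s) t 2s+1<) ∷
    zigzagEdges-unique c d (suc s) t c≢d
    where
    z≢z′ : skip x (2 * s) ≢ skip x (suc (2 * s))
    z≢z′ eq = <-irrefl eq (skip-< x (n<1+n _))
    2s+1< : suc (2 * s) < 2 * suc s
    2s+1< = subst (suc (2 * s) <_) (sym (*-suc 2 s)) (n<1+n _)
    2s< : 2 * s < 2 * suc s
    2s< = <-trans (n<1+n _) 2s+1<
    avoiding : ∀ {q v} {l : List (ℕ × ℕ)} → All (λ e → proj₁ e ≢ q) l → All ((q , v) ≢_) l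
    avoiding = All.map λ e₁≢q eq → e₁≢q (sym (cong proj₁ eq))

-- A closed walk x ∷ inner ++ [ x ] of length L in K_{K+2}^* with distinct edges, each containing one of
-- the new vertices K and K + 1 (as edges are sorted pairs, this says K ≤ proj₂).
record NewCircuit (K x L : ℕ) : Set where
  field
    inner : List ℕ
    length≡ : length (x ∷ inner) ≡ L
    vertices< : All (_< suc (suc K)) (x ∷ inner)
    distinct : Unique (stepEdges (x ∷ inner ++ x ∷ []))
    new : All (λ e → K ≤ proj₂ e) (stepEdges (x ∷ inner ++ x ∷ []))

module Circuits (K x : ℕ) (x<K : x < K) where
  open Zigzag K x

  a b : ℕ
  a = K
  b = suc K

  a≢b : a ≢ b
  a≢b = <⇒≢ (n<1+n K)

  xa xb : ℕ × ℕ
  xa = (x , a)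
  xb = (x , b)

  -- Each circuit leaves x along xa, uses edges S₁, S₂ inside {a, b} and edges Z from old vertices
  -- other than x, and returns along xb.
  shape-unique : ∀ S₁ S₂ Z → All (λ e → K ≤ proj₁ e) (S₁ ++ S₂) → Unique (S₁ ++ S₂) →
                 All (λ e → proj₁ e < K × proj₁ e ≢ x) Z → Unique Z → Unique (xa ∷ S₁ ++ Z ++ S₂ ++ xb ∷ [])
  shape-unique S₁ S₂ Z S-new S-unique Z-old Z-unique =
    All.tabulate xa≢ ∷ Unique-insert S₁ S-xb-unique Z-unique Z∉
    where
    S-or-xb : ∀ {e} → e ∈ S₁ ++ S₂ ++ xb ∷ [] → K ≤ proj₁ e ⊎ e ≡ xb
    S-or-xb e∈ with ∈-++⁻ S₁ e∈
    ... | inj₁ e∈S₁ = inj₁ (All.lookup S-new (∈-++⁺ˡ e∈S₁))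
    ... | inj₂ e∈S₂xb with ∈-++⁻ S₂ e∈S₂xb
    ... | inj₁ e∈S₂ = inj₁ (All.lookup S-new (∈-++⁺ʳ S₁ e∈S₂))
    ... | inj₂ (here refl) = inj₂ refl
    S-xb-unique : Unique (S₁ ++ S₂ ++ xb ∷ [])
    S-xb-unique = subst Unique (++-assoc S₁ S₂ (xb ∷ []))
      (Unique.++⁺ S-unique ([] ∷ []) λ { (xb∈S , here refl) → <⇒≱ x<K (All.lookup S-new xb∈S) })
    Z∉ : ∀ {e} → e ∈ Z → e ∉ S₁ ++ S₂ ++ xb ∷ []
    Z∉ e∈Z e∈ with S-or-xb e∈ | All.lookup Z-old e∈Z
    ... | inj₁ K≤e₁ | e₁<K , _ = <⇒≱ e₁<K K≤e₁
    ... | inj₂ refl | _ , x≢x = x≢x refl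
    xa≢ : ∀ {e} → e ∈ S₁ ++ Z ++ S₂ ++ xb ∷ [] → xa ≢ e
    xa≢ e∈ refl with ∈-++⁻ S₁ e∈
    ... | inj₁ xa∈S₁ = <⇒≱ x<K (All.lookup S-new (∈-++⁺ˡ xa∈S₁))
    ... | inj₂ xa∈ZS₂xb with ∈-++⁻ Z xa∈ZS₂xb
    ... | inj₁ xa∈Z = proj₂ (All.lookup Z-old xa∈Z) refl
    ... | inj₂ xa∈S₂xb with S-or-xb (∈-++⁺ʳ S₁ xa∈S₂xb)
    ... | inj₁ K≤x = <⇒≱ x<K K≤x
    ... | inj₂ ()

  circuit : ∀ {L} inner S₁ S₂ Z → stepEdges (x ∷ inner ++ x ∷ []) ≡ xa ∷ S₁ ++ Z ++ S₂ ++ xb ∷ [] →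
            length (x ∷ inner) ≡ L → All (_< suc (suc K)) (x ∷ inner) →
            All (λ e → K ≤ proj₁ e × K ≤ proj₂ e) (S₁ ++ S₂) → Unique (S₁ ++ S₂) →
            All (λ e → proj₁ e < K × proj₁ e ≢ x) Z → Unique Z → All (λ e → K ≤ proj₂ e) Z → NewCircuit K x L
  circuit inner S₁ S₂ Z shape length≡ vertices< S-new S-unique Z-old Z-unique Z-new = record
    { inner = inner ; length≡ = length≡ ; vertices< = vertices<
    ; distinct = subst Unique (sym shape) (shape-unique S₁ S₂ Z (All.map proj₁ S-new) S-unique Z-old Z-unique)
    ; new = subst (All _) (sym shape)
              (≤-refl ∷ ++⁺ (++⁻ˡ S₁ S-new₂) (++⁺ Z-new (++⁺ (++⁻ʳ S₁ S-new₂) (n≤1+n K ∷ [])))) }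
    where S-new₂ = All.map proj₂ S-new

  a< : a < suc (suc K)
  a< = m<n⇒m<1+n ≤-refl

  b< : b < suc (suc K)
  b< = ≤-refl

  x< : x < suc (suc K)
  x< = <⇒<2+ x<K

  zigzagEdges-old : ∀ c d t → 2 * t < K → All (λ e → proj₁ e < K × proj₁ e ≢ x) (zigzagEdges c d 0 t)
  zigzagEdges-old c d t bound = All.tabulate λ e∈ →
    let p , _ , p< , e₁≡ , _ = ∈-zigzagEdges⁻ e∈
    in subst (_< K) (sym e₁≡) (≤-<-trans (skip-≤ x p) (<-≤-trans (s≤s p<) bound))
     , (λ eq → skip-≢ x p (trans (sym e₁≡) eq))

  zigzagEdges-new : ∀ c d t → K ≤ c → K ≤ d → All (λ e → K ≤ proj₂ e) (zigzagEdges c d 0 t)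
  zigzagEdges-new c d t K≤c K≤d = All.tabulate λ e∈ →
    let _ , _ , _ , _ , e₂≡ = ∈-zigzagEdges⁻ e∈ in K≤ e₂≡
    where
    K≤ : ∀ {y} → y ≡ c ⊎ y ≡ d → K ≤ y
    K≤ (inj₁ refl) = K≤c
    K≤ (inj₂ refl) = K≤d

  -- x, then a walk P ++ [ b ] from a to b inside {a, b} with edges S, then zigzag back from b to x.
  viaZigzag : ∀ t → 2 * t < K → (P : List ℕ) (S : List (ℕ × ℕ)) → stepEdges (x ∷ P ++ b ∷ []) ≡ xa ∷ S →
              All (_< suc (suc K)) P → All (λ e → K ≤ proj₁ e × K ≤ proj₂ e) S → Unique S →
              NewCircuit K x (2 + length P + 4 * t)
  viaZigzag t bound P S P-edges P< S-new S-unique =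
    circuit (P ++ b ∷ zigzag b a 0 t) S [] (zigzagEdges b a 0 t) shape length≡
      (x< ∷ ++⁺ P< (b< ∷ zigzag< b a 0 t b< a< bound))
      (subst (All _) (sym (++-identityʳ S)) S-new) (subst Unique (sym (++-identityʳ S)) S-unique)
      (zigzagEdges-old b a t bound) (zigzagEdges-unique b a 0 t (≢-sym a≢b))
      (zigzagEdges-new b a t (n≤1+n K) ≤-refl)
    where
    shape : stepEdges (x ∷ (P ++ b ∷ zigzag b a 0 t) ++ x ∷ []) ≡ xa ∷ S ++ zigzagEdges b a 0 t ++ xb ∷ []
    shape = begin
      stepEdges (x ∷ (P ++ b ∷ zigzag b a 0 t) ++ x ∷ [])
        ≡⟨ cong (λ l → stepEdges (x ∷ l)) (++-assoc P (b ∷ zigzag b a 0 t) (x ∷ [])) ⟩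
      stepEdges ((x ∷ P) ++ b ∷ zigzag b a 0 t ++ x ∷ [])
        ≡⟨ stepEdges-++ (x ∷ P) b (zigzag b a 0 t ++ x ∷ []) ⟩
      stepEdges (x ∷ P ++ b ∷ []) ++ stepEdges (b ∷ zigzag b a 0 t ++ x ∷ [])
        ≡⟨ cong₂ _++_ P-edges (stepEdges-zigzag b a 0 t (x ∷ []) (n≤1+n K) ≤-refl bound) ⟩
      (xa ∷ S) ++ zigzagEdges b a 0 t ++ edge b x ∷ []
        ≡⟨ cong (λ e → xa ∷ S ++ zigzagEdges b a 0 t ++ e ∷ []) (edge-> (m<n⇒m<1+n x<K)) ⟩
      xa ∷ S ++ zigzagEdges b a 0 t ++ xb ∷ [] ∎
      where open ≡-Reasoning
    length≡ : length (x ∷ P ++ b ∷ zigzag b a 0 t) ≡ 2 + length P + 4 * t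
    length≡ = cong suc (trans (length-++ P) (trans (cong (λ l → length P + suc l) (length-zigzag b a 0 t))
                (+-suc (length P) (4 * t))))

  xa≡ : edge x a ≡ xa
  xa≡ = edge-≤ (<⇒≤ x<K)

  ab≡ : edge a b ≡ (a , b)
  ab≡ = edge-≤ (n≤1+n K)

  loop≡ : ∀ y → edge y y ≡ (y , y)
  loop≡ y = edge-≤ ≤-refl

  circuit₀ : ∀ t → 2 * t < K → NewCircuit K x (3 + 4 * t)
  circuit₀ t bound = viaZigzag t bound (a ∷ []) ((a , b) ∷ [])
    (cong₂ _∷_ xa≡ (cong (_∷ []) ab≡)) (a< ∷ []) ((≤-refl , n≤1+n K) ∷ []) ([] ∷ [])

  circuit₁ : ∀ t → 2 * t < K → NewCircuit K x (4 + 4 * t)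
  circuit₁ t bound = viaZigzag t bound (a ∷ a ∷ []) ((a , a) ∷ (a , b) ∷ [])
    (cong₂ _∷_ xa≡ (cong₂ _∷_ (loop≡ a) (cong (_∷ []) ab≡))) (a< ∷ a< ∷ [])
    ((≤-refl , ≤-refl) ∷ (≤-refl , n≤1+n K) ∷ []) ((,-≢ʳ a≢b ∷ []) ∷ [] ∷ [])

  circuit₂ : ∀ t → 2 * t < K → NewCircuit K x (5 + 4 * t)
  circuit₂ t bound = viaZigzag t bound (a ∷ a ∷ b ∷ []) ((a , a) ∷ (a , b) ∷ (b , b) ∷ [])
    (cong₂ _∷_ xa≡ (cong₂ _∷_ (loop≡ a) (cong₂ _∷_ ab≡ (cong (_∷ []) (loop≡ b))))) (a< ∷ a< ∷ b< ∷ [])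
    ((≤-refl , ≤-refl) ∷ (≤-refl , n≤1+n K) ∷ (n≤1+n K , n≤1+n K) ∷ [])
    ((,-≢ʳ a≢b ∷ ,-≢ˡ a≢b ∷ []) ∷ (,-≢ˡ a≢b ∷ []) ∷ [] ∷ [])

  -- x a a, zigzag back to a, then through one more old vertex z to b b x.
  circuit₃ : ∀ t → suc (2 * t) < K → NewCircuit K x (6 + 4 * t)
  circuit₃ t bound = circuit inner ((a , a) ∷ []) ((b , b) ∷ []) Z shape length≡
    (x< ∷ a< ∷ a< ∷ ++⁺ (zigzag< a b 0 t a< b< bound′) (<⇒<2+ z<K ∷ b< ∷ b< ∷ []))
    ((≤-refl , ≤-refl) ∷ (n≤1+n K , n≤1+n K) ∷ []) ((,-≢ˡ a≢b ∷ []) ∷ [] ∷ [])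
    (++⁺ (zigzagEdges-old a b t bound′) ((z<K , skip-≢ x (2 * t)) ∷ (z<K , skip-≢ x (2 * t)) ∷ []))
    (Unique.++⁺ (zigzagEdges-unique a b 0 t a≢b) ((,-≢ʳ a≢b ∷ []) ∷ [] ∷ []) z∉zigzag)
    (++⁺ (zigzagEdges-new a b t ≤-refl (n≤1+n K)) (≤-refl ∷ n≤1+n K ∷ []))
    where
    z = skip x (2 * t)
    bound′ : 2 * t < K
    bound′ = <-trans (n<1+n _) bound
    z<K : z < K
    z<K = ≤-<-trans (skip-≤ x (2 * t)) bound
    inner = a ∷ a ∷ (zigzag a b 0 t ++ z ∷ b ∷ b ∷ [])
    Z = zigzagEdges a b 0 t ++ (z , a) ∷ (z , b) ∷ []
    z∉zigzag : ∀ {e} → e ∈ zigzagEdges a b 0 t × e ∈ (z , a) ∷ (z , b) ∷ [] → ⊥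
    z∉zigzag (e∈ , e∈′) with ∈-zigzagEdges⁻ e∈
    ... | p , _ , p<2t , e₁≡ , _ = <-irrefl (trans (sym e₁≡) (e₁≡z e∈′)) (skip-< x p<2t)
      where
      e₁≡z : ∀ {e} → e ∈ (z , a) ∷ (z , b) ∷ [] → proj₁ e ≡ z
      e₁≡z (here refl) = refl
      e₁≡z (there (here refl)) = refl
    length≡ : length (x ∷ inner) ≡ 6 + 4 * t
    length≡ = cong (3 +_) (trans (length-++ (zigzag a b 0 t))
                (trans (cong (_+ 3) (length-zigzag a b 0 t)) (+-comm (4 * t) 3)))
    shape : stepEdges (x ∷ inner ++ x ∷ []) ≡ xa ∷ (a , a) ∷ [] ++ Z ++ (b , b) ∷ [] ++ xb ∷ []
    shape = cong₂ _∷_ xa≡ (cong₂ _∷_ (loop≡ a) (begin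
      stepEdges (a ∷ (zigzag a b 0 t ++ z ∷ b ∷ b ∷ []) ++ x ∷ [])
        ≡⟨ cong (λ l → stepEdges (a ∷ l)) (++-assoc (zigzag a b 0 t) (z ∷ b ∷ b ∷ []) (x ∷ [])) ⟩
      stepEdges (a ∷ zigzag a b 0 t ++ z ∷ b ∷ b ∷ x ∷ [])
        ≡⟨ stepEdges-zigzag a b 0 t (z ∷ b ∷ b ∷ x ∷ []) ≤-refl (n≤1+n K) bound′ ⟩
      zigzagEdges a b 0 t ++ edge a z ∷ edge z b ∷ edge b b ∷ edge b x ∷ []
        ≡⟨ cong (zigzagEdges a b 0 t ++_) (cong₂ _∷_ (edge-> z<K) (cong₂ _∷_ (edge-≤ (<⇒≤ (m<n⇒m<1+n z<K)))
             (cong₂ _∷_ (loop≡ b) (cong (_∷ []) (edge-> (m<n⇒m<1+n x<K)))))) ⟩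
      zigzagEdges a b 0 t ++ (z , a) ∷ (z , b) ∷ (b , b) ∷ xb ∷ []
        ≡⟨ sym (++-assoc (zigzagEdges a b 0 t) ((z , a) ∷ (z , b) ∷ []) ((b , b) ∷ xb ∷ [])) ⟩
      Z ++ (b , b) ∷ xb ∷ [] ∎))
      where open ≡-Reasoning

-- A circuit using all 2K + 3 new edges needs the new vertices to have even degree K + 3: K must be odd.
newCircuit : ∀ {K x L} → Odd K → x < K → 3 ≤ L → L ≤ 2 * K + 3 → NewCircuit K x L
newCircuit {x = x} {suc (suc (suc q))} (m , refl) x<K (s≤s (s≤s (s≤s _))) L≤ =
  subst (NewCircuit _ x) (cong (3 +_) (sym q≡)) (byResidue (q % 4) (m%n<n q 4) (subst (_≤ 2 + 4 * m) q≡ q≤))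
  where
  open Circuits _ x x<K
  t = q / 4
  q≡ : q ≡ q % 4 + 4 * t
  q≡ = trans (m≡m%n+[m/n]*n q 4) (cong (q % 4 +_) (*-comm t 4))
  q≤ : q ≤ 2 + 4 * m
  q≤ = +-cancelˡ-≤ 3 q (2 + 4 * m) (subst (3 + q ≤_) (rearrange m) L≤)
    where
    rearrange : ∀ m → 2 * suc (2 * m) + 3 ≡ 3 + (2 + 4 * m)
    rearrange = solve-∀
  4t<4[1+m] : ∀ r → r + 4 * t ≤ 2 + 4 * m → 4 * t < 4 * suc m
  4t<4[1+m] r bound = begin-strict
    4 * t          ≤⟨ m≤n+m (4 * t) r ⟩
    r + 4 * t      ≤⟨ bound ⟩
    2 + 4 * m      <⟨ m<n+m (2 + 4 * m) {2} z<s ⟩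
    2 + (2 + 4 * m) ≡⟨ sym (*-suc 4 m) ⟩
    4 * suc m      ∎
    where open ≤-Reasoning
  2t<K : ∀ r → r + 4 * t ≤ 2 + 4 * m → 2 * t < suc (2 * m)
  2t<K r bound = s≤s (*-monoʳ-≤ 2 (≤-pred (*-cancelˡ-< 4 t (suc m) (4t<4[1+m] r bound))))
  1+2t<K : 3 + 4 * t ≤ 2 + 4 * m → suc (2 * t) < suc (2 * m)
  1+2t<K bound = s≤s (*-monoʳ-< 2 (*-cancelˡ-< 4 t m (≤-pred (≤-pred bound))))
  byResidue : ∀ r → r < 4 → r + 4 * t ≤ 2 + 4 * m → NewCircuit (suc (2 * m)) x (3 + (r + 4 * t))
  byResidue 0 _ bound = circuit₀ t (2t<K 0 bound)
  byResidue 1 _ bound = circuit₁ t (2t<K 1 bound)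
  byResidue 2 _ bound = circuit₂ t (2t<K 2 bound)
  byResidue 3 _ bound = circuit₃ t (1+2t<K bound)
  byResidue (suc (suc (suc (suc _)))) (s≤s (s≤s (s≤s (s≤s ())))) _

!-++ʳ : ∀ A B i → (A ++ B) ! (length A + i) ≡ B ! i
!-++ʳ [] B i = refl
!-++ʳ (a ∷ A) B i = !-++ʳ A B i

!-++ˡ : ∀ A B {i} → i < length A → (A ++ B) ! i ≡ A ! i
!-++ˡ (a ∷ A) B {zero} _ = refl
!-++ˡ (a ∷ A) B {suc i} i<A = !-++ˡ A B (s<s⁻¹ i<A)

!-length : ∀ A B → (A ++ B) ! length A ≡ B ! 0
!-length A B = trans (cong ((A ++ B) !_) (sym (+-identityʳ (length A)))) (!-++ʳ A B 0)

split-at : ∀ (U : List ℕ) {j} → j < length U → ∃ λ T → ∃ λ R → length T ≡ j × U ≡ T ++ U ! j ∷ R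
split-at (u ∷ U) {zero} _ = [] , U , refl , refl
split-at (u ∷ U) {suc j} j<U with split-at U (s<s⁻¹ j<U)
... | T , R , |T|≡j , U≡ = u ∷ T , R , cong suc |T|≡j , cong (u ∷_) U≡

splice : ∀ {k n} T x R W → ChordedTrail k n (length T) (T ++ x ∷ R) → 1 ≤ length T →
         All (_< k) (x ∷ W) → Unique (stepEdges (x ∷ W ++ x ∷ [])) →
         (∀ {e} → e ∈ stepEdges (x ∷ W ++ x ∷ []) → e ∉ chordedEdges (T ++ x ∷ R) (length T)) →
         ∀ j → (T ++ (x ∷ W) ++ x ∷ R) ! j ≡ x →
         ChordedTrail k (n + length (x ∷ W)) j (T ++ (x ∷ W) ++ x ∷ R)
splice {k} {n} T x R W trail 1≤T W< W-distinct W-new j U′!j≡x =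
  chordedTrail length≡′ vertices<′ closed′ (subst Unique (cong₂ _∷_ chord≡ (sym stepEdges-U′)) distinct′)
  where
  open ChordedTrail trail
  U = T ++ x ∷ R
  U′ = T ++ (x ∷ W) ++ x ∷ R
  L = length (x ∷ W)

  n≡ : n ≡ length T + length R
  n≡ = suc-injective (trans (sym length≡) (trans (length-++ T) (+-suc (length T) (length R))))

  length≡′ : length U′ ≡ suc (n + L)
  length≡′ = trans (length-++ T) (trans (cong (length T +_) (length-++ (x ∷ W)))
    (trans (regroup (length T) L (length R)) (cong (λ z → suc (z + L)) (sym n≡))))
    where
    regroup : ∀ a b c → a + (b + suc c) ≡ suc (a + c + b)
    regroup = solve-∀

  vertices<′ : All (_< k) U′
  vertices<′ = ++⁺ (++⁻ˡ T vertices<) (++⁺ W< (++⁻ʳ T vertices<))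

  first≡ : U′ ! 0 ≡ U ! 0
  first≡ = trans (!-++ˡ T _ 1≤T) (sym (!-++ˡ T _ 1≤T))

  last≡ : U′ ! (n + L) ≡ U ! n
  last≡ = begin
    U′ ! (n + L)                         ≡⟨ cong (U′ !_) (trans (cong (_+ L) n≡) (regroup (length T) (length R) L)) ⟩
    U′ ! (length T + (L + length R))     ≡⟨ !-++ʳ T ((x ∷ W) ++ x ∷ R) (L + length R) ⟩
    ((x ∷ W) ++ x ∷ R) ! (L + length R)  ≡⟨ !-++ʳ (x ∷ W) (x ∷ R) (length R) ⟩
    (x ∷ R) ! length R                   ≡⟨ sym (!-++ʳ T (x ∷ R) (length R)) ⟩
    U ! (length T + length R)            ≡⟨ cong (U !_) (sym n≡) ⟩
    U ! n                                ∎
    where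
    open ≡-Reasoning
    regroup : ∀ a b c → a + b + c ≡ a + (c + b)
    regroup = solve-∀

  closed′ : U′ ! (n + L) ≡ U′ ! 0
  closed′ = trans last≡ (trans closed (sym first≡))

  chord≡ : edge (U ! 0) (U ! length T) ≡ edge (U′ ! 0) (U′ ! j)
  chord≡ = cong₂ edge (sym first≡) (trans (!-length T (x ∷ R)) (sym U′!j≡x))

  before = stepEdges (T ++ x ∷ [])
  after = stepEdges (x ∷ R)
  inserted = stepEdges (x ∷ W ++ x ∷ [])

  stepEdges-U : stepEdges U ≡ before ++ after
  stepEdges-U = stepEdges-++ T x R

  stepEdges-U′ : stepEdges U′ ≡ before ++ inserted ++ after
  stepEdges-U′ = trans (stepEdges-++ T x (W ++ x ∷ R)) (cong (before ++_) (stepEdges-++ (x ∷ W) x R))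

  distinct′ : Unique (edge (U ! 0) (U ! length T) ∷ before ++ inserted ++ after)
  distinct′ = Unique-insert (chord ∷ before) (subst (λ l → Unique (chord ∷ l)) stepEdges-U distinct) W-distinct
    (λ e∈ e∈′ → W-new e∈ (subst (λ l → _ ∈ chord ∷ l) (sym stepEdges-U) e∈′))
    where chord = edge (U ! 0) (U ! length T)

ChordedTrail-lift : ∀ {k k′ n j U} → k ≤ k′ → ChordedTrail k n j U → ChordedTrail k′ n j U
ChordedTrail-lift k≤k′ (chordedTrail length≡ vertices< closed distinct) =
  chordedTrail length≡ (All.map (λ v<k → <-≤-trans v<k k≤k′) vertices<) closed distinct

-- From K_K^* to K_{K+2}^*: splice a new circuit of length L in at u_j; the chord may then end at u_j
-- before or after the circuit.
extend : ∀ {K n j L U} → Odd K → ChordedTrail K n j U → 1 ≤ j → j ≤ n → 3 ≤ L → L ≤ 2 * K + 3 →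
         ∃ (ChordedTrail (2 + K) (n + L) j) × ∃ (ChordedTrail (2 + K) (n + L) (j + L))
extend {K} {n} {j} {L} {U} odd trail 1≤j j≤n 3≤L L≤ with split-at U (position< trail j≤n)
... | T , R , refl , U≡ = (U′ , spliceAt j (!-length T ((x ∷ W) ++ x ∷ R)))
                         , (U′ , spliceAt (j + L) (subst (λ i → U′ ! (j + i) ≡ x) length≡ U′!j+|xW|≡x))
  where
  x = U ! j
  open NewCircuit (newCircuit odd (vertex< trail j≤n) 3≤L L≤) renaming (inner to W)
  U′ = T ++ (x ∷ W) ++ x ∷ R
  trail′ : ChordedTrail (2 + K) n j (T ++ x ∷ R)
  trail′ = subst (ChordedTrail (2 + K) n j) U≡ (ChordedTrail-lift (m≤n+m K 2) trail)
  W-new : ∀ {e} → e ∈ stepEdges (x ∷ W ++ x ∷ []) → e ∉ chordedEdges (T ++ x ∷ R) j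
  W-new e∈ e∈′ = <⇒≱ (proj₂ (∈-allEdges⁻ (chordedEdges⊆allEdges trail j≤n e∈U))) (All.lookup new e∈)
    where e∈U = subst (λ l → _ ∈ chordedEdges l j) (sym U≡) e∈′
  spliceAt : ∀ j′ → U′ ! j′ ≡ x → ChordedTrail (2 + K) (n + L) j′ U′
  spliceAt j′ U′!j′≡x =
    subst (λ L → ChordedTrail (2 + K) (n + L) j′ U′) length≡
      (splice T x R W trail′ 1≤j vertices< distinct W-new j′ U′!j′≡x)
  U′!j+|xW|≡x : U′ ! (j + length (x ∷ W)) ≡ x
  U′!j+|xW|≡x = trans (!-++ʳ T ((x ∷ W) ++ x ∷ R) (length (x ∷ W))) (!-length (x ∷ W) (x ∷ R))

<-of-sum : ∀ {a b T d} → a + b ≡ T + d → suc d ≤ b → a < T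
<-of-sum {a} {b} {T} {d} a+b≡ 1+d≤b = +-cancelʳ-< d a T (begin-strict
  a + d      <⟨ +-monoʳ-< a 1+d≤b ⟩
  a + b      ≡⟨ a+b≡ ⟩
  T + d      ∎)
  where open ≤-Reasoning

-- The arithmetic of the induction step for j ≥ 3: a pair (p, q) just above the range T of the smaller
-- graph is a pair in that range with one side lengthened by L ∈ [3, c].
split-pair : ∀ {T c p q} → 3 ≤ c → c + 10 < T → 3 ≤ p → 3 ≤ q → T ≤ p + q → p + q < T + c →
             ∃₂ (λ L q′ → 3 ≤ L × L ≤ c × 3 ≤ q′ × p + q′ < T × q′ + L ≡ q)
             ⊎ ∃₂ (λ L p′ → 3 ≤ L × L ≤ c × 3 ≤ p′ × p′ + q < T × p′ + L ≡ p)
split-pair {T} {c} {p} {q} 3≤c c+10<T 3≤p 3≤q T≤p+q p+q<T+c with m≤n⇒∃[o]m+o≡n T≤p+q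
... | d , T+d≡p+q = pick (L + 3 ≤? q) (L + 3 ≤? p)
  where
  L = 3 ⊔ suc d
  d<c : d < c
  d<c = +-cancelˡ-< T d c (subst (_< T + c) (sym T+d≡p+q) p+q<T+c)
  3≤L : 3 ≤ L
  3≤L = m≤m⊔n 3 (suc d)
  1+d≤L : suc d ≤ L
  1+d≤L = m≤n⊔m 3 (suc d)
  L≤c : L ≤ c
  L≤c = ⊔-lub 3≤c d<c
  L≤3+d : L ≤ 3 + d
  L≤3+d = ⊔-lub (m≤m+n 3 d) (+-monoˡ-≤ d (s≤s z≤n))
  <L+3⇒≤L+2 : ∀ {r} → ¬ (L + 3 ≤ r) → r ≤ 5 + d
  <L+3⇒≤L+2 {r} ¬L+3≤r = ≤-trans (≤-pred (subst (suc r ≤_) (+-suc L 2) (≰⇒> ¬L+3≤r)))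
                                  (≤-trans (+-monoˡ-≤ 2 L≤3+d) (≤-reflexive (+-comm (3 + d) 2)))
  pick : Dec (L + 3 ≤ q) → Dec (L + 3 ≤ p) → _
  pick (yes L+3≤q) _ with m≤n⇒∃[o]m+o≡n L+3≤q
  ... | e , refl =
    inj₁ (L , 3 + e , 3≤L , L≤c , m≤m+n 3 e , <-of-sum (trans (regroup p L e) (sym T+d≡p+q)) 1+d≤L , commute L e)
    where
    regroup : ∀ p L e → p + (3 + e) + L ≡ p + (L + 3 + e)
    regroup = solve-∀
    commute : ∀ L e → 3 + e + L ≡ L + 3 + e
    commute = solve-∀
  pick (no _) (yes L+3≤p) with m≤n⇒∃[o]m+o≡n L+3≤p
  ... | e , refl =
    inj₂ (L , 3 + e , 3≤L , L≤c , m≤m+n 3 e , <-of-sum (trans (regroup q L e) (sym T+d≡p+q)) 1+d≤L , commute L e)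
    where
    regroup : ∀ q L e → 3 + e + q + L ≡ L + 3 + e + q
    regroup = solve-∀
    commute : ∀ L e → 3 + e + L ≡ L + 3 + e
    commute = solve-∀
  pick (no ¬L+3≤q) (no ¬L+3≤p) = ⊥-elim (<⇒≱ c+10<T (begin
    T                   ≤⟨ +-cancelʳ-≤ d T (10 + d) T+d≤ ⟩
    10 + d              ≤⟨ +-monoʳ-≤ 10 (<⇒≤ d<c) ⟩
    10 + c              ≡⟨ +-comm 10 c ⟩
    c + 10              ∎))
    where
    open ≤-Reasoning
    T+d≤ : T + d ≤ 10 + d + d
    T+d≤ = begin
      T + d                 ≡⟨ T+d≡p+q ⟩
      p + q                 ≤⟨ +-mono-≤ (<L+3⇒≤L+2 ¬L+3≤p) (<L+3⇒≤L+2 ¬L+3≤q) ⟩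
      (5 + d) + (5 + d)     ≡⟨ regroup d ⟩
      10 + d + d            ∎
      where
      regroup : ∀ d → (5 + d) + (5 + d) ≡ 10 + d + d
      regroup = solve-∀

-- The same for j = 2: a length n just above the range lengthens a length n′ in the range by L ∈ [3, c].
split-length : ∀ {T c n} → 3 ≤ c → 10 ≤ T → T ≤ n + 3 → n + 3 ≤ T + c →
               ∃₂ λ L n′ → 3 ≤ L × L ≤ c × 4 ≤ n′ × n′ + 3 ≤ T × n′ + L ≡ n
split-length {T} {c} {n} 3≤c 10≤T T≤n+3 n+3≤T+c with m≤n⇒∃[o]m+o≡n T≤n+3
... | d , T+d≡n+3 = result (m≤n⇒∃[o]m+o≡n (⊔-lub 3≤n d≤n))
  where
  open ≤-Reasoning
  L = 3 ⊔ d
  d≤c : d ≤ c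
  d≤c = +-cancelˡ-≤ T d c (subst (_≤ T + c) (sym T+d≡n+3) n+3≤T+c)
  d+10≤n+3 : d + 10 ≤ n + 3
  d+10≤n+3 = begin
    d + 10  ≡⟨ +-comm d 10 ⟩
    10 + d  ≤⟨ +-monoˡ-≤ d 10≤T ⟩
    T + d   ≡⟨ T+d≡n+3 ⟩
    n + 3   ∎
  3≤n : 3 ≤ n
  3≤n = +-cancelʳ-≤ 3 3 n (≤-trans (m≤n+m 6 4) (≤-trans 10≤T T≤n+3))
  d≤n : d ≤ n
  d≤n = +-cancelʳ-≤ 3 d n (≤-trans (+-monoʳ-≤ d (s≤s (s≤s (s≤s z≤n)))) d+10≤n+3)
  L≤3+d : L ≤ 3 + d
  L≤3+d = ⊔-lub (m≤m+n 3 d) (m≤n+m d 3)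
  result : ∃ (λ n′ → L + n′ ≡ n) → ∃₂ λ L n′ → 3 ≤ L × L ≤ c × 4 ≤ n′ × n′ + 3 ≤ T × n′ + L ≡ n
  result (n′ , refl) = L , n′ , m≤m⊔n 3 d , ⊔-lub 3≤c d≤c , 4≤n′ , n′+3≤T , +-comm n′ L
    where
    4≤n′ : 4 ≤ n′
    4≤n′ = +-cancelʳ-≤ 6 4 n′ (+-cancelʳ-≤ d 10 (n′ + 6) (begin
      10 + d                ≤⟨ +-monoˡ-≤ d 10≤T ⟩
      T + d                 ≡⟨ T+d≡n+3 ⟩
      L + n′ + 3            ≤⟨ +-monoˡ-≤ 3 (+-monoˡ-≤ n′ L≤3+d) ⟩
      3 + d + n′ + 3        ≡⟨ regroup d n′ ⟩
      n′ + 6 + d            ∎))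
      where
      regroup : ∀ d n′ → 3 + d + n′ + 3 ≡ n′ + 6 + d
      regroup = solve-∀
    n′+3≤T : n′ + 3 ≤ T
    n′+3≤T = +-cancelʳ-≤ L (n′ + 3) T (begin
      n′ + 3 + L            ≡⟨ regroup n′ L ⟩
      L + n′ + 3            ≡⟨ sym T+d≡n+3 ⟩
      T + d                 ≤⟨ +-monoʳ-≤ T (m≤n⊔m 3 d) ⟩
      T + L                 ∎)
      where
      regroup : ∀ n′ L → n′ + 3 + L ≡ L + n′ + 3
      regroup = solve-∀

triangle-2+ : ∀ K → triangle (2 + K) ≡ triangle K + (2 * K + 3)
triangle-2+ K = regroup K (triangle K)
  where
  regroup : ∀ K t → 2 + K + (1 + K + t) ≡ t + (2 * K + 3)
  regroup = solve-∀

triangle-large : ∀ {K} → 7 ≤ K → (2 * K + 3) + 10 < triangle K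
triangle-large 7≤K with m≤n⇒∃[o]m+o≡n 7≤K
... | i , refl = go i
  where
  go : ∀ i → (2 * (7 + i) + 3) + 10 < triangle (7 + i)
  go zero = ≤-refl
  go (suc i) = begin-strict
    2 * (8 + i) + 3 + 10              ≤⟨ m≤m+n _ (6 + i) ⟩
    2 * (8 + i) + 3 + 10 + (6 + i)    ≡⟨ regroup i ⟩
    (8 + i) + (2 * (7 + i) + 3 + 10)  <⟨ +-monoʳ-< (8 + i) (go i) ⟩
    (8 + i) + triangle (7 + i)        ∎
    where
    open ≤-Reasoning
    regroup : ∀ i → 2 * (8 + i) + 3 + 10 + (6 + i) ≡ (8 + i) + (2 * (7 + i) + 3 + 10)
    regroup = solve-∀

-- Realisations of all the embeddings claimed by the theorem in K_k^*: for j ≥ 3 as p = j, q = n − j.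
ChordTrails : ℕ → Set
ChordTrails k = ∀ p q → 3 ≤ p → 3 ≤ q → p + q < triangle k → ∃ (ChordedTrail k (p + q) p)

Chord2Trails : ℕ → Set
Chord2Trails k = ∀ n → 4 ≤ n → n + 3 ≤ triangle k → ∃ (ChordedTrail k n 2)

liftTrail : ∀ {K n j} → ∃ (ChordedTrail K n j) → ∃ (ChordedTrail (2 + K) n j)
liftTrail {K} = map₂ (ChordedTrail-lift (m≤n+m K 2))

chordTrails-step : ∀ {K} → Odd K → 7 ≤ K → ChordTrails K → ChordTrails (2 + K)
chordTrails-step {K} odd 7≤K trails p q 3≤p 3≤q p+q< with p + q <? triangle K
... | yes small = liftTrail (trails p q 3≤p 3≤q small)
... | no large with split-pair (m≤n+m 3 (2 * K)) (triangle-large 7≤K) 3≤p 3≤q (≮⇒≥ large)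
                                (subst (p + q <_) (triangle-2+ K) p+q<)
... | inj₁ (L , q′ , 3≤L , L≤ , 3≤q′ , small , refl) =
  subst (λ n → ∃ (ChordedTrail (2 + K) n p)) (+-assoc p q′ L)
    (proj₁ (extend odd (proj₂ (trails p q′ 3≤p 3≤q′ small)) (≤-trans (s≤s z≤n) 3≤p) (m≤m+n p q′) 3≤L L≤))
... | inj₂ (L , p′ , 3≤L , L≤ , 3≤p′ , small , refl) =
  subst (λ n → ∃ (ChordedTrail (2 + K) n (p′ + L))) (swap p′ q L)
    (proj₂ (extend odd (proj₂ (trails p′ q 3≤p′ 3≤q small)) (≤-trans (s≤s z≤n) 3≤p′) (m≤m+n p′ q) 3≤L L≤))
  where
  swap : ∀ a b c → a + b + c ≡ a + c + b
  swap = solve-∀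

chord2Trails-step : ∀ {K} → Odd K → 7 ≤ K → Chord2Trails K → Chord2Trails (2 + K)
chord2Trails-step {K} odd 7≤K trails n 4≤n n+3≤ with n + 3 ≤? triangle K
... | yes small = liftTrail (trails n 4≤n small)
... | no large with split-length (m≤n+m 3 (2 * K)) (≤-trans (m≤n+m 10 (2 * K + 3)) (<⇒≤ (triangle-large 7≤K)))
                                  (<⇒≤ (≰⇒> large)) (subst (n + 3 ≤_) (triangle-2+ K) n+3≤)
... | L , n′ , 3≤L , L≤ , 4≤n′ , small , refl =
  proj₁ (extend odd (proj₂ (trails n′ 4≤n′ small)) (s≤s z≤n) (≤-trans (s≤s (s≤s z≤n)) 4≤n′) 3≤L L≤)

Table : Set
Table = List (ℕ × ℕ × List ℕ)

Tabulated : ℕ → Table → ℕ → ℕ → Set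
Tabulated k rows n j = Any (λ (n′ , j′ , U) → n′ ≡ n × j′ ≡ j × ChordedTrail k n j U) rows

tabulated? : ∀ k rows n j → Dec (Tabulated k rows n j)
tabulated? k rows n j = any? (λ (n′ , j′ , U) → n′ ≟ n ×-dec j′ ≟ j ×-dec chordedTrail? k n j U) rows

Tabulated⇒∃ : ∀ {k rows n j} → Tabulated k rows n j → ∃ (ChordedTrail k n j)
Tabulated⇒∃ tab with Any.satisfied tab
... | (_ , _ , U) , (_ , _ , trail) = U , trail

TableCoversChords : ℕ → Table → Set
TableCoversChords k rows =
  ∀ (p q : Fin (triangle k)) → 3 ≤ toℕ p → 3 ≤ toℕ q → toℕ p + toℕ q < triangle k →
  Tabulated k rows (toℕ p + toℕ q) (toℕ p)

tableCoversChords? : ∀ k rows → Dec (TableCoversChords k rows)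
tableCoversChords? k rows = Fin.all? λ p → Fin.all? λ q →
  3 ≤? toℕ p →-dec 3 ≤? toℕ q →-dec toℕ p + toℕ q <? triangle k →-dec tabulated? k rows _ _

TableCoversChords⇒ChordTrails : ∀ {k rows} → TableCoversChords k rows → ChordTrails k
TableCoversChords⇒ChordTrails covers p q 3≤p 3≤q p+q<
  with covers (fromℕ< (≤-<-trans (m≤m+n p q) p+q<)) (fromℕ< (≤-<-trans (m≤n+m q p) p+q<))
... | covered rewrite toℕ-fromℕ< (≤-<-trans (m≤m+n p q) p+q<) | toℕ-fromℕ< (≤-<-trans (m≤n+m q p) p+q<) =
  Tabulated⇒∃ (covered 3≤p 3≤q p+q<)

TableCoversChord2 : ℕ → Table → Set
TableCoversChord2 k rows =
  ∀ (n : Fin (triangle k)) → 4 ≤ toℕ n → toℕ n + 3 ≤ triangle k → Tabulated k rows (toℕ n) 2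

tableCoversChord2? : ∀ k rows → Dec (TableCoversChord2 k rows)
tableCoversChord2? k rows = Fin.all? λ n →
  4 ≤? toℕ n →-dec toℕ n + 3 ≤? triangle k →-dec tabulated? k rows _ 2

TableCoversChord2⇒Chord2Trails : ∀ {k rows} → TableCoversChord2 k rows → Chord2Trails k
TableCoversChord2⇒Chord2Trails covers n 4≤n n+3≤ with covers (fromℕ< (<-≤-trans (m<m+n n {3} z<s) n+3≤))
... | covered rewrite toℕ-fromℕ< (<-≤-trans (m<m+n n {3} z<s) n+3≤) = Tabulated⇒∃ (covered 4≤n n+3≤)

-- Found by computer search; checked by evaluating the decision procedures in trailsIn5 and trailsIn7.
table₅ : Table
table₅ =
  (4 , 2 , 0 ∷ 2 ∷ 1 ∷ 4 ∷ 0 ∷ []) ∷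
  (5 , 2 , 0 ∷ 2 ∷ 1 ∷ 1 ∷ 3 ∷ 0 ∷ []) ∷
  (6 , 2 , 0 ∷ 2 ∷ 1 ∷ 1 ∷ 3 ∷ 4 ∷ 0 ∷ []) ∷
  (6 , 3 , 0 ∷ 2 ∷ 2 ∷ 1 ∷ 3 ∷ 4 ∷ 0 ∷ []) ∷
  (7 , 2 , 0 ∷ 2 ∷ 1 ∷ 1 ∷ 3 ∷ 4 ∷ 4 ∷ 0 ∷ []) ∷
  (7 , 3 , 0 ∷ 2 ∷ 2 ∷ 1 ∷ 3 ∷ 4 ∷ 4 ∷ 0 ∷ []) ∷
  (7 , 4 , 0 ∷ 2 ∷ 2 ∷ 1 ∷ 0 ∷ 4 ∷ 3 ∷ 0 ∷ []) ∷
  (8 , 2 , 0 ∷ 2 ∷ 1 ∷ 1 ∷ 3 ∷ 4 ∷ 4 ∷ 0 ∷ 0 ∷ []) ∷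
  (8 , 3 , 0 ∷ 2 ∷ 2 ∷ 1 ∷ 3 ∷ 4 ∷ 4 ∷ 0 ∷ 0 ∷ []) ∷
  (8 , 4 , 0 ∷ 2 ∷ 2 ∷ 1 ∷ 0 ∷ 4 ∷ 1 ∷ 3 ∷ 0 ∷ []) ∷
  (8 , 5 , 0 ∷ 2 ∷ 2 ∷ 1 ∷ 3 ∷ 3 ∷ 4 ∷ 4 ∷ 0 ∷ []) ∷
  (9 , 2 , 0 ∷ 2 ∷ 1 ∷ 1 ∷ 3 ∷ 4 ∷ 4 ∷ 2 ∷ 3 ∷ 0 ∷ []) ∷
  (9 , 3 , 0 ∷ 2 ∷ 2 ∷ 1 ∷ 3 ∷ 4 ∷ 4 ∷ 2 ∷ 3 ∷ 0 ∷ []) ∷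
  (9 , 4 , 0 ∷ 2 ∷ 2 ∷ 1 ∷ 0 ∷ 4 ∷ 1 ∷ 1 ∷ 3 ∷ 0 ∷ []) ∷
  (9 , 5 , 0 ∷ 2 ∷ 2 ∷ 1 ∷ 3 ∷ 3 ∷ 4 ∷ 4 ∷ 0 ∷ 0 ∷ []) ∷
  (9 , 6 , 0 ∷ 2 ∷ 2 ∷ 1 ∷ 3 ∷ 3 ∷ 0 ∷ 4 ∷ 1 ∷ 0 ∷ []) ∷
  (10 , 2 , 0 ∷ 2 ∷ 1 ∷ 1 ∷ 3 ∷ 4 ∷ 4 ∷ 2 ∷ 3 ∷ 3 ∷ 0 ∷ []) ∷
  (10 , 3 , 0 ∷ 2 ∷ 2 ∷ 1 ∷ 3 ∷ 4 ∷ 4 ∷ 2 ∷ 3 ∷ 3 ∷ 0 ∷ []) ∷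
  (10 , 4 , 0 ∷ 2 ∷ 2 ∷ 1 ∷ 0 ∷ 4 ∷ 1 ∷ 1 ∷ 3 ∷ 3 ∷ 0 ∷ []) ∷
  (10 , 5 , 0 ∷ 2 ∷ 2 ∷ 1 ∷ 3 ∷ 3 ∷ 4 ∷ 4 ∷ 1 ∷ 1 ∷ 0 ∷ []) ∷
  (10 , 6 , 0 ∷ 2 ∷ 2 ∷ 1 ∷ 3 ∷ 3 ∷ 0 ∷ 1 ∷ 1 ∷ 4 ∷ 0 ∷ []) ∷
  (10 , 7 , 0 ∷ 2 ∷ 2 ∷ 1 ∷ 3 ∷ 2 ∷ 4 ∷ 4 ∷ 1 ∷ 0 ∷ 0 ∷ []) ∷
  (11 , 2 , 0 ∷ 2 ∷ 1 ∷ 1 ∷ 3 ∷ 4 ∷ 4 ∷ 2 ∷ 3 ∷ 3 ∷ 0 ∷ 0 ∷ []) ∷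
  (11 , 3 , 0 ∷ 2 ∷ 2 ∷ 1 ∷ 3 ∷ 4 ∷ 4 ∷ 2 ∷ 3 ∷ 3 ∷ 0 ∷ 0 ∷ []) ∷
  (11 , 4 , 0 ∷ 2 ∷ 2 ∷ 1 ∷ 0 ∷ 4 ∷ 1 ∷ 3 ∷ 2 ∷ 4 ∷ 3 ∷ 0 ∷ []) ∷
  (11 , 5 , 0 ∷ 2 ∷ 2 ∷ 1 ∷ 3 ∷ 3 ∷ 4 ∷ 4 ∷ 1 ∷ 1 ∷ 0 ∷ 0 ∷ []) ∷
  (11 , 6 , 0 ∷ 2 ∷ 2 ∷ 1 ∷ 3 ∷ 3 ∷ 0 ∷ 1 ∷ 1 ∷ 4 ∷ 4 ∷ 0 ∷ []) ∷
  (11 , 7 , 0 ∷ 2 ∷ 2 ∷ 1 ∷ 3 ∷ 3 ∷ 4 ∷ 4 ∷ 2 ∷ 3 ∷ 0 ∷ 0 ∷ []) ∷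
  (11 , 8 , 0 ∷ 2 ∷ 2 ∷ 1 ∷ 3 ∷ 3 ∷ 2 ∷ 4 ∷ 4 ∷ 3 ∷ 0 ∷ 0 ∷ []) ∷
  (12 , 2 , 0 ∷ 2 ∷ 1 ∷ 1 ∷ 3 ∷ 4 ∷ 4 ∷ 2 ∷ 2 ∷ 3 ∷ 3 ∷ 0 ∷ 0 ∷ []) ∷
  (12 , 3 , 0 ∷ 2 ∷ 2 ∷ 1 ∷ 1 ∷ 3 ∷ 2 ∷ 4 ∷ 4 ∷ 3 ∷ 3 ∷ 0 ∷ 0 ∷ []) ∷
  (12 , 4 , 0 ∷ 2 ∷ 2 ∷ 1 ∷ 0 ∷ 4 ∷ 1 ∷ 1 ∷ 3 ∷ 2 ∷ 4 ∷ 3 ∷ 0 ∷ []) ∷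
  (12 , 5 , 0 ∷ 2 ∷ 2 ∷ 1 ∷ 3 ∷ 3 ∷ 2 ∷ 4 ∷ 4 ∷ 1 ∷ 1 ∷ 0 ∷ 0 ∷ []) ∷
  (12 , 6 , 0 ∷ 2 ∷ 2 ∷ 1 ∷ 3 ∷ 4 ∷ 0 ∷ 1 ∷ 4 ∷ 2 ∷ 3 ∷ 3 ∷ 0 ∷ []) ∷
  (12 , 7 , 0 ∷ 2 ∷ 2 ∷ 1 ∷ 3 ∷ 3 ∷ 2 ∷ 4 ∷ 4 ∷ 1 ∷ 1 ∷ 0 ∷ 0 ∷ []) ∷
  (12 , 8 , 0 ∷ 2 ∷ 2 ∷ 1 ∷ 3 ∷ 3 ∷ 2 ∷ 4 ∷ 0 ∷ 3 ∷ 4 ∷ 1 ∷ 0 ∷ []) ∷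
  (12 , 9 , 0 ∷ 2 ∷ 2 ∷ 1 ∷ 3 ∷ 4 ∷ 2 ∷ 3 ∷ 3 ∷ 0 ∷ 1 ∷ 4 ∷ 0 ∷ []) ∷
  (13 , 3 , 0 ∷ 2 ∷ 1 ∷ 0 ∷ 3 ∷ 2 ∷ 4 ∷ 4 ∷ 1 ∷ 1 ∷ 3 ∷ 3 ∷ 4 ∷ 0 ∷ []) ∷
  (13 , 4 , 0 ∷ 2 ∷ 2 ∷ 1 ∷ 0 ∷ 4 ∷ 1 ∷ 1 ∷ 3 ∷ 2 ∷ 4 ∷ 4 ∷ 3 ∷ 0 ∷ []) ∷
  (13 , 5 , 0 ∷ 2 ∷ 2 ∷ 1 ∷ 3 ∷ 0 ∷ 1 ∷ 4 ∷ 2 ∷ 3 ∷ 3 ∷ 4 ∷ 4 ∷ 0 ∷ []) ∷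
  (13 , 6 , 0 ∷ 2 ∷ 2 ∷ 1 ∷ 3 ∷ 4 ∷ 0 ∷ 1 ∷ 1 ∷ 4 ∷ 4 ∷ 2 ∷ 3 ∷ 0 ∷ []) ∷
  (13 , 7 , 0 ∷ 2 ∷ 2 ∷ 1 ∷ 3 ∷ 3 ∷ 4 ∷ 0 ∷ 3 ∷ 2 ∷ 4 ∷ 4 ∷ 1 ∷ 0 ∷ []) ∷
  (13 , 8 , 0 ∷ 2 ∷ 2 ∷ 1 ∷ 3 ∷ 4 ∷ 1 ∷ 1 ∷ 0 ∷ 3 ∷ 2 ∷ 4 ∷ 4 ∷ 0 ∷ []) ∷
  (13 , 9 , 0 ∷ 2 ∷ 2 ∷ 1 ∷ 3 ∷ 2 ∷ 4 ∷ 3 ∷ 3 ∷ 0 ∷ 4 ∷ 4 ∷ 1 ∷ 0 ∷ []) ∷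
  (13 , 10 , 0 ∷ 2 ∷ 2 ∷ 1 ∷ 3 ∷ 2 ∷ 4 ∷ 4 ∷ 3 ∷ 3 ∷ 0 ∷ 1 ∷ 4 ∷ 0 ∷ []) ∷
  (14 , 3 , 0 ∷ 2 ∷ 1 ∷ 0 ∷ 3 ∷ 4 ∷ 2 ∷ 2 ∷ 3 ∷ 3 ∷ 1 ∷ 1 ∷ 4 ∷ 4 ∷ 0 ∷ []) ∷
  (14 , 4 , 0 ∷ 2 ∷ 2 ∷ 1 ∷ 0 ∷ 4 ∷ 1 ∷ 1 ∷ 3 ∷ 2 ∷ 4 ∷ 4 ∷ 3 ∷ 3 ∷ 0 ∷ []) ∷
  (14 , 5 , 0 ∷ 2 ∷ 2 ∷ 1 ∷ 3 ∷ 0 ∷ 4 ∷ 2 ∷ 3 ∷ 3 ∷ 4 ∷ 4 ∷ 1 ∷ 1 ∷ 0 ∷ []) ∷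
  (14 , 6 , 0 ∷ 2 ∷ 2 ∷ 1 ∷ 3 ∷ 3 ∷ 0 ∷ 4 ∷ 2 ∷ 3 ∷ 4 ∷ 4 ∷ 1 ∷ 1 ∷ 0 ∷ []) ∷
  (14 , 7 , 0 ∷ 2 ∷ 2 ∷ 1 ∷ 3 ∷ 2 ∷ 4 ∷ 0 ∷ 1 ∷ 1 ∷ 4 ∷ 4 ∷ 3 ∷ 3 ∷ 0 ∷ []) ∷
  (14 , 8 , 0 ∷ 2 ∷ 2 ∷ 1 ∷ 3 ∷ 4 ∷ 1 ∷ 1 ∷ 0 ∷ 4 ∷ 4 ∷ 2 ∷ 3 ∷ 3 ∷ 0 ∷ []) ∷
  (14 , 9 , 0 ∷ 2 ∷ 2 ∷ 1 ∷ 3 ∷ 3 ∷ 2 ∷ 4 ∷ 3 ∷ 0 ∷ 1 ∷ 1 ∷ 4 ∷ 4 ∷ 0 ∷ []) ∷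
  (14 , 10 , 0 ∷ 2 ∷ 2 ∷ 1 ∷ 3 ∷ 2 ∷ 4 ∷ 4 ∷ 1 ∷ 1 ∷ 0 ∷ 3 ∷ 3 ∷ 4 ∷ 0 ∷ []) ∷
  (14 , 11 , 0 ∷ 2 ∷ 2 ∷ 1 ∷ 3 ∷ 3 ∷ 2 ∷ 4 ∷ 4 ∷ 1 ∷ 1 ∷ 0 ∷ 3 ∷ 4 ∷ 0 ∷ []) ∷
  []

table₇ : Table
table₇ =
  (4 , 2 , 0 ∷ 4 ∷ 1 ∷ 6 ∷ 0 ∷ []) ∷
  (5 , 2 , 0 ∷ 4 ∷ 1 ∷ 6 ∷ 2 ∷ 0 ∷ []) ∷
  (6 , 2 , 0 ∷ 4 ∷ 1 ∷ 6 ∷ 2 ∷ 3 ∷ 0 ∷ []) ∷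
  (6 , 3 , 0 ∷ 4 ∷ 1 ∷ 6 ∷ 2 ∷ 1 ∷ 0 ∷ []) ∷
  (7 , 2 , 0 ∷ 4 ∷ 1 ∷ 6 ∷ 2 ∷ 1 ∷ 5 ∷ 0 ∷ []) ∷
  (7 , 3 , 0 ∷ 4 ∷ 1 ∷ 6 ∷ 2 ∷ 1 ∷ 0 ∷ 0 ∷ []) ∷
  (7 , 4 , 0 ∷ 4 ∷ 1 ∷ 6 ∷ 2 ∷ 1 ∷ 0 ∷ 0 ∷ []) ∷
  (8 , 2 , 0 ∷ 4 ∷ 1 ∷ 6 ∷ 2 ∷ 1 ∷ 5 ∷ 6 ∷ 0 ∷ []) ∷
  (8 , 3 , 0 ∷ 4 ∷ 1 ∷ 6 ∷ 2 ∷ 1 ∷ 5 ∷ 2 ∷ 0 ∷ []) ∷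
  (8 , 4 , 0 ∷ 4 ∷ 1 ∷ 6 ∷ 2 ∷ 1 ∷ 5 ∷ 6 ∷ 0 ∷ []) ∷
  (8 , 5 , 0 ∷ 4 ∷ 1 ∷ 6 ∷ 2 ∷ 1 ∷ 5 ∷ 6 ∷ 0 ∷ []) ∷
  (9 , 2 , 0 ∷ 4 ∷ 1 ∷ 6 ∷ 2 ∷ 1 ∷ 5 ∷ 6 ∷ 6 ∷ 0 ∷ []) ∷
  (9 , 3 , 0 ∷ 4 ∷ 1 ∷ 6 ∷ 2 ∷ 1 ∷ 0 ∷ 5 ∷ 2 ∷ 0 ∷ []) ∷
  (9 , 4 , 0 ∷ 4 ∷ 1 ∷ 6 ∷ 2 ∷ 1 ∷ 0 ∷ 6 ∷ 3 ∷ 0 ∷ []) ∷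
  (9 , 5 , 0 ∷ 4 ∷ 1 ∷ 6 ∷ 2 ∷ 1 ∷ 5 ∷ 6 ∷ 6 ∷ 0 ∷ []) ∷
  (9 , 6 , 0 ∷ 4 ∷ 1 ∷ 6 ∷ 2 ∷ 1 ∷ 0 ∷ 6 ∷ 3 ∷ 0 ∷ []) ∷
  (10 , 2 , 0 ∷ 4 ∷ 1 ∷ 6 ∷ 2 ∷ 1 ∷ 5 ∷ 6 ∷ 4 ∷ 3 ∷ 0 ∷ []) ∷
  (10 , 3 , 0 ∷ 4 ∷ 1 ∷ 6 ∷ 2 ∷ 1 ∷ 0 ∷ 5 ∷ 4 ∷ 3 ∷ 0 ∷ []) ∷
  (10 , 4 , 0 ∷ 4 ∷ 1 ∷ 6 ∷ 2 ∷ 1 ∷ 0 ∷ 6 ∷ 4 ∷ 3 ∷ 0 ∷ []) ∷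
  (10 , 5 , 0 ∷ 4 ∷ 1 ∷ 6 ∷ 2 ∷ 1 ∷ 5 ∷ 6 ∷ 4 ∷ 3 ∷ 0 ∷ []) ∷
  (10 , 6 , 0 ∷ 4 ∷ 1 ∷ 6 ∷ 2 ∷ 1 ∷ 0 ∷ 6 ∷ 4 ∷ 3 ∷ 0 ∷ []) ∷
  (10 , 7 , 0 ∷ 4 ∷ 1 ∷ 6 ∷ 2 ∷ 1 ∷ 5 ∷ 2 ∷ 4 ∷ 3 ∷ 0 ∷ []) ∷
  (11 , 2 , 0 ∷ 4 ∷ 1 ∷ 6 ∷ 2 ∷ 1 ∷ 5 ∷ 6 ∷ 4 ∷ 4 ∷ 2 ∷ 0 ∷ []) ∷
  (11 , 3 , 0 ∷ 4 ∷ 1 ∷ 6 ∷ 2 ∷ 1 ∷ 0 ∷ 5 ∷ 4 ∷ 4 ∷ 2 ∷ 0 ∷ []) ∷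
  (11 , 4 , 0 ∷ 4 ∷ 1 ∷ 6 ∷ 2 ∷ 1 ∷ 0 ∷ 6 ∷ 4 ∷ 4 ∷ 3 ∷ 0 ∷ []) ∷
  (11 , 5 , 0 ∷ 4 ∷ 1 ∷ 6 ∷ 2 ∷ 1 ∷ 5 ∷ 6 ∷ 4 ∷ 4 ∷ 2 ∷ 0 ∷ []) ∷
  (11 , 6 , 0 ∷ 4 ∷ 1 ∷ 6 ∷ 2 ∷ 1 ∷ 0 ∷ 6 ∷ 4 ∷ 4 ∷ 2 ∷ 0 ∷ []) ∷
  (11 , 7 , 0 ∷ 4 ∷ 1 ∷ 6 ∷ 2 ∷ 1 ∷ 5 ∷ 2 ∷ 4 ∷ 3 ∷ 1 ∷ 0 ∷ []) ∷
  (11 , 8 , 0 ∷ 4 ∷ 1 ∷ 6 ∷ 2 ∷ 1 ∷ 0 ∷ 6 ∷ 3 ∷ 4 ∷ 2 ∷ 0 ∷ []) ∷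
  (12 , 2 , 0 ∷ 4 ∷ 1 ∷ 6 ∷ 2 ∷ 1 ∷ 5 ∷ 6 ∷ 4 ∷ 4 ∷ 2 ∷ 5 ∷ 0 ∷ []) ∷
  (12 , 3 , 0 ∷ 4 ∷ 1 ∷ 6 ∷ 2 ∷ 1 ∷ 0 ∷ 5 ∷ 4 ∷ 4 ∷ 2 ∷ 3 ∷ 0 ∷ []) ∷
  (12 , 4 , 0 ∷ 4 ∷ 1 ∷ 6 ∷ 2 ∷ 1 ∷ 0 ∷ 6 ∷ 4 ∷ 4 ∷ 2 ∷ 5 ∷ 0 ∷ []) ∷
  (12 , 5 , 0 ∷ 4 ∷ 1 ∷ 6 ∷ 2 ∷ 1 ∷ 5 ∷ 6 ∷ 4 ∷ 4 ∷ 2 ∷ 5 ∷ 0 ∷ []) ∷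
  (12 , 6 , 0 ∷ 4 ∷ 1 ∷ 6 ∷ 2 ∷ 1 ∷ 0 ∷ 6 ∷ 4 ∷ 4 ∷ 2 ∷ 5 ∷ 0 ∷ []) ∷
  (12 , 7 , 0 ∷ 4 ∷ 1 ∷ 6 ∷ 2 ∷ 1 ∷ 5 ∷ 2 ∷ 4 ∷ 3 ∷ 1 ∷ 1 ∷ 0 ∷ []) ∷
  (12 , 8 , 0 ∷ 4 ∷ 1 ∷ 6 ∷ 2 ∷ 1 ∷ 0 ∷ 6 ∷ 3 ∷ 4 ∷ 2 ∷ 5 ∷ 0 ∷ []) ∷
  (12 , 9 , 0 ∷ 4 ∷ 1 ∷ 6 ∷ 2 ∷ 1 ∷ 0 ∷ 6 ∷ 4 ∷ 3 ∷ 2 ∷ 5 ∷ 0 ∷ []) ∷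
  (13 , 2 , 0 ∷ 4 ∷ 1 ∷ 6 ∷ 2 ∷ 1 ∷ 5 ∷ 6 ∷ 4 ∷ 4 ∷ 2 ∷ 5 ∷ 3 ∷ 0 ∷ []) ∷
  (13 , 3 , 0 ∷ 4 ∷ 1 ∷ 6 ∷ 2 ∷ 1 ∷ 0 ∷ 5 ∷ 4 ∷ 4 ∷ 2 ∷ 5 ∷ 3 ∷ 0 ∷ []) ∷
  (13 , 4 , 0 ∷ 4 ∷ 1 ∷ 6 ∷ 2 ∷ 1 ∷ 0 ∷ 6 ∷ 4 ∷ 4 ∷ 2 ∷ 5 ∷ 3 ∷ 0 ∷ []) ∷
  (13 , 5 , 0 ∷ 4 ∷ 1 ∷ 6 ∷ 2 ∷ 1 ∷ 5 ∷ 6 ∷ 4 ∷ 4 ∷ 2 ∷ 5 ∷ 3 ∷ 0 ∷ []) ∷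
  (13 , 6 , 0 ∷ 4 ∷ 1 ∷ 6 ∷ 2 ∷ 1 ∷ 0 ∷ 6 ∷ 4 ∷ 4 ∷ 2 ∷ 5 ∷ 3 ∷ 0 ∷ []) ∷
  (13 , 7 , 0 ∷ 4 ∷ 1 ∷ 6 ∷ 2 ∷ 1 ∷ 5 ∷ 2 ∷ 4 ∷ 3 ∷ 1 ∷ 1 ∷ 0 ∷ 0 ∷ []) ∷
  (13 , 8 , 0 ∷ 4 ∷ 1 ∷ 6 ∷ 2 ∷ 1 ∷ 0 ∷ 6 ∷ 3 ∷ 4 ∷ 2 ∷ 5 ∷ 5 ∷ 0 ∷ []) ∷
  (13 , 9 , 0 ∷ 4 ∷ 1 ∷ 6 ∷ 2 ∷ 1 ∷ 0 ∷ 6 ∷ 4 ∷ 3 ∷ 2 ∷ 4 ∷ 5 ∷ 0 ∷ []) ∷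
  (13 , 10 , 0 ∷ 4 ∷ 1 ∷ 6 ∷ 2 ∷ 1 ∷ 0 ∷ 6 ∷ 4 ∷ 4 ∷ 2 ∷ 5 ∷ 3 ∷ 0 ∷ []) ∷
  (14 , 2 , 0 ∷ 4 ∷ 1 ∷ 6 ∷ 2 ∷ 1 ∷ 5 ∷ 6 ∷ 4 ∷ 4 ∷ 2 ∷ 5 ∷ 3 ∷ 3 ∷ 0 ∷ []) ∷
  (14 , 3 , 0 ∷ 4 ∷ 1 ∷ 6 ∷ 2 ∷ 1 ∷ 0 ∷ 5 ∷ 4 ∷ 4 ∷ 2 ∷ 5 ∷ 1 ∷ 3 ∷ 0 ∷ []) ∷
  (14 , 4 , 0 ∷ 4 ∷ 1 ∷ 6 ∷ 2 ∷ 1 ∷ 0 ∷ 6 ∷ 4 ∷ 4 ∷ 2 ∷ 5 ∷ 1 ∷ 3 ∷ 0 ∷ []) ∷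
  (14 , 5 , 0 ∷ 4 ∷ 1 ∷ 6 ∷ 2 ∷ 1 ∷ 5 ∷ 6 ∷ 4 ∷ 4 ∷ 2 ∷ 5 ∷ 3 ∷ 3 ∷ 0 ∷ []) ∷
  (14 , 6 , 0 ∷ 4 ∷ 1 ∷ 6 ∷ 2 ∷ 1 ∷ 0 ∷ 6 ∷ 4 ∷ 4 ∷ 2 ∷ 5 ∷ 1 ∷ 3 ∷ 0 ∷ []) ∷
  (14 , 7 , 0 ∷ 4 ∷ 1 ∷ 6 ∷ 2 ∷ 1 ∷ 5 ∷ 2 ∷ 4 ∷ 3 ∷ 1 ∷ 0 ∷ 3 ∷ 6 ∷ 0 ∷ []) ∷
  (14 , 8 , 0 ∷ 4 ∷ 1 ∷ 6 ∷ 2 ∷ 1 ∷ 0 ∷ 6 ∷ 3 ∷ 4 ∷ 2 ∷ 5 ∷ 3 ∷ 2 ∷ 0 ∷ []) ∷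
  (14 , 9 , 0 ∷ 4 ∷ 1 ∷ 6 ∷ 2 ∷ 1 ∷ 0 ∷ 6 ∷ 4 ∷ 3 ∷ 2 ∷ 4 ∷ 5 ∷ 0 ∷ 0 ∷ []) ∷
  (14 , 10 , 0 ∷ 4 ∷ 1 ∷ 6 ∷ 2 ∷ 1 ∷ 0 ∷ 6 ∷ 4 ∷ 4 ∷ 2 ∷ 5 ∷ 1 ∷ 3 ∷ 0 ∷ []) ∷
  (14 , 11 , 0 ∷ 4 ∷ 1 ∷ 6 ∷ 2 ∷ 1 ∷ 0 ∷ 6 ∷ 4 ∷ 4 ∷ 2 ∷ 5 ∷ 1 ∷ 3 ∷ 0 ∷ []) ∷
  (15 , 2 , 0 ∷ 4 ∷ 1 ∷ 6 ∷ 2 ∷ 1 ∷ 5 ∷ 6 ∷ 4 ∷ 4 ∷ 2 ∷ 5 ∷ 3 ∷ 3 ∷ 6 ∷ 0 ∷ []) ∷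
  (15 , 3 , 0 ∷ 4 ∷ 1 ∷ 6 ∷ 2 ∷ 1 ∷ 0 ∷ 5 ∷ 4 ∷ 4 ∷ 2 ∷ 5 ∷ 1 ∷ 3 ∷ 0 ∷ 0 ∷ []) ∷
  (15 , 4 , 0 ∷ 4 ∷ 1 ∷ 6 ∷ 2 ∷ 1 ∷ 0 ∷ 6 ∷ 4 ∷ 4 ∷ 2 ∷ 5 ∷ 1 ∷ 3 ∷ 0 ∷ 0 ∷ []) ∷
  (15 , 5 , 0 ∷ 4 ∷ 1 ∷ 6 ∷ 2 ∷ 1 ∷ 5 ∷ 6 ∷ 4 ∷ 4 ∷ 2 ∷ 5 ∷ 3 ∷ 3 ∷ 6 ∷ 0 ∷ []) ∷
  (15 , 6 , 0 ∷ 4 ∷ 1 ∷ 6 ∷ 2 ∷ 1 ∷ 0 ∷ 6 ∷ 4 ∷ 4 ∷ 2 ∷ 5 ∷ 1 ∷ 3 ∷ 5 ∷ 0 ∷ []) ∷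
  (15 , 7 , 0 ∷ 4 ∷ 1 ∷ 6 ∷ 2 ∷ 1 ∷ 5 ∷ 2 ∷ 4 ∷ 3 ∷ 1 ∷ 1 ∷ 0 ∷ 6 ∷ 3 ∷ 0 ∷ []) ∷
  (15 , 8 , 0 ∷ 4 ∷ 1 ∷ 6 ∷ 2 ∷ 1 ∷ 0 ∷ 6 ∷ 3 ∷ 4 ∷ 2 ∷ 5 ∷ 1 ∷ 3 ∷ 5 ∷ 0 ∷ []) ∷
  (15 , 9 , 0 ∷ 4 ∷ 1 ∷ 6 ∷ 2 ∷ 1 ∷ 0 ∷ 6 ∷ 4 ∷ 3 ∷ 2 ∷ 4 ∷ 5 ∷ 2 ∷ 0 ∷ 0 ∷ []) ∷
  (15 , 10 , 0 ∷ 4 ∷ 1 ∷ 6 ∷ 2 ∷ 1 ∷ 0 ∷ 6 ∷ 4 ∷ 4 ∷ 2 ∷ 5 ∷ 1 ∷ 3 ∷ 0 ∷ 0 ∷ []) ∷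
  (15 , 11 , 0 ∷ 4 ∷ 1 ∷ 6 ∷ 2 ∷ 1 ∷ 0 ∷ 6 ∷ 4 ∷ 4 ∷ 2 ∷ 5 ∷ 1 ∷ 3 ∷ 0 ∷ 0 ∷ []) ∷
  (15 , 12 , 0 ∷ 4 ∷ 1 ∷ 6 ∷ 2 ∷ 1 ∷ 0 ∷ 6 ∷ 4 ∷ 4 ∷ 2 ∷ 5 ∷ 3 ∷ 3 ∷ 2 ∷ 0 ∷ []) ∷
  (16 , 2 , 0 ∷ 4 ∷ 1 ∷ 6 ∷ 2 ∷ 1 ∷ 5 ∷ 6 ∷ 4 ∷ 4 ∷ 2 ∷ 5 ∷ 3 ∷ 3 ∷ 6 ∷ 0 ∷ 0 ∷ []) ∷
  (16 , 3 , 0 ∷ 4 ∷ 1 ∷ 6 ∷ 2 ∷ 1 ∷ 0 ∷ 5 ∷ 4 ∷ 4 ∷ 2 ∷ 5 ∷ 1 ∷ 3 ∷ 2 ∷ 0 ∷ 0 ∷ []) ∷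
  (16 , 4 , 0 ∷ 4 ∷ 1 ∷ 6 ∷ 2 ∷ 1 ∷ 0 ∷ 6 ∷ 4 ∷ 4 ∷ 2 ∷ 5 ∷ 1 ∷ 3 ∷ 6 ∷ 5 ∷ 0 ∷ []) ∷
  (16 , 5 , 0 ∷ 4 ∷ 1 ∷ 6 ∷ 2 ∷ 1 ∷ 5 ∷ 6 ∷ 4 ∷ 4 ∷ 2 ∷ 5 ∷ 3 ∷ 3 ∷ 6 ∷ 0 ∷ 0 ∷ []) ∷
  (16 , 6 , 0 ∷ 4 ∷ 1 ∷ 6 ∷ 2 ∷ 1 ∷ 0 ∷ 6 ∷ 4 ∷ 4 ∷ 2 ∷ 5 ∷ 1 ∷ 3 ∷ 6 ∷ 5 ∷ 0 ∷ []) ∷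
  (16 , 7 , 0 ∷ 4 ∷ 1 ∷ 6 ∷ 2 ∷ 1 ∷ 5 ∷ 2 ∷ 4 ∷ 3 ∷ 1 ∷ 1 ∷ 0 ∷ 6 ∷ 3 ∷ 3 ∷ 0 ∷ []) ∷
  (16 , 8 , 0 ∷ 4 ∷ 1 ∷ 6 ∷ 2 ∷ 1 ∷ 0 ∷ 6 ∷ 3 ∷ 4 ∷ 2 ∷ 5 ∷ 1 ∷ 3 ∷ 5 ∷ 5 ∷ 0 ∷ []) ∷
  (16 , 9 , 0 ∷ 4 ∷ 1 ∷ 6 ∷ 2 ∷ 1 ∷ 0 ∷ 6 ∷ 4 ∷ 3 ∷ 2 ∷ 4 ∷ 5 ∷ 3 ∷ 6 ∷ 5 ∷ 0 ∷ []) ∷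
  (16 , 10 , 0 ∷ 4 ∷ 1 ∷ 6 ∷ 2 ∷ 1 ∷ 0 ∷ 6 ∷ 4 ∷ 4 ∷ 2 ∷ 5 ∷ 1 ∷ 3 ∷ 6 ∷ 5 ∷ 0 ∷ []) ∷
  (16 , 11 , 0 ∷ 4 ∷ 1 ∷ 6 ∷ 2 ∷ 1 ∷ 0 ∷ 6 ∷ 4 ∷ 4 ∷ 2 ∷ 5 ∷ 1 ∷ 3 ∷ 2 ∷ 0 ∷ 0 ∷ []) ∷
  (16 , 12 , 0 ∷ 4 ∷ 1 ∷ 6 ∷ 2 ∷ 1 ∷ 0 ∷ 6 ∷ 4 ∷ 4 ∷ 2 ∷ 5 ∷ 3 ∷ 3 ∷ 6 ∷ 5 ∷ 0 ∷ []) ∷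
  (16 , 13 , 0 ∷ 4 ∷ 1 ∷ 6 ∷ 2 ∷ 1 ∷ 0 ∷ 6 ∷ 4 ∷ 4 ∷ 2 ∷ 5 ∷ 1 ∷ 3 ∷ 6 ∷ 5 ∷ 0 ∷ []) ∷
  (17 , 2 , 0 ∷ 4 ∷ 1 ∷ 6 ∷ 2 ∷ 1 ∷ 5 ∷ 6 ∷ 4 ∷ 4 ∷ 2 ∷ 5 ∷ 3 ∷ 3 ∷ 6 ∷ 6 ∷ 0 ∷ 0 ∷ []) ∷
  (17 , 3 , 0 ∷ 4 ∷ 1 ∷ 6 ∷ 2 ∷ 1 ∷ 0 ∷ 5 ∷ 4 ∷ 4 ∷ 2 ∷ 5 ∷ 1 ∷ 3 ∷ 6 ∷ 4 ∷ 3 ∷ 0 ∷ []) ∷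
  (17 , 4 , 0 ∷ 4 ∷ 1 ∷ 6 ∷ 2 ∷ 1 ∷ 0 ∷ 6 ∷ 4 ∷ 4 ∷ 2 ∷ 5 ∷ 1 ∷ 3 ∷ 6 ∷ 5 ∷ 3 ∷ 0 ∷ []) ∷
  (17 , 5 , 0 ∷ 4 ∷ 1 ∷ 6 ∷ 2 ∷ 1 ∷ 5 ∷ 6 ∷ 4 ∷ 4 ∷ 2 ∷ 5 ∷ 3 ∷ 3 ∷ 6 ∷ 6 ∷ 0 ∷ 0 ∷ []) ∷
  (17 , 6 , 0 ∷ 4 ∷ 1 ∷ 6 ∷ 2 ∷ 1 ∷ 0 ∷ 6 ∷ 4 ∷ 4 ∷ 2 ∷ 5 ∷ 1 ∷ 3 ∷ 6 ∷ 5 ∷ 3 ∷ 0 ∷ []) ∷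
  (17 , 7 , 0 ∷ 4 ∷ 1 ∷ 6 ∷ 2 ∷ 1 ∷ 5 ∷ 2 ∷ 4 ∷ 3 ∷ 1 ∷ 1 ∷ 0 ∷ 6 ∷ 3 ∷ 3 ∷ 0 ∷ 0 ∷ []) ∷
  (17 , 8 , 0 ∷ 4 ∷ 1 ∷ 6 ∷ 2 ∷ 1 ∷ 0 ∷ 6 ∷ 3 ∷ 4 ∷ 2 ∷ 5 ∷ 1 ∷ 3 ∷ 5 ∷ 5 ∷ 0 ∷ 0 ∷ []) ∷
  (17 , 9 , 0 ∷ 4 ∷ 1 ∷ 6 ∷ 2 ∷ 1 ∷ 0 ∷ 6 ∷ 4 ∷ 3 ∷ 2 ∷ 4 ∷ 5 ∷ 3 ∷ 6 ∷ 5 ∷ 2 ∷ 0 ∷ []) ∷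
  (17 , 10 , 0 ∷ 4 ∷ 1 ∷ 6 ∷ 2 ∷ 1 ∷ 0 ∷ 6 ∷ 4 ∷ 4 ∷ 2 ∷ 5 ∷ 1 ∷ 3 ∷ 6 ∷ 5 ∷ 3 ∷ 0 ∷ []) ∷
  (17 , 11 , 0 ∷ 4 ∷ 1 ∷ 6 ∷ 2 ∷ 1 ∷ 0 ∷ 6 ∷ 4 ∷ 4 ∷ 2 ∷ 5 ∷ 1 ∷ 3 ∷ 6 ∷ 5 ∷ 3 ∷ 0 ∷ []) ∷
  (17 , 12 , 0 ∷ 4 ∷ 1 ∷ 6 ∷ 2 ∷ 1 ∷ 0 ∷ 6 ∷ 4 ∷ 4 ∷ 2 ∷ 5 ∷ 3 ∷ 3 ∷ 6 ∷ 5 ∷ 5 ∷ 0 ∷ []) ∷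
  (17 , 13 , 0 ∷ 4 ∷ 1 ∷ 6 ∷ 2 ∷ 1 ∷ 0 ∷ 6 ∷ 4 ∷ 4 ∷ 2 ∷ 5 ∷ 1 ∷ 3 ∷ 6 ∷ 5 ∷ 5 ∷ 0 ∷ []) ∷
  (17 , 14 , 0 ∷ 4 ∷ 1 ∷ 6 ∷ 2 ∷ 1 ∷ 0 ∷ 6 ∷ 4 ∷ 4 ∷ 2 ∷ 5 ∷ 1 ∷ 3 ∷ 5 ∷ 4 ∷ 3 ∷ 0 ∷ []) ∷
  (18 , 2 , 0 ∷ 4 ∷ 1 ∷ 6 ∷ 2 ∷ 1 ∷ 5 ∷ 6 ∷ 4 ∷ 4 ∷ 2 ∷ 5 ∷ 3 ∷ 3 ∷ 6 ∷ 0 ∷ 3 ∷ 2 ∷ 0 ∷ []) ∷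
  (18 , 3 , 0 ∷ 4 ∷ 1 ∷ 6 ∷ 2 ∷ 1 ∷ 0 ∷ 5 ∷ 4 ∷ 4 ∷ 2 ∷ 5 ∷ 1 ∷ 3 ∷ 6 ∷ 4 ∷ 3 ∷ 0 ∷ 0 ∷ []) ∷
  (18 , 4 , 0 ∷ 4 ∷ 1 ∷ 6 ∷ 2 ∷ 1 ∷ 0 ∷ 6 ∷ 4 ∷ 4 ∷ 2 ∷ 5 ∷ 1 ∷ 3 ∷ 6 ∷ 5 ∷ 3 ∷ 0 ∷ 0 ∷ []) ∷
  (18 , 5 , 0 ∷ 4 ∷ 1 ∷ 6 ∷ 2 ∷ 1 ∷ 5 ∷ 6 ∷ 4 ∷ 4 ∷ 2 ∷ 5 ∷ 3 ∷ 3 ∷ 6 ∷ 0 ∷ 3 ∷ 2 ∷ 0 ∷ []) ∷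
  (18 , 6 , 0 ∷ 4 ∷ 1 ∷ 6 ∷ 2 ∷ 1 ∷ 0 ∷ 6 ∷ 4 ∷ 4 ∷ 2 ∷ 5 ∷ 1 ∷ 3 ∷ 6 ∷ 5 ∷ 3 ∷ 2 ∷ 0 ∷ []) ∷
  (18 , 7 , 0 ∷ 4 ∷ 1 ∷ 6 ∷ 2 ∷ 1 ∷ 5 ∷ 2 ∷ 4 ∷ 3 ∷ 1 ∷ 1 ∷ 0 ∷ 6 ∷ 3 ∷ 3 ∷ 5 ∷ 5 ∷ 0 ∷ []) ∷
  (18 , 8 , 0 ∷ 4 ∷ 1 ∷ 6 ∷ 2 ∷ 1 ∷ 0 ∷ 6 ∷ 3 ∷ 4 ∷ 2 ∷ 5 ∷ 1 ∷ 3 ∷ 5 ∷ 4 ∷ 6 ∷ 5 ∷ 0 ∷ []) ∷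
  (18 , 9 , 0 ∷ 4 ∷ 1 ∷ 6 ∷ 2 ∷ 1 ∷ 0 ∷ 6 ∷ 4 ∷ 3 ∷ 2 ∷ 4 ∷ 5 ∷ 3 ∷ 6 ∷ 5 ∷ 2 ∷ 0 ∷ 0 ∷ []) ∷
  (18 , 10 , 0 ∷ 4 ∷ 1 ∷ 6 ∷ 2 ∷ 1 ∷ 0 ∷ 6 ∷ 4 ∷ 4 ∷ 2 ∷ 5 ∷ 1 ∷ 3 ∷ 6 ∷ 5 ∷ 3 ∷ 0 ∷ 0 ∷ []) ∷
  (18 , 11 , 0 ∷ 4 ∷ 1 ∷ 6 ∷ 2 ∷ 1 ∷ 0 ∷ 6 ∷ 4 ∷ 4 ∷ 2 ∷ 5 ∷ 1 ∷ 3 ∷ 6 ∷ 5 ∷ 3 ∷ 0 ∷ 0 ∷ []) ∷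
  (18 , 12 , 0 ∷ 4 ∷ 1 ∷ 6 ∷ 2 ∷ 1 ∷ 0 ∷ 6 ∷ 4 ∷ 4 ∷ 2 ∷ 5 ∷ 3 ∷ 3 ∷ 6 ∷ 5 ∷ 5 ∷ 0 ∷ 0 ∷ []) ∷
  (18 , 13 , 0 ∷ 4 ∷ 1 ∷ 6 ∷ 2 ∷ 1 ∷ 0 ∷ 6 ∷ 4 ∷ 4 ∷ 2 ∷ 5 ∷ 1 ∷ 3 ∷ 6 ∷ 5 ∷ 3 ∷ 2 ∷ 0 ∷ []) ∷
  (18 , 14 , 0 ∷ 4 ∷ 1 ∷ 6 ∷ 2 ∷ 1 ∷ 0 ∷ 6 ∷ 4 ∷ 4 ∷ 2 ∷ 5 ∷ 1 ∷ 3 ∷ 0 ∷ 5 ∷ 3 ∷ 2 ∷ 0 ∷ []) ∷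
  (18 , 15 , 0 ∷ 4 ∷ 1 ∷ 6 ∷ 2 ∷ 1 ∷ 0 ∷ 6 ∷ 4 ∷ 4 ∷ 2 ∷ 5 ∷ 1 ∷ 3 ∷ 6 ∷ 5 ∷ 3 ∷ 0 ∷ 0 ∷ []) ∷
  (19 , 2 , 0 ∷ 4 ∷ 1 ∷ 6 ∷ 2 ∷ 1 ∷ 5 ∷ 6 ∷ 4 ∷ 4 ∷ 2 ∷ 5 ∷ 3 ∷ 3 ∷ 6 ∷ 0 ∷ 3 ∷ 2 ∷ 0 ∷ 0 ∷ []) ∷
  (19 , 3 , 0 ∷ 4 ∷ 1 ∷ 6 ∷ 2 ∷ 1 ∷ 0 ∷ 5 ∷ 4 ∷ 4 ∷ 2 ∷ 5 ∷ 1 ∷ 3 ∷ 6 ∷ 4 ∷ 3 ∷ 2 ∷ 0 ∷ 0 ∷ []) ∷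
  (19 , 4 , 0 ∷ 4 ∷ 1 ∷ 6 ∷ 2 ∷ 1 ∷ 0 ∷ 6 ∷ 4 ∷ 4 ∷ 2 ∷ 5 ∷ 1 ∷ 3 ∷ 6 ∷ 5 ∷ 3 ∷ 3 ∷ 0 ∷ 0 ∷ []) ∷
  (19 , 5 , 0 ∷ 4 ∷ 1 ∷ 6 ∷ 2 ∷ 1 ∷ 5 ∷ 6 ∷ 4 ∷ 4 ∷ 2 ∷ 5 ∷ 3 ∷ 3 ∷ 6 ∷ 0 ∷ 3 ∷ 2 ∷ 0 ∷ 0 ∷ []) ∷
  (19 , 6 , 0 ∷ 4 ∷ 1 ∷ 6 ∷ 2 ∷ 1 ∷ 0 ∷ 6 ∷ 4 ∷ 4 ∷ 2 ∷ 5 ∷ 1 ∷ 3 ∷ 6 ∷ 5 ∷ 3 ∷ 2 ∷ 2 ∷ 0 ∷ []) ∷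
  (19 , 7 , 0 ∷ 4 ∷ 1 ∷ 6 ∷ 2 ∷ 1 ∷ 5 ∷ 2 ∷ 4 ∷ 3 ∷ 1 ∷ 1 ∷ 0 ∷ 6 ∷ 3 ∷ 3 ∷ 5 ∷ 5 ∷ 0 ∷ 0 ∷ []) ∷
  (19 , 8 , 0 ∷ 4 ∷ 1 ∷ 6 ∷ 2 ∷ 1 ∷ 0 ∷ 6 ∷ 3 ∷ 4 ∷ 2 ∷ 5 ∷ 1 ∷ 3 ∷ 5 ∷ 4 ∷ 6 ∷ 6 ∷ 5 ∷ 0 ∷ []) ∷
  (19 , 9 , 0 ∷ 4 ∷ 1 ∷ 6 ∷ 2 ∷ 1 ∷ 0 ∷ 6 ∷ 4 ∷ 3 ∷ 2 ∷ 4 ∷ 5 ∷ 3 ∷ 6 ∷ 5 ∷ 2 ∷ 2 ∷ 0 ∷ 0 ∷ []) ∷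
  (19 , 10 , 0 ∷ 4 ∷ 1 ∷ 6 ∷ 2 ∷ 1 ∷ 0 ∷ 6 ∷ 4 ∷ 4 ∷ 2 ∷ 5 ∷ 1 ∷ 3 ∷ 6 ∷ 5 ∷ 3 ∷ 3 ∷ 0 ∷ 0 ∷ []) ∷
  (19 , 11 , 0 ∷ 4 ∷ 1 ∷ 6 ∷ 2 ∷ 1 ∷ 0 ∷ 6 ∷ 4 ∷ 4 ∷ 2 ∷ 5 ∷ 1 ∷ 3 ∷ 6 ∷ 5 ∷ 3 ∷ 2 ∷ 0 ∷ 0 ∷ []) ∷
  (19 , 12 , 0 ∷ 4 ∷ 1 ∷ 6 ∷ 2 ∷ 1 ∷ 0 ∷ 6 ∷ 4 ∷ 4 ∷ 2 ∷ 5 ∷ 3 ∷ 3 ∷ 6 ∷ 5 ∷ 4 ∷ 3 ∷ 2 ∷ 0 ∷ []) ∷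
  (19 , 13 , 0 ∷ 4 ∷ 1 ∷ 6 ∷ 2 ∷ 1 ∷ 0 ∷ 6 ∷ 4 ∷ 4 ∷ 2 ∷ 5 ∷ 1 ∷ 3 ∷ 6 ∷ 5 ∷ 3 ∷ 2 ∷ 0 ∷ 0 ∷ []) ∷
  (19 , 14 , 0 ∷ 4 ∷ 1 ∷ 6 ∷ 2 ∷ 1 ∷ 0 ∷ 6 ∷ 4 ∷ 4 ∷ 2 ∷ 5 ∷ 1 ∷ 3 ∷ 0 ∷ 5 ∷ 3 ∷ 2 ∷ 2 ∷ 0 ∷ []) ∷
  (19 , 15 , 0 ∷ 4 ∷ 1 ∷ 6 ∷ 2 ∷ 1 ∷ 0 ∷ 6 ∷ 4 ∷ 4 ∷ 2 ∷ 5 ∷ 1 ∷ 3 ∷ 6 ∷ 5 ∷ 3 ∷ 2 ∷ 0 ∷ 0 ∷ []) ∷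
  (19 , 16 , 0 ∷ 4 ∷ 1 ∷ 6 ∷ 2 ∷ 1 ∷ 0 ∷ 6 ∷ 4 ∷ 4 ∷ 2 ∷ 5 ∷ 1 ∷ 3 ∷ 6 ∷ 5 ∷ 3 ∷ 2 ∷ 0 ∷ 0 ∷ []) ∷
  (20 , 2 , 0 ∷ 4 ∷ 1 ∷ 6 ∷ 2 ∷ 1 ∷ 5 ∷ 6 ∷ 4 ∷ 4 ∷ 2 ∷ 5 ∷ 3 ∷ 3 ∷ 6 ∷ 0 ∷ 3 ∷ 2 ∷ 2 ∷ 0 ∷ 0 ∷ []) ∷
  (20 , 3 , 0 ∷ 4 ∷ 1 ∷ 6 ∷ 2 ∷ 1 ∷ 0 ∷ 5 ∷ 4 ∷ 4 ∷ 2 ∷ 5 ∷ 1 ∷ 3 ∷ 6 ∷ 4 ∷ 3 ∷ 2 ∷ 2 ∷ 0 ∷ 0 ∷ []) ∷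
  (20 , 4 , 0 ∷ 4 ∷ 1 ∷ 6 ∷ 2 ∷ 1 ∷ 0 ∷ 6 ∷ 4 ∷ 4 ∷ 2 ∷ 5 ∷ 1 ∷ 3 ∷ 6 ∷ 5 ∷ 3 ∷ 3 ∷ 4 ∷ 5 ∷ 0 ∷ []) ∷
  (20 , 5 , 0 ∷ 4 ∷ 1 ∷ 6 ∷ 2 ∷ 1 ∷ 5 ∷ 6 ∷ 4 ∷ 4 ∷ 2 ∷ 5 ∷ 3 ∷ 3 ∷ 6 ∷ 0 ∷ 3 ∷ 2 ∷ 2 ∷ 0 ∷ 0 ∷ []) ∷
  (20 , 6 , 0 ∷ 4 ∷ 1 ∷ 6 ∷ 2 ∷ 1 ∷ 0 ∷ 6 ∷ 4 ∷ 4 ∷ 2 ∷ 5 ∷ 1 ∷ 3 ∷ 6 ∷ 5 ∷ 3 ∷ 3 ∷ 2 ∷ 2 ∷ 0 ∷ []) ∷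
  (20 , 7 , 0 ∷ 4 ∷ 1 ∷ 6 ∷ 2 ∷ 1 ∷ 5 ∷ 2 ∷ 4 ∷ 3 ∷ 1 ∷ 1 ∷ 0 ∷ 6 ∷ 3 ∷ 3 ∷ 5 ∷ 4 ∷ 6 ∷ 5 ∷ 0 ∷ []) ∷
  (20 , 8 , 0 ∷ 4 ∷ 1 ∷ 6 ∷ 2 ∷ 1 ∷ 0 ∷ 6 ∷ 3 ∷ 4 ∷ 2 ∷ 5 ∷ 1 ∷ 3 ∷ 5 ∷ 4 ∷ 6 ∷ 6 ∷ 5 ∷ 5 ∷ 0 ∷ []) ∷
  (20 , 9 , 0 ∷ 4 ∷ 1 ∷ 6 ∷ 2 ∷ 1 ∷ 0 ∷ 6 ∷ 4 ∷ 3 ∷ 2 ∷ 4 ∷ 5 ∷ 3 ∷ 6 ∷ 5 ∷ 5 ∷ 2 ∷ 2 ∷ 0 ∷ 0 ∷ []) ∷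
  (20 , 10 , 0 ∷ 4 ∷ 1 ∷ 6 ∷ 2 ∷ 1 ∷ 0 ∷ 6 ∷ 4 ∷ 4 ∷ 2 ∷ 5 ∷ 1 ∷ 3 ∷ 6 ∷ 5 ∷ 3 ∷ 3 ∷ 4 ∷ 5 ∷ 0 ∷ []) ∷
  (20 , 11 , 0 ∷ 4 ∷ 1 ∷ 6 ∷ 2 ∷ 1 ∷ 0 ∷ 6 ∷ 4 ∷ 4 ∷ 2 ∷ 5 ∷ 1 ∷ 3 ∷ 6 ∷ 5 ∷ 3 ∷ 2 ∷ 2 ∷ 0 ∷ 0 ∷ []) ∷
  (20 , 12 , 0 ∷ 4 ∷ 1 ∷ 6 ∷ 2 ∷ 1 ∷ 0 ∷ 6 ∷ 4 ∷ 4 ∷ 2 ∷ 5 ∷ 3 ∷ 3 ∷ 6 ∷ 5 ∷ 4 ∷ 3 ∷ 2 ∷ 0 ∷ 0 ∷ []) ∷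
  (20 , 13 , 0 ∷ 4 ∷ 1 ∷ 6 ∷ 2 ∷ 1 ∷ 0 ∷ 6 ∷ 4 ∷ 4 ∷ 2 ∷ 5 ∷ 1 ∷ 3 ∷ 6 ∷ 5 ∷ 3 ∷ 2 ∷ 2 ∷ 0 ∷ 0 ∷ []) ∷
  (20 , 14 , 0 ∷ 4 ∷ 1 ∷ 6 ∷ 2 ∷ 1 ∷ 0 ∷ 6 ∷ 4 ∷ 4 ∷ 2 ∷ 5 ∷ 1 ∷ 3 ∷ 0 ∷ 5 ∷ 3 ∷ 3 ∷ 2 ∷ 2 ∷ 0 ∷ []) ∷
  (20 , 15 , 0 ∷ 4 ∷ 1 ∷ 6 ∷ 2 ∷ 1 ∷ 0 ∷ 6 ∷ 4 ∷ 4 ∷ 2 ∷ 5 ∷ 1 ∷ 3 ∷ 6 ∷ 5 ∷ 3 ∷ 2 ∷ 2 ∷ 0 ∷ 0 ∷ []) ∷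
  (20 , 16 , 0 ∷ 4 ∷ 1 ∷ 6 ∷ 2 ∷ 1 ∷ 0 ∷ 6 ∷ 4 ∷ 4 ∷ 2 ∷ 5 ∷ 1 ∷ 3 ∷ 6 ∷ 5 ∷ 3 ∷ 2 ∷ 2 ∷ 0 ∷ 0 ∷ []) ∷
  (20 , 17 , 0 ∷ 4 ∷ 1 ∷ 6 ∷ 2 ∷ 1 ∷ 0 ∷ 6 ∷ 4 ∷ 4 ∷ 2 ∷ 5 ∷ 1 ∷ 3 ∷ 6 ∷ 5 ∷ 3 ∷ 3 ∷ 2 ∷ 2 ∷ 0 ∷ []) ∷
  (21 , 2 , 0 ∷ 4 ∷ 1 ∷ 6 ∷ 2 ∷ 1 ∷ 5 ∷ 6 ∷ 4 ∷ 4 ∷ 2 ∷ 5 ∷ 3 ∷ 3 ∷ 6 ∷ 0 ∷ 3 ∷ 4 ∷ 5 ∷ 5 ∷ 0 ∷ 0 ∷ []) ∷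
  (21 , 3 , 0 ∷ 4 ∷ 1 ∷ 6 ∷ 2 ∷ 1 ∷ 0 ∷ 5 ∷ 4 ∷ 4 ∷ 2 ∷ 5 ∷ 1 ∷ 3 ∷ 6 ∷ 4 ∷ 3 ∷ 3 ∷ 2 ∷ 2 ∷ 0 ∷ 0 ∷ []) ∷
  (21 , 4 , 0 ∷ 4 ∷ 1 ∷ 6 ∷ 2 ∷ 1 ∷ 0 ∷ 6 ∷ 4 ∷ 4 ∷ 2 ∷ 5 ∷ 1 ∷ 3 ∷ 6 ∷ 5 ∷ 3 ∷ 3 ∷ 4 ∷ 5 ∷ 5 ∷ 0 ∷ []) ∷
  (21 , 5 , 0 ∷ 4 ∷ 1 ∷ 6 ∷ 2 ∷ 1 ∷ 5 ∷ 6 ∷ 4 ∷ 4 ∷ 2 ∷ 5 ∷ 3 ∷ 3 ∷ 6 ∷ 0 ∷ 3 ∷ 4 ∷ 5 ∷ 5 ∷ 0 ∷ 0 ∷ []) ∷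
  (21 , 6 , 0 ∷ 4 ∷ 1 ∷ 6 ∷ 2 ∷ 1 ∷ 0 ∷ 6 ∷ 4 ∷ 4 ∷ 2 ∷ 5 ∷ 1 ∷ 3 ∷ 6 ∷ 5 ∷ 3 ∷ 3 ∷ 4 ∷ 5 ∷ 5 ∷ 0 ∷ []) ∷
  (21 , 7 , 0 ∷ 4 ∷ 1 ∷ 6 ∷ 2 ∷ 1 ∷ 5 ∷ 2 ∷ 4 ∷ 3 ∷ 1 ∷ 1 ∷ 0 ∷ 6 ∷ 3 ∷ 3 ∷ 5 ∷ 6 ∷ 6 ∷ 4 ∷ 5 ∷ 0 ∷ []) ∷
  (21 , 8 , 0 ∷ 4 ∷ 1 ∷ 6 ∷ 2 ∷ 1 ∷ 0 ∷ 6 ∷ 3 ∷ 4 ∷ 2 ∷ 5 ∷ 1 ∷ 3 ∷ 5 ∷ 4 ∷ 6 ∷ 6 ∷ 5 ∷ 5 ∷ 0 ∷ 0 ∷ []) ∷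
  (21 , 9 , 0 ∷ 4 ∷ 1 ∷ 6 ∷ 2 ∷ 1 ∷ 0 ∷ 6 ∷ 4 ∷ 3 ∷ 2 ∷ 4 ∷ 5 ∷ 3 ∷ 6 ∷ 6 ∷ 5 ∷ 5 ∷ 2 ∷ 2 ∷ 0 ∷ 0 ∷ []) ∷
  (21 , 10 , 0 ∷ 4 ∷ 1 ∷ 6 ∷ 2 ∷ 1 ∷ 0 ∷ 6 ∷ 4 ∷ 4 ∷ 2 ∷ 5 ∷ 1 ∷ 3 ∷ 6 ∷ 5 ∷ 3 ∷ 3 ∷ 4 ∷ 5 ∷ 5 ∷ 0 ∷ []) ∷
  (21 , 11 , 0 ∷ 4 ∷ 1 ∷ 6 ∷ 2 ∷ 1 ∷ 0 ∷ 6 ∷ 4 ∷ 4 ∷ 2 ∷ 5 ∷ 1 ∷ 3 ∷ 6 ∷ 5 ∷ 3 ∷ 3 ∷ 2 ∷ 2 ∷ 0 ∷ 0 ∷ []) ∷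
  (21 , 12 , 0 ∷ 4 ∷ 1 ∷ 6 ∷ 2 ∷ 1 ∷ 0 ∷ 6 ∷ 4 ∷ 4 ∷ 2 ∷ 5 ∷ 3 ∷ 3 ∷ 6 ∷ 5 ∷ 4 ∷ 3 ∷ 2 ∷ 2 ∷ 0 ∷ 0 ∷ []) ∷
  (21 , 13 , 0 ∷ 4 ∷ 1 ∷ 6 ∷ 2 ∷ 1 ∷ 0 ∷ 6 ∷ 4 ∷ 4 ∷ 2 ∷ 5 ∷ 1 ∷ 3 ∷ 6 ∷ 5 ∷ 3 ∷ 3 ∷ 2 ∷ 2 ∷ 0 ∷ 0 ∷ []) ∷
  (21 , 14 , 0 ∷ 4 ∷ 1 ∷ 6 ∷ 2 ∷ 1 ∷ 0 ∷ 6 ∷ 4 ∷ 4 ∷ 2 ∷ 5 ∷ 1 ∷ 3 ∷ 0 ∷ 5 ∷ 6 ∷ 6 ∷ 3 ∷ 2 ∷ 2 ∷ 0 ∷ []) ∷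
  (21 , 15 , 0 ∷ 4 ∷ 1 ∷ 6 ∷ 2 ∷ 1 ∷ 0 ∷ 6 ∷ 4 ∷ 4 ∷ 2 ∷ 5 ∷ 1 ∷ 3 ∷ 6 ∷ 5 ∷ 3 ∷ 3 ∷ 2 ∷ 2 ∷ 0 ∷ 0 ∷ []) ∷
  (21 , 16 , 0 ∷ 4 ∷ 1 ∷ 6 ∷ 2 ∷ 1 ∷ 0 ∷ 6 ∷ 4 ∷ 4 ∷ 2 ∷ 5 ∷ 1 ∷ 3 ∷ 6 ∷ 5 ∷ 3 ∷ 3 ∷ 2 ∷ 2 ∷ 0 ∷ 0 ∷ []) ∷
  (21 , 17 , 0 ∷ 4 ∷ 1 ∷ 6 ∷ 2 ∷ 1 ∷ 0 ∷ 6 ∷ 4 ∷ 4 ∷ 2 ∷ 5 ∷ 1 ∷ 3 ∷ 6 ∷ 5 ∷ 3 ∷ 3 ∷ 2 ∷ 2 ∷ 0 ∷ 0 ∷ []) ∷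
  (21 , 18 , 0 ∷ 4 ∷ 1 ∷ 6 ∷ 2 ∷ 1 ∷ 0 ∷ 6 ∷ 4 ∷ 4 ∷ 2 ∷ 5 ∷ 1 ∷ 3 ∷ 6 ∷ 5 ∷ 4 ∷ 3 ∷ 3 ∷ 2 ∷ 2 ∷ 0 ∷ []) ∷
  (22 , 2 , 0 ∷ 4 ∷ 1 ∷ 6 ∷ 2 ∷ 1 ∷ 5 ∷ 6 ∷ 4 ∷ 4 ∷ 2 ∷ 5 ∷ 3 ∷ 3 ∷ 6 ∷ 0 ∷ 2 ∷ 3 ∷ 4 ∷ 5 ∷ 5 ∷ 0 ∷ 0 ∷ []) ∷
  (22 , 3 , 0 ∷ 4 ∷ 1 ∷ 6 ∷ 2 ∷ 1 ∷ 0 ∷ 5 ∷ 4 ∷ 4 ∷ 2 ∷ 5 ∷ 1 ∷ 3 ∷ 6 ∷ 5 ∷ 5 ∷ 3 ∷ 3 ∷ 2 ∷ 2 ∷ 0 ∷ 0 ∷ []) ∷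
  (22 , 4 , 0 ∷ 4 ∷ 1 ∷ 6 ∷ 2 ∷ 1 ∷ 0 ∷ 6 ∷ 4 ∷ 4 ∷ 2 ∷ 5 ∷ 1 ∷ 3 ∷ 6 ∷ 5 ∷ 3 ∷ 3 ∷ 4 ∷ 5 ∷ 5 ∷ 0 ∷ 0 ∷ []) ∷
  (22 , 5 , 0 ∷ 4 ∷ 1 ∷ 6 ∷ 2 ∷ 1 ∷ 5 ∷ 6 ∷ 4 ∷ 4 ∷ 2 ∷ 5 ∷ 3 ∷ 3 ∷ 6 ∷ 0 ∷ 2 ∷ 3 ∷ 4 ∷ 5 ∷ 5 ∷ 0 ∷ 0 ∷ []) ∷
  (22 , 6 , 0 ∷ 4 ∷ 1 ∷ 6 ∷ 2 ∷ 1 ∷ 0 ∷ 6 ∷ 4 ∷ 4 ∷ 2 ∷ 5 ∷ 1 ∷ 3 ∷ 6 ∷ 5 ∷ 3 ∷ 0 ∷ 5 ∷ 4 ∷ 3 ∷ 2 ∷ 0 ∷ []) ∷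
  (22 , 7 , 0 ∷ 4 ∷ 1 ∷ 6 ∷ 2 ∷ 1 ∷ 5 ∷ 2 ∷ 4 ∷ 3 ∷ 1 ∷ 1 ∷ 0 ∷ 6 ∷ 3 ∷ 3 ∷ 5 ∷ 6 ∷ 4 ∷ 5 ∷ 5 ∷ 0 ∷ 0 ∷ []) ∷
  (22 , 8 , 0 ∷ 4 ∷ 1 ∷ 6 ∷ 2 ∷ 1 ∷ 0 ∷ 6 ∷ 3 ∷ 4 ∷ 2 ∷ 5 ∷ 1 ∷ 3 ∷ 5 ∷ 4 ∷ 4 ∷ 6 ∷ 6 ∷ 5 ∷ 5 ∷ 0 ∷ 0 ∷ []) ∷
  (22 , 9 , 0 ∷ 4 ∷ 1 ∷ 6 ∷ 2 ∷ 1 ∷ 0 ∷ 6 ∷ 4 ∷ 3 ∷ 2 ∷ 4 ∷ 5 ∷ 3 ∷ 3 ∷ 1 ∷ 1 ∷ 5 ∷ 5 ∷ 2 ∷ 2 ∷ 0 ∷ 0 ∷ []) ∷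
  (22 , 10 , 0 ∷ 4 ∷ 1 ∷ 6 ∷ 2 ∷ 1 ∷ 0 ∷ 6 ∷ 4 ∷ 4 ∷ 2 ∷ 5 ∷ 1 ∷ 3 ∷ 6 ∷ 5 ∷ 3 ∷ 3 ∷ 4 ∷ 5 ∷ 5 ∷ 0 ∷ 0 ∷ []) ∷
  (22 , 11 , 0 ∷ 4 ∷ 1 ∷ 6 ∷ 2 ∷ 1 ∷ 0 ∷ 6 ∷ 4 ∷ 4 ∷ 2 ∷ 5 ∷ 1 ∷ 3 ∷ 6 ∷ 5 ∷ 4 ∷ 3 ∷ 3 ∷ 2 ∷ 2 ∷ 0 ∷ 0 ∷ []) ∷
  (22 , 12 , 0 ∷ 4 ∷ 1 ∷ 6 ∷ 2 ∷ 1 ∷ 0 ∷ 6 ∷ 4 ∷ 4 ∷ 2 ∷ 5 ∷ 3 ∷ 3 ∷ 6 ∷ 5 ∷ 4 ∷ 3 ∷ 1 ∷ 1 ∷ 5 ∷ 0 ∷ 0 ∷ []) ∷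
  (22 , 13 , 0 ∷ 4 ∷ 1 ∷ 6 ∷ 2 ∷ 1 ∷ 0 ∷ 6 ∷ 4 ∷ 4 ∷ 2 ∷ 5 ∷ 1 ∷ 3 ∷ 6 ∷ 5 ∷ 3 ∷ 3 ∷ 4 ∷ 5 ∷ 5 ∷ 0 ∷ 0 ∷ []) ∷
  (22 , 14 , 0 ∷ 4 ∷ 1 ∷ 6 ∷ 2 ∷ 1 ∷ 0 ∷ 6 ∷ 4 ∷ 4 ∷ 2 ∷ 5 ∷ 1 ∷ 3 ∷ 0 ∷ 5 ∷ 3 ∷ 6 ∷ 5 ∷ 4 ∷ 3 ∷ 2 ∷ 0 ∷ []) ∷
  (22 , 15 , 0 ∷ 4 ∷ 1 ∷ 6 ∷ 2 ∷ 1 ∷ 0 ∷ 6 ∷ 4 ∷ 4 ∷ 2 ∷ 5 ∷ 1 ∷ 3 ∷ 6 ∷ 5 ∷ 4 ∷ 3 ∷ 3 ∷ 2 ∷ 2 ∷ 0 ∷ 0 ∷ []) ∷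
  (22 , 16 , 0 ∷ 4 ∷ 1 ∷ 6 ∷ 2 ∷ 1 ∷ 0 ∷ 6 ∷ 4 ∷ 4 ∷ 2 ∷ 5 ∷ 1 ∷ 3 ∷ 6 ∷ 5 ∷ 3 ∷ 3 ∷ 4 ∷ 5 ∷ 5 ∷ 0 ∷ 0 ∷ []) ∷
  (22 , 17 , 0 ∷ 4 ∷ 1 ∷ 6 ∷ 2 ∷ 1 ∷ 0 ∷ 6 ∷ 4 ∷ 4 ∷ 2 ∷ 5 ∷ 1 ∷ 3 ∷ 6 ∷ 5 ∷ 3 ∷ 0 ∷ 5 ∷ 4 ∷ 3 ∷ 2 ∷ 0 ∷ []) ∷
  (22 , 18 , 0 ∷ 4 ∷ 1 ∷ 6 ∷ 2 ∷ 1 ∷ 0 ∷ 6 ∷ 4 ∷ 4 ∷ 2 ∷ 5 ∷ 1 ∷ 3 ∷ 6 ∷ 5 ∷ 3 ∷ 2 ∷ 0 ∷ 5 ∷ 4 ∷ 3 ∷ 0 ∷ []) ∷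
  (22 , 19 , 0 ∷ 4 ∷ 1 ∷ 6 ∷ 2 ∷ 1 ∷ 0 ∷ 6 ∷ 4 ∷ 4 ∷ 2 ∷ 5 ∷ 1 ∷ 3 ∷ 6 ∷ 5 ∷ 3 ∷ 4 ∷ 5 ∷ 0 ∷ 3 ∷ 2 ∷ 0 ∷ []) ∷
  (23 , 2 , 0 ∷ 4 ∷ 1 ∷ 6 ∷ 2 ∷ 1 ∷ 5 ∷ 6 ∷ 4 ∷ 4 ∷ 2 ∷ 5 ∷ 3 ∷ 3 ∷ 6 ∷ 0 ∷ 2 ∷ 2 ∷ 3 ∷ 4 ∷ 5 ∷ 5 ∷ 0 ∷ 0 ∷ []) ∷
  (23 , 3 , 0 ∷ 4 ∷ 1 ∷ 6 ∷ 2 ∷ 1 ∷ 0 ∷ 5 ∷ 4 ∷ 4 ∷ 2 ∷ 5 ∷ 1 ∷ 3 ∷ 6 ∷ 6 ∷ 5 ∷ 5 ∷ 3 ∷ 3 ∷ 2 ∷ 2 ∷ 0 ∷ 0 ∷ []) ∷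
  (23 , 4 , 0 ∷ 4 ∷ 1 ∷ 6 ∷ 2 ∷ 1 ∷ 0 ∷ 6 ∷ 4 ∷ 4 ∷ 2 ∷ 5 ∷ 1 ∷ 3 ∷ 6 ∷ 6 ∷ 5 ∷ 4 ∷ 3 ∷ 3 ∷ 5 ∷ 5 ∷ 0 ∷ 0 ∷ []) ∷
  (23 , 5 , 0 ∷ 4 ∷ 1 ∷ 6 ∷ 2 ∷ 1 ∷ 5 ∷ 6 ∷ 4 ∷ 4 ∷ 2 ∷ 5 ∷ 3 ∷ 3 ∷ 6 ∷ 0 ∷ 2 ∷ 2 ∷ 3 ∷ 4 ∷ 5 ∷ 5 ∷ 0 ∷ 0 ∷ []) ∷
  (23 , 6 , 0 ∷ 4 ∷ 1 ∷ 6 ∷ 2 ∷ 1 ∷ 0 ∷ 6 ∷ 4 ∷ 4 ∷ 2 ∷ 5 ∷ 1 ∷ 3 ∷ 6 ∷ 5 ∷ 3 ∷ 0 ∷ 5 ∷ 4 ∷ 3 ∷ 3 ∷ 2 ∷ 0 ∷ []) ∷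
  (23 , 7 , 0 ∷ 4 ∷ 1 ∷ 6 ∷ 2 ∷ 1 ∷ 5 ∷ 2 ∷ 4 ∷ 3 ∷ 1 ∷ 1 ∷ 0 ∷ 6 ∷ 3 ∷ 3 ∷ 5 ∷ 6 ∷ 4 ∷ 4 ∷ 5 ∷ 5 ∷ 0 ∷ 0 ∷ []) ∷
  (23 , 8 , 0 ∷ 4 ∷ 1 ∷ 6 ∷ 2 ∷ 1 ∷ 0 ∷ 6 ∷ 3 ∷ 4 ∷ 2 ∷ 5 ∷ 1 ∷ 3 ∷ 3 ∷ 5 ∷ 5 ∷ 6 ∷ 6 ∷ 4 ∷ 4 ∷ 5 ∷ 0 ∷ 0 ∷ []) ∷
  (23 , 9 , 0 ∷ 4 ∷ 1 ∷ 6 ∷ 2 ∷ 1 ∷ 0 ∷ 6 ∷ 4 ∷ 3 ∷ 2 ∷ 4 ∷ 5 ∷ 1 ∷ 1 ∷ 3 ∷ 3 ∷ 6 ∷ 5 ∷ 5 ∷ 2 ∷ 2 ∷ 0 ∷ 0 ∷ []) ∷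
  (23 , 10 , 0 ∷ 4 ∷ 1 ∷ 6 ∷ 2 ∷ 1 ∷ 0 ∷ 6 ∷ 4 ∷ 4 ∷ 2 ∷ 5 ∷ 1 ∷ 3 ∷ 6 ∷ 6 ∷ 5 ∷ 4 ∷ 3 ∷ 3 ∷ 5 ∷ 5 ∷ 0 ∷ 0 ∷ []) ∷
  (23 , 11 , 0 ∷ 4 ∷ 1 ∷ 6 ∷ 2 ∷ 1 ∷ 0 ∷ 6 ∷ 4 ∷ 4 ∷ 2 ∷ 5 ∷ 1 ∷ 3 ∷ 6 ∷ 5 ∷ 5 ∷ 4 ∷ 3 ∷ 3 ∷ 2 ∷ 2 ∷ 0 ∷ 0 ∷ []) ∷
  (23 , 12 , 0 ∷ 4 ∷ 1 ∷ 6 ∷ 2 ∷ 1 ∷ 0 ∷ 6 ∷ 4 ∷ 4 ∷ 2 ∷ 5 ∷ 3 ∷ 3 ∷ 6 ∷ 5 ∷ 4 ∷ 3 ∷ 1 ∷ 1 ∷ 5 ∷ 5 ∷ 0 ∷ 0 ∷ []) ∷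
  (23 , 13 , 0 ∷ 4 ∷ 1 ∷ 6 ∷ 2 ∷ 1 ∷ 0 ∷ 6 ∷ 4 ∷ 4 ∷ 2 ∷ 5 ∷ 1 ∷ 3 ∷ 6 ∷ 5 ∷ 5 ∷ 4 ∷ 3 ∷ 3 ∷ 2 ∷ 2 ∷ 0 ∷ 0 ∷ []) ∷
  (23 , 14 , 0 ∷ 4 ∷ 1 ∷ 6 ∷ 2 ∷ 1 ∷ 0 ∷ 6 ∷ 4 ∷ 4 ∷ 2 ∷ 5 ∷ 1 ∷ 3 ∷ 0 ∷ 5 ∷ 3 ∷ 6 ∷ 5 ∷ 4 ∷ 3 ∷ 3 ∷ 2 ∷ 0 ∷ []) ∷
  (23 , 15 , 0 ∷ 4 ∷ 1 ∷ 6 ∷ 2 ∷ 1 ∷ 0 ∷ 6 ∷ 4 ∷ 4 ∷ 2 ∷ 5 ∷ 1 ∷ 3 ∷ 6 ∷ 5 ∷ 5 ∷ 4 ∷ 3 ∷ 3 ∷ 2 ∷ 2 ∷ 0 ∷ 0 ∷ []) ∷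
  (23 , 16 , 0 ∷ 4 ∷ 1 ∷ 6 ∷ 2 ∷ 1 ∷ 0 ∷ 6 ∷ 4 ∷ 4 ∷ 2 ∷ 5 ∷ 1 ∷ 3 ∷ 6 ∷ 5 ∷ 5 ∷ 4 ∷ 3 ∷ 3 ∷ 2 ∷ 2 ∷ 0 ∷ 0 ∷ []) ∷
  (23 , 17 , 0 ∷ 4 ∷ 1 ∷ 6 ∷ 2 ∷ 1 ∷ 0 ∷ 6 ∷ 4 ∷ 4 ∷ 2 ∷ 5 ∷ 1 ∷ 3 ∷ 6 ∷ 5 ∷ 3 ∷ 0 ∷ 5 ∷ 4 ∷ 3 ∷ 3 ∷ 2 ∷ 0 ∷ []) ∷
  (23 , 18 , 0 ∷ 4 ∷ 1 ∷ 6 ∷ 2 ∷ 1 ∷ 0 ∷ 6 ∷ 4 ∷ 4 ∷ 2 ∷ 5 ∷ 1 ∷ 3 ∷ 6 ∷ 5 ∷ 3 ∷ 2 ∷ 0 ∷ 5 ∷ 4 ∷ 3 ∷ 3 ∷ 0 ∷ []) ∷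
  (23 , 19 , 0 ∷ 4 ∷ 1 ∷ 6 ∷ 2 ∷ 1 ∷ 0 ∷ 6 ∷ 4 ∷ 4 ∷ 2 ∷ 5 ∷ 1 ∷ 3 ∷ 6 ∷ 5 ∷ 3 ∷ 2 ∷ 2 ∷ 0 ∷ 3 ∷ 4 ∷ 5 ∷ 0 ∷ []) ∷
  (23 , 20 , 0 ∷ 4 ∷ 1 ∷ 6 ∷ 2 ∷ 1 ∷ 0 ∷ 6 ∷ 4 ∷ 4 ∷ 2 ∷ 5 ∷ 1 ∷ 3 ∷ 6 ∷ 5 ∷ 3 ∷ 3 ∷ 4 ∷ 5 ∷ 0 ∷ 2 ∷ 3 ∷ 0 ∷ []) ∷
  (24 , 2 , 0 ∷ 4 ∷ 1 ∷ 6 ∷ 2 ∷ 1 ∷ 5 ∷ 6 ∷ 4 ∷ 4 ∷ 2 ∷ 5 ∷ 3 ∷ 3 ∷ 6 ∷ 6 ∷ 0 ∷ 0 ∷ 5 ∷ 5 ∷ 4 ∷ 3 ∷ 2 ∷ 2 ∷ 0 ∷ []) ∷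
  (24 , 3 , 0 ∷ 4 ∷ 1 ∷ 6 ∷ 2 ∷ 1 ∷ 0 ∷ 5 ∷ 4 ∷ 4 ∷ 2 ∷ 5 ∷ 1 ∷ 3 ∷ 5 ∷ 5 ∷ 6 ∷ 6 ∷ 4 ∷ 3 ∷ 3 ∷ 2 ∷ 2 ∷ 0 ∷ 0 ∷ []) ∷
  (24 , 4 , 0 ∷ 4 ∷ 1 ∷ 6 ∷ 2 ∷ 1 ∷ 0 ∷ 6 ∷ 4 ∷ 4 ∷ 2 ∷ 5 ∷ 1 ∷ 1 ∷ 3 ∷ 4 ∷ 5 ∷ 3 ∷ 3 ∷ 6 ∷ 6 ∷ 5 ∷ 5 ∷ 0 ∷ 0 ∷ []) ∷
  (24 , 5 , 0 ∷ 4 ∷ 1 ∷ 6 ∷ 2 ∷ 1 ∷ 5 ∷ 6 ∷ 4 ∷ 4 ∷ 2 ∷ 5 ∷ 3 ∷ 3 ∷ 6 ∷ 6 ∷ 0 ∷ 0 ∷ 5 ∷ 5 ∷ 4 ∷ 3 ∷ 2 ∷ 2 ∷ 0 ∷ []) ∷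
  (24 , 6 , 0 ∷ 4 ∷ 1 ∷ 6 ∷ 2 ∷ 1 ∷ 0 ∷ 6 ∷ 4 ∷ 4 ∷ 2 ∷ 5 ∷ 1 ∷ 3 ∷ 6 ∷ 5 ∷ 3 ∷ 0 ∷ 5 ∷ 4 ∷ 3 ∷ 3 ∷ 2 ∷ 2 ∷ 0 ∷ []) ∷
  (24 , 7 , 0 ∷ 4 ∷ 1 ∷ 6 ∷ 2 ∷ 1 ∷ 5 ∷ 2 ∷ 4 ∷ 3 ∷ 1 ∷ 1 ∷ 0 ∷ 6 ∷ 3 ∷ 3 ∷ 5 ∷ 6 ∷ 6 ∷ 4 ∷ 4 ∷ 5 ∷ 5 ∷ 0 ∷ 0 ∷ []) ∷
  (24 , 8 , 0 ∷ 4 ∷ 1 ∷ 6 ∷ 2 ∷ 1 ∷ 0 ∷ 6 ∷ 3 ∷ 4 ∷ 2 ∷ 5 ∷ 1 ∷ 1 ∷ 3 ∷ 3 ∷ 5 ∷ 6 ∷ 6 ∷ 4 ∷ 4 ∷ 5 ∷ 5 ∷ 0 ∷ 0 ∷ []) ∷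
  (24 , 9 , 0 ∷ 4 ∷ 1 ∷ 6 ∷ 2 ∷ 1 ∷ 0 ∷ 6 ∷ 4 ∷ 3 ∷ 2 ∷ 4 ∷ 5 ∷ 1 ∷ 1 ∷ 3 ∷ 3 ∷ 6 ∷ 6 ∷ 5 ∷ 5 ∷ 2 ∷ 2 ∷ 0 ∷ 0 ∷ []) ∷
  (24 , 10 , 0 ∷ 4 ∷ 1 ∷ 6 ∷ 2 ∷ 1 ∷ 0 ∷ 6 ∷ 4 ∷ 4 ∷ 2 ∷ 5 ∷ 1 ∷ 1 ∷ 3 ∷ 4 ∷ 5 ∷ 3 ∷ 3 ∷ 6 ∷ 6 ∷ 5 ∷ 5 ∷ 0 ∷ 0 ∷ []) ∷
  (24 , 11 , 0 ∷ 4 ∷ 1 ∷ 6 ∷ 2 ∷ 1 ∷ 0 ∷ 6 ∷ 4 ∷ 4 ∷ 2 ∷ 5 ∷ 1 ∷ 3 ∷ 6 ∷ 6 ∷ 5 ∷ 5 ∷ 4 ∷ 3 ∷ 3 ∷ 2 ∷ 2 ∷ 0 ∷ 0 ∷ []) ∷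
  (24 , 12 , 0 ∷ 4 ∷ 1 ∷ 6 ∷ 2 ∷ 1 ∷ 0 ∷ 6 ∷ 4 ∷ 4 ∷ 2 ∷ 5 ∷ 3 ∷ 3 ∷ 6 ∷ 6 ∷ 5 ∷ 5 ∷ 4 ∷ 3 ∷ 1 ∷ 1 ∷ 5 ∷ 0 ∷ 0 ∷ []) ∷
  (24 , 13 , 0 ∷ 4 ∷ 1 ∷ 6 ∷ 2 ∷ 1 ∷ 0 ∷ 6 ∷ 4 ∷ 4 ∷ 2 ∷ 5 ∷ 1 ∷ 3 ∷ 6 ∷ 6 ∷ 5 ∷ 5 ∷ 4 ∷ 3 ∷ 3 ∷ 2 ∷ 2 ∷ 0 ∷ 0 ∷ []) ∷
  (24 , 14 , 0 ∷ 4 ∷ 1 ∷ 6 ∷ 2 ∷ 1 ∷ 0 ∷ 6 ∷ 4 ∷ 4 ∷ 2 ∷ 5 ∷ 1 ∷ 3 ∷ 0 ∷ 5 ∷ 3 ∷ 6 ∷ 5 ∷ 4 ∷ 3 ∷ 3 ∷ 2 ∷ 2 ∷ 0 ∷ []) ∷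
  (24 , 15 , 0 ∷ 4 ∷ 1 ∷ 6 ∷ 2 ∷ 1 ∷ 0 ∷ 6 ∷ 4 ∷ 4 ∷ 2 ∷ 5 ∷ 1 ∷ 3 ∷ 5 ∷ 0 ∷ 3 ∷ 6 ∷ 5 ∷ 5 ∷ 4 ∷ 3 ∷ 3 ∷ 2 ∷ 0 ∷ []) ∷
  (24 , 16 , 0 ∷ 4 ∷ 1 ∷ 6 ∷ 2 ∷ 1 ∷ 0 ∷ 6 ∷ 4 ∷ 4 ∷ 2 ∷ 5 ∷ 1 ∷ 3 ∷ 6 ∷ 5 ∷ 0 ∷ 2 ∷ 3 ∷ 4 ∷ 5 ∷ 5 ∷ 3 ∷ 3 ∷ 0 ∷ []) ∷
  (24 , 17 , 0 ∷ 4 ∷ 1 ∷ 6 ∷ 2 ∷ 1 ∷ 0 ∷ 6 ∷ 4 ∷ 4 ∷ 2 ∷ 5 ∷ 1 ∷ 3 ∷ 6 ∷ 5 ∷ 3 ∷ 0 ∷ 5 ∷ 4 ∷ 3 ∷ 3 ∷ 2 ∷ 2 ∷ 0 ∷ []) ∷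
  (24 , 18 , 0 ∷ 4 ∷ 1 ∷ 6 ∷ 2 ∷ 1 ∷ 0 ∷ 6 ∷ 4 ∷ 4 ∷ 2 ∷ 5 ∷ 1 ∷ 3 ∷ 6 ∷ 5 ∷ 3 ∷ 2 ∷ 0 ∷ 5 ∷ 5 ∷ 4 ∷ 3 ∷ 3 ∷ 0 ∷ []) ∷
  (24 , 19 , 0 ∷ 4 ∷ 1 ∷ 6 ∷ 2 ∷ 1 ∷ 0 ∷ 6 ∷ 4 ∷ 4 ∷ 2 ∷ 5 ∷ 1 ∷ 3 ∷ 6 ∷ 5 ∷ 3 ∷ 2 ∷ 2 ∷ 0 ∷ 3 ∷ 4 ∷ 5 ∷ 5 ∷ 0 ∷ []) ∷
  (24 , 20 , 0 ∷ 4 ∷ 1 ∷ 6 ∷ 2 ∷ 1 ∷ 0 ∷ 6 ∷ 4 ∷ 4 ∷ 2 ∷ 5 ∷ 1 ∷ 3 ∷ 6 ∷ 5 ∷ 3 ∷ 3 ∷ 4 ∷ 5 ∷ 0 ∷ 2 ∷ 2 ∷ 3 ∷ 0 ∷ []) ∷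
  (24 , 21 , 0 ∷ 4 ∷ 1 ∷ 6 ∷ 2 ∷ 1 ∷ 0 ∷ 6 ∷ 4 ∷ 4 ∷ 2 ∷ 5 ∷ 1 ∷ 3 ∷ 6 ∷ 5 ∷ 3 ∷ 3 ∷ 4 ∷ 5 ∷ 5 ∷ 0 ∷ 3 ∷ 2 ∷ 0 ∷ []) ∷
  (25 , 2 , 0 ∷ 3 ∷ 1 ∷ 1 ∷ 6 ∷ 3 ∷ 4 ∷ 5 ∷ 6 ∷ 6 ∷ 4 ∷ 0 ∷ 5 ∷ 2 ∷ 2 ∷ 4 ∷ 4 ∷ 1 ∷ 5 ∷ 5 ∷ 3 ∷ 3 ∷ 2 ∷ 6 ∷ 0 ∷ 0 ∷ []) ∷
  (25 , 3 , 0 ∷ 4 ∷ 1 ∷ 6 ∷ 2 ∷ 1 ∷ 0 ∷ 5 ∷ 4 ∷ 4 ∷ 2 ∷ 5 ∷ 1 ∷ 1 ∷ 3 ∷ 3 ∷ 4 ∷ 6 ∷ 6 ∷ 5 ∷ 5 ∷ 3 ∷ 2 ∷ 2 ∷ 0 ∷ 0 ∷ []) ∷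
  (25 , 4 , 0 ∷ 4 ∷ 1 ∷ 6 ∷ 2 ∷ 1 ∷ 0 ∷ 6 ∷ 4 ∷ 4 ∷ 2 ∷ 2 ∷ 3 ∷ 4 ∷ 5 ∷ 3 ∷ 6 ∷ 6 ∷ 5 ∷ 5 ∷ 1 ∷ 1 ∷ 3 ∷ 3 ∷ 0 ∷ 0 ∷ []) ∷
  (25 , 5 , 0 ∷ 2 ∷ 1 ∷ 5 ∷ 3 ∷ 4 ∷ 2 ∷ 6 ∷ 0 ∷ 0 ∷ 3 ∷ 1 ∷ 1 ∷ 4 ∷ 4 ∷ 6 ∷ 5 ∷ 5 ∷ 2 ∷ 2 ∷ 3 ∷ 3 ∷ 6 ∷ 6 ∷ 1 ∷ 0 ∷ []) ∷
  (25 , 6 , 0 ∷ 4 ∷ 1 ∷ 6 ∷ 2 ∷ 1 ∷ 0 ∷ 6 ∷ 4 ∷ 4 ∷ 2 ∷ 5 ∷ 1 ∷ 3 ∷ 6 ∷ 5 ∷ 3 ∷ 0 ∷ 5 ∷ 5 ∷ 4 ∷ 3 ∷ 3 ∷ 2 ∷ 2 ∷ 0 ∷ []) ∷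
  (25 , 7 , 0 ∷ 3 ∷ 1 ∷ 1 ∷ 6 ∷ 3 ∷ 4 ∷ 5 ∷ 6 ∷ 6 ∷ 4 ∷ 0 ∷ 6 ∷ 2 ∷ 2 ∷ 1 ∷ 4 ∷ 4 ∷ 2 ∷ 3 ∷ 3 ∷ 5 ∷ 5 ∷ 1 ∷ 0 ∷ 0 ∷ []) ∷
  (25 , 8 , 0 ∷ 4 ∷ 1 ∷ 6 ∷ 2 ∷ 1 ∷ 0 ∷ 6 ∷ 3 ∷ 4 ∷ 2 ∷ 5 ∷ 6 ∷ 6 ∷ 4 ∷ 4 ∷ 5 ∷ 5 ∷ 1 ∷ 1 ∷ 3 ∷ 3 ∷ 2 ∷ 2 ∷ 0 ∷ 0 ∷ []) ∷
  (25 , 9 , 0 ∷ 4 ∷ 1 ∷ 6 ∷ 2 ∷ 1 ∷ 0 ∷ 6 ∷ 4 ∷ 3 ∷ 2 ∷ 4 ∷ 4 ∷ 5 ∷ 1 ∷ 1 ∷ 3 ∷ 3 ∷ 6 ∷ 6 ∷ 5 ∷ 5 ∷ 2 ∷ 2 ∷ 0 ∷ 0 ∷ []) ∷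
  (25 , 10 , 0 ∷ 4 ∷ 1 ∷ 6 ∷ 2 ∷ 1 ∷ 0 ∷ 6 ∷ 4 ∷ 4 ∷ 2 ∷ 2 ∷ 3 ∷ 4 ∷ 5 ∷ 3 ∷ 6 ∷ 6 ∷ 5 ∷ 5 ∷ 1 ∷ 1 ∷ 3 ∷ 3 ∷ 0 ∷ 0 ∷ []) ∷
  (25 , 11 , 0 ∷ 4 ∷ 1 ∷ 6 ∷ 2 ∷ 1 ∷ 0 ∷ 6 ∷ 4 ∷ 4 ∷ 2 ∷ 5 ∷ 1 ∷ 1 ∷ 3 ∷ 3 ∷ 6 ∷ 6 ∷ 5 ∷ 5 ∷ 4 ∷ 3 ∷ 2 ∷ 2 ∷ 0 ∷ 0 ∷ []) ∷
  (25 , 12 , 0 ∷ 4 ∷ 1 ∷ 6 ∷ 2 ∷ 1 ∷ 0 ∷ 6 ∷ 4 ∷ 4 ∷ 2 ∷ 5 ∷ 5 ∷ 1 ∷ 1 ∷ 3 ∷ 3 ∷ 4 ∷ 5 ∷ 6 ∷ 6 ∷ 3 ∷ 2 ∷ 2 ∷ 0 ∷ 0 ∷ []) ∷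
  (25 , 13 , 0 ∷ 4 ∷ 1 ∷ 6 ∷ 2 ∷ 1 ∷ 0 ∷ 6 ∷ 4 ∷ 4 ∷ 2 ∷ 5 ∷ 3 ∷ 0 ∷ 2 ∷ 3 ∷ 1 ∷ 5 ∷ 4 ∷ 3 ∷ 3 ∷ 6 ∷ 6 ∷ 5 ∷ 5 ∷ 0 ∷ []) ∷
  (25 , 14 , 0 ∷ 4 ∷ 1 ∷ 6 ∷ 2 ∷ 1 ∷ 0 ∷ 6 ∷ 4 ∷ 4 ∷ 2 ∷ 5 ∷ 1 ∷ 3 ∷ 0 ∷ 5 ∷ 3 ∷ 6 ∷ 5 ∷ 5 ∷ 4 ∷ 3 ∷ 3 ∷ 2 ∷ 2 ∷ 0 ∷ []) ∷
  (25 , 15 , 0 ∷ 4 ∷ 1 ∷ 6 ∷ 2 ∷ 1 ∷ 0 ∷ 6 ∷ 4 ∷ 4 ∷ 2 ∷ 5 ∷ 1 ∷ 3 ∷ 5 ∷ 0 ∷ 3 ∷ 6 ∷ 5 ∷ 5 ∷ 4 ∷ 3 ∷ 3 ∷ 2 ∷ 2 ∷ 0 ∷ []) ∷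
  (25 , 16 , 0 ∷ 4 ∷ 1 ∷ 6 ∷ 2 ∷ 1 ∷ 0 ∷ 6 ∷ 4 ∷ 4 ∷ 2 ∷ 5 ∷ 1 ∷ 3 ∷ 6 ∷ 5 ∷ 0 ∷ 3 ∷ 5 ∷ 5 ∷ 4 ∷ 3 ∷ 3 ∷ 2 ∷ 2 ∷ 0 ∷ []) ∷
  (25 , 17 , 0 ∷ 4 ∷ 1 ∷ 6 ∷ 2 ∷ 1 ∷ 0 ∷ 6 ∷ 4 ∷ 4 ∷ 2 ∷ 5 ∷ 1 ∷ 3 ∷ 6 ∷ 5 ∷ 3 ∷ 0 ∷ 5 ∷ 5 ∷ 4 ∷ 3 ∷ 3 ∷ 2 ∷ 2 ∷ 0 ∷ []) ∷
  (25 , 18 , 0 ∷ 4 ∷ 1 ∷ 6 ∷ 2 ∷ 1 ∷ 0 ∷ 6 ∷ 4 ∷ 4 ∷ 2 ∷ 5 ∷ 1 ∷ 3 ∷ 6 ∷ 5 ∷ 3 ∷ 3 ∷ 0 ∷ 2 ∷ 2 ∷ 3 ∷ 4 ∷ 5 ∷ 5 ∷ 0 ∷ []) ∷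
  (25 , 19 , 0 ∷ 4 ∷ 1 ∷ 6 ∷ 2 ∷ 1 ∷ 0 ∷ 6 ∷ 4 ∷ 4 ∷ 2 ∷ 5 ∷ 1 ∷ 3 ∷ 6 ∷ 5 ∷ 3 ∷ 2 ∷ 2 ∷ 0 ∷ 3 ∷ 3 ∷ 4 ∷ 5 ∷ 5 ∷ 0 ∷ []) ∷
  (25 , 20 , 0 ∷ 4 ∷ 1 ∷ 6 ∷ 2 ∷ 1 ∷ 0 ∷ 6 ∷ 4 ∷ 4 ∷ 2 ∷ 5 ∷ 1 ∷ 3 ∷ 6 ∷ 5 ∷ 3 ∷ 3 ∷ 2 ∷ 2 ∷ 0 ∷ 5 ∷ 5 ∷ 4 ∷ 3 ∷ 0 ∷ []) ∷
  (25 , 21 , 0 ∷ 4 ∷ 1 ∷ 6 ∷ 2 ∷ 1 ∷ 0 ∷ 6 ∷ 4 ∷ 4 ∷ 2 ∷ 5 ∷ 1 ∷ 3 ∷ 6 ∷ 5 ∷ 3 ∷ 3 ∷ 4 ∷ 5 ∷ 5 ∷ 0 ∷ 3 ∷ 2 ∷ 2 ∷ 0 ∷ []) ∷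
  (25 , 22 , 0 ∷ 4 ∷ 1 ∷ 6 ∷ 2 ∷ 1 ∷ 0 ∷ 6 ∷ 4 ∷ 4 ∷ 2 ∷ 5 ∷ 1 ∷ 3 ∷ 6 ∷ 5 ∷ 5 ∷ 4 ∷ 3 ∷ 3 ∷ 2 ∷ 2 ∷ 0 ∷ 5 ∷ 3 ∷ 0 ∷ []) ∷
  (26 , 3 , 0 ∷ 6 ∷ 4 ∷ 0 ∷ 3 ∷ 6 ∷ 2 ∷ 5 ∷ 6 ∷ 6 ∷ 1 ∷ 0 ∷ 2 ∷ 3 ∷ 5 ∷ 1 ∷ 1 ∷ 4 ∷ 2 ∷ 2 ∷ 1 ∷ 3 ∷ 3 ∷ 4 ∷ 5 ∷ 5 ∷ 0 ∷ []) ∷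
  (26 , 4 , 0 ∷ 2 ∷ 1 ∷ 5 ∷ 0 ∷ 3 ∷ 4 ∷ 2 ∷ 6 ∷ 0 ∷ 4 ∷ 6 ∷ 5 ∷ 2 ∷ 3 ∷ 6 ∷ 6 ∷ 1 ∷ 3 ∷ 3 ∷ 5 ∷ 5 ∷ 4 ∷ 4 ∷ 1 ∷ 1 ∷ 0 ∷ []) ∷
  (26 , 5 , 0 ∷ 5 ∷ 4 ∷ 3 ∷ 3 ∷ 0 ∷ 1 ∷ 6 ∷ 6 ∷ 0 ∷ 2 ∷ 5 ∷ 1 ∷ 2 ∷ 4 ∷ 1 ∷ 3 ∷ 6 ∷ 5 ∷ 5 ∷ 3 ∷ 2 ∷ 2 ∷ 6 ∷ 4 ∷ 4 ∷ 0 ∷ []) ∷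
  (26 , 6 , 0 ∷ 4 ∷ 1 ∷ 6 ∷ 2 ∷ 1 ∷ 0 ∷ 6 ∷ 4 ∷ 4 ∷ 2 ∷ 5 ∷ 1 ∷ 3 ∷ 6 ∷ 6 ∷ 5 ∷ 3 ∷ 0 ∷ 2 ∷ 2 ∷ 3 ∷ 3 ∷ 4 ∷ 5 ∷ 5 ∷ 0 ∷ []) ∷
  (26 , 7 , 0 ∷ 1 ∷ 2 ∷ 3 ∷ 6 ∷ 1 ∷ 5 ∷ 0 ∷ 4 ∷ 6 ∷ 5 ∷ 4 ∷ 3 ∷ 1 ∷ 1 ∷ 4 ∷ 2 ∷ 2 ∷ 6 ∷ 6 ∷ 0 ∷ 2 ∷ 5 ∷ 5 ∷ 3 ∷ 3 ∷ 0 ∷ []) ∷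
  (26 , 8 , 0 ∷ 6 ∷ 3 ∷ 5 ∷ 2 ∷ 2 ∷ 3 ∷ 3 ∷ 0 ∷ 5 ∷ 1 ∷ 6 ∷ 2 ∷ 4 ∷ 6 ∷ 6 ∷ 5 ∷ 5 ∷ 4 ∷ 3 ∷ 1 ∷ 2 ∷ 0 ∷ 4 ∷ 4 ∷ 1 ∷ 0 ∷ []) ∷
  (26 , 9 , 0 ∷ 2 ∷ 1 ∷ 5 ∷ 0 ∷ 3 ∷ 4 ∷ 2 ∷ 6 ∷ 0 ∷ 4 ∷ 6 ∷ 5 ∷ 2 ∷ 3 ∷ 6 ∷ 6 ∷ 1 ∷ 3 ∷ 3 ∷ 5 ∷ 5 ∷ 4 ∷ 4 ∷ 1 ∷ 1 ∷ 0 ∷ []) ∷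
  (26 , 10 , 0 ∷ 3 ∷ 1 ∷ 1 ∷ 6 ∷ 3 ∷ 4 ∷ 5 ∷ 6 ∷ 6 ∷ 0 ∷ 1 ∷ 4 ∷ 0 ∷ 5 ∷ 5 ∷ 2 ∷ 3 ∷ 5 ∷ 1 ∷ 2 ∷ 6 ∷ 4 ∷ 4 ∷ 2 ∷ 2 ∷ 0 ∷ []) ∷
  (26 , 11 , 0 ∷ 4 ∷ 1 ∷ 6 ∷ 2 ∷ 1 ∷ 0 ∷ 6 ∷ 4 ∷ 4 ∷ 2 ∷ 0 ∷ 5 ∷ 2 ∷ 2 ∷ 3 ∷ 1 ∷ 5 ∷ 3 ∷ 4 ∷ 5 ∷ 5 ∷ 6 ∷ 6 ∷ 3 ∷ 3 ∷ 0 ∷ []) ∷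
  (26 , 12 , 0 ∷ 4 ∷ 1 ∷ 6 ∷ 2 ∷ 1 ∷ 0 ∷ 6 ∷ 4 ∷ 4 ∷ 2 ∷ 5 ∷ 0 ∷ 2 ∷ 2 ∷ 3 ∷ 1 ∷ 5 ∷ 4 ∷ 3 ∷ 6 ∷ 6 ∷ 5 ∷ 5 ∷ 3 ∷ 3 ∷ 0 ∷ []) ∷
  (26 , 13 , 0 ∷ 4 ∷ 1 ∷ 6 ∷ 2 ∷ 1 ∷ 0 ∷ 6 ∷ 4 ∷ 4 ∷ 2 ∷ 5 ∷ 3 ∷ 0 ∷ 5 ∷ 6 ∷ 6 ∷ 3 ∷ 4 ∷ 5 ∷ 5 ∷ 1 ∷ 1 ∷ 3 ∷ 3 ∷ 2 ∷ 0 ∷ []) ∷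
  (26 , 14 , 0 ∷ 4 ∷ 1 ∷ 6 ∷ 2 ∷ 1 ∷ 0 ∷ 6 ∷ 4 ∷ 4 ∷ 2 ∷ 5 ∷ 1 ∷ 3 ∷ 0 ∷ 5 ∷ 3 ∷ 6 ∷ 6 ∷ 5 ∷ 5 ∷ 4 ∷ 3 ∷ 3 ∷ 2 ∷ 2 ∷ 0 ∷ []) ∷
  (26 , 15 , 0 ∷ 4 ∷ 1 ∷ 6 ∷ 2 ∷ 1 ∷ 0 ∷ 6 ∷ 4 ∷ 4 ∷ 2 ∷ 5 ∷ 1 ∷ 3 ∷ 5 ∷ 0 ∷ 2 ∷ 2 ∷ 3 ∷ 6 ∷ 6 ∷ 5 ∷ 5 ∷ 4 ∷ 3 ∷ 3 ∷ 0 ∷ []) ∷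
  (26 , 16 , 0 ∷ 4 ∷ 1 ∷ 6 ∷ 2 ∷ 1 ∷ 0 ∷ 6 ∷ 4 ∷ 4 ∷ 2 ∷ 5 ∷ 1 ∷ 3 ∷ 5 ∷ 5 ∷ 0 ∷ 2 ∷ 2 ∷ 3 ∷ 4 ∷ 5 ∷ 6 ∷ 6 ∷ 3 ∷ 3 ∷ 0 ∷ []) ∷
  (26 , 17 , 0 ∷ 4 ∷ 1 ∷ 6 ∷ 2 ∷ 1 ∷ 0 ∷ 6 ∷ 4 ∷ 4 ∷ 2 ∷ 5 ∷ 1 ∷ 3 ∷ 6 ∷ 6 ∷ 5 ∷ 0 ∷ 3 ∷ 4 ∷ 5 ∷ 5 ∷ 3 ∷ 3 ∷ 2 ∷ 2 ∷ 0 ∷ []) ∷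
  (26 , 18 , 0 ∷ 4 ∷ 1 ∷ 6 ∷ 2 ∷ 1 ∷ 0 ∷ 6 ∷ 4 ∷ 4 ∷ 2 ∷ 5 ∷ 1 ∷ 3 ∷ 6 ∷ 6 ∷ 5 ∷ 3 ∷ 0 ∷ 5 ∷ 5 ∷ 4 ∷ 3 ∷ 3 ∷ 2 ∷ 2 ∷ 0 ∷ []) ∷
  (26 , 19 , 0 ∷ 4 ∷ 1 ∷ 6 ∷ 2 ∷ 1 ∷ 0 ∷ 6 ∷ 4 ∷ 4 ∷ 2 ∷ 5 ∷ 1 ∷ 3 ∷ 6 ∷ 6 ∷ 5 ∷ 3 ∷ 3 ∷ 0 ∷ 5 ∷ 5 ∷ 4 ∷ 3 ∷ 2 ∷ 2 ∷ 0 ∷ []) ∷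
  (26 , 20 , 0 ∷ 4 ∷ 1 ∷ 6 ∷ 2 ∷ 1 ∷ 0 ∷ 6 ∷ 4 ∷ 4 ∷ 2 ∷ 5 ∷ 1 ∷ 3 ∷ 6 ∷ 6 ∷ 5 ∷ 3 ∷ 2 ∷ 2 ∷ 0 ∷ 5 ∷ 5 ∷ 4 ∷ 3 ∷ 3 ∷ 0 ∷ []) ∷
  (26 , 21 , 0 ∷ 4 ∷ 1 ∷ 6 ∷ 2 ∷ 1 ∷ 0 ∷ 6 ∷ 4 ∷ 4 ∷ 2 ∷ 5 ∷ 1 ∷ 3 ∷ 6 ∷ 6 ∷ 5 ∷ 4 ∷ 3 ∷ 5 ∷ 5 ∷ 0 ∷ 3 ∷ 3 ∷ 2 ∷ 2 ∷ 0 ∷ []) ∷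
  (26 , 22 , 0 ∷ 4 ∷ 1 ∷ 6 ∷ 2 ∷ 1 ∷ 0 ∷ 6 ∷ 4 ∷ 4 ∷ 2 ∷ 5 ∷ 1 ∷ 3 ∷ 6 ∷ 6 ∷ 5 ∷ 4 ∷ 3 ∷ 3 ∷ 2 ∷ 2 ∷ 0 ∷ 3 ∷ 5 ∷ 5 ∷ 0 ∷ []) ∷
  (26 , 23 , 0 ∷ 4 ∷ 1 ∷ 6 ∷ 2 ∷ 1 ∷ 0 ∷ 6 ∷ 4 ∷ 4 ∷ 2 ∷ 5 ∷ 1 ∷ 3 ∷ 6 ∷ 6 ∷ 5 ∷ 5 ∷ 4 ∷ 3 ∷ 3 ∷ 2 ∷ 2 ∷ 0 ∷ 5 ∷ 3 ∷ 0 ∷ []) ∷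
  (27 , 3 , 0 ∷ 6 ∷ 4 ∷ 0 ∷ 3 ∷ 6 ∷ 2 ∷ 5 ∷ 6 ∷ 6 ∷ 1 ∷ 0 ∷ 2 ∷ 3 ∷ 5 ∷ 1 ∷ 1 ∷ 4 ∷ 2 ∷ 2 ∷ 1 ∷ 3 ∷ 3 ∷ 4 ∷ 4 ∷ 5 ∷ 5 ∷ 0 ∷ []) ∷
  (27 , 4 , 0 ∷ 2 ∷ 1 ∷ 5 ∷ 0 ∷ 3 ∷ 4 ∷ 2 ∷ 6 ∷ 0 ∷ 4 ∷ 6 ∷ 5 ∷ 2 ∷ 2 ∷ 3 ∷ 5 ∷ 5 ∷ 4 ∷ 4 ∷ 1 ∷ 6 ∷ 6 ∷ 3 ∷ 3 ∷ 1 ∷ 1 ∷ 0 ∷ []) ∷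
  (27 , 5 , 0 ∷ 5 ∷ 4 ∷ 3 ∷ 3 ∷ 0 ∷ 1 ∷ 6 ∷ 6 ∷ 0 ∷ 2 ∷ 5 ∷ 1 ∷ 2 ∷ 4 ∷ 1 ∷ 1 ∷ 3 ∷ 2 ∷ 2 ∷ 6 ∷ 5 ∷ 5 ∷ 3 ∷ 6 ∷ 4 ∷ 4 ∷ 0 ∷ []) ∷
  (27 , 6 , 0 ∷ 4 ∷ 1 ∷ 6 ∷ 2 ∷ 1 ∷ 0 ∷ 6 ∷ 4 ∷ 4 ∷ 2 ∷ 5 ∷ 1 ∷ 1 ∷ 3 ∷ 2 ∷ 2 ∷ 0 ∷ 3 ∷ 3 ∷ 6 ∷ 6 ∷ 5 ∷ 3 ∷ 4 ∷ 5 ∷ 5 ∷ 0 ∷ []) ∷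
  (27 , 7 , 0 ∷ 1 ∷ 2 ∷ 3 ∷ 6 ∷ 1 ∷ 5 ∷ 0 ∷ 4 ∷ 6 ∷ 5 ∷ 4 ∷ 3 ∷ 1 ∷ 1 ∷ 4 ∷ 4 ∷ 2 ∷ 6 ∷ 6 ∷ 0 ∷ 3 ∷ 3 ∷ 5 ∷ 5 ∷ 2 ∷ 2 ∷ 0 ∷ []) ∷
  (27 , 8 , 0 ∷ 6 ∷ 3 ∷ 5 ∷ 2 ∷ 2 ∷ 3 ∷ 3 ∷ 0 ∷ 5 ∷ 1 ∷ 6 ∷ 2 ∷ 4 ∷ 6 ∷ 6 ∷ 5 ∷ 5 ∷ 4 ∷ 3 ∷ 1 ∷ 2 ∷ 0 ∷ 4 ∷ 4 ∷ 1 ∷ 1 ∷ 0 ∷ []) ∷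
  (27 , 9 , 0 ∷ 2 ∷ 1 ∷ 5 ∷ 0 ∷ 3 ∷ 4 ∷ 2 ∷ 6 ∷ 0 ∷ 4 ∷ 6 ∷ 5 ∷ 2 ∷ 2 ∷ 3 ∷ 5 ∷ 5 ∷ 4 ∷ 4 ∷ 1 ∷ 6 ∷ 6 ∷ 3 ∷ 3 ∷ 1 ∷ 1 ∷ 0 ∷ []) ∷
  (27 , 10 , 0 ∷ 2 ∷ 1 ∷ 5 ∷ 0 ∷ 3 ∷ 4 ∷ 2 ∷ 6 ∷ 1 ∷ 0 ∷ 6 ∷ 3 ∷ 3 ∷ 1 ∷ 1 ∷ 4 ∷ 5 ∷ 5 ∷ 3 ∷ 2 ∷ 2 ∷ 5 ∷ 6 ∷ 6 ∷ 4 ∷ 4 ∷ 0 ∷ []) ∷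
  (27 , 11 , 0 ∷ 4 ∷ 1 ∷ 6 ∷ 2 ∷ 1 ∷ 0 ∷ 6 ∷ 4 ∷ 4 ∷ 2 ∷ 0 ∷ 3 ∷ 3 ∷ 2 ∷ 2 ∷ 5 ∷ 3 ∷ 6 ∷ 6 ∷ 5 ∷ 1 ∷ 1 ∷ 3 ∷ 4 ∷ 5 ∷ 5 ∷ 0 ∷ []) ∷
  (27 , 12 , 0 ∷ 4 ∷ 1 ∷ 6 ∷ 2 ∷ 1 ∷ 0 ∷ 6 ∷ 4 ∷ 4 ∷ 2 ∷ 5 ∷ 0 ∷ 3 ∷ 3 ∷ 5 ∷ 4 ∷ 3 ∷ 1 ∷ 1 ∷ 5 ∷ 5 ∷ 6 ∷ 6 ∷ 3 ∷ 2 ∷ 2 ∷ 0 ∷ []) ∷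
  (27 , 13 , 0 ∷ 4 ∷ 1 ∷ 6 ∷ 2 ∷ 1 ∷ 0 ∷ 6 ∷ 4 ∷ 4 ∷ 2 ∷ 5 ∷ 3 ∷ 0 ∷ 2 ∷ 2 ∷ 3 ∷ 1 ∷ 1 ∷ 5 ∷ 4 ∷ 3 ∷ 3 ∷ 6 ∷ 6 ∷ 5 ∷ 5 ∷ 0 ∷ []) ∷
  (27 , 14 , 0 ∷ 4 ∷ 1 ∷ 6 ∷ 2 ∷ 1 ∷ 0 ∷ 6 ∷ 4 ∷ 4 ∷ 2 ∷ 5 ∷ 3 ∷ 3 ∷ 0 ∷ 5 ∷ 4 ∷ 3 ∷ 6 ∷ 6 ∷ 5 ∷ 5 ∷ 1 ∷ 1 ∷ 3 ∷ 2 ∷ 2 ∷ 0 ∷ []) ∷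
  (27 , 15 , 0 ∷ 4 ∷ 1 ∷ 6 ∷ 2 ∷ 1 ∷ 0 ∷ 6 ∷ 4 ∷ 4 ∷ 2 ∷ 5 ∷ 1 ∷ 1 ∷ 3 ∷ 0 ∷ 5 ∷ 4 ∷ 3 ∷ 6 ∷ 6 ∷ 5 ∷ 5 ∷ 3 ∷ 3 ∷ 2 ∷ 2 ∷ 0 ∷ []) ∷
  (27 , 16 , 0 ∷ 4 ∷ 1 ∷ 6 ∷ 2 ∷ 1 ∷ 0 ∷ 6 ∷ 4 ∷ 4 ∷ 2 ∷ 5 ∷ 1 ∷ 1 ∷ 3 ∷ 3 ∷ 0 ∷ 2 ∷ 2 ∷ 3 ∷ 5 ∷ 6 ∷ 6 ∷ 3 ∷ 4 ∷ 5 ∷ 5 ∷ 0 ∷ []) ∷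
  (27 , 17 , 0 ∷ 4 ∷ 1 ∷ 6 ∷ 2 ∷ 1 ∷ 0 ∷ 6 ∷ 4 ∷ 4 ∷ 2 ∷ 5 ∷ 1 ∷ 1 ∷ 3 ∷ 5 ∷ 5 ∷ 0 ∷ 3 ∷ 4 ∷ 5 ∷ 6 ∷ 6 ∷ 3 ∷ 3 ∷ 2 ∷ 2 ∷ 0 ∷ []) ∷
  (27 , 18 , 0 ∷ 4 ∷ 1 ∷ 6 ∷ 2 ∷ 1 ∷ 0 ∷ 6 ∷ 4 ∷ 4 ∷ 2 ∷ 5 ∷ 1 ∷ 1 ∷ 3 ∷ 4 ∷ 5 ∷ 5 ∷ 0 ∷ 2 ∷ 2 ∷ 3 ∷ 6 ∷ 6 ∷ 5 ∷ 3 ∷ 3 ∷ 0 ∷ []) ∷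
  (27 , 19 , 0 ∷ 4 ∷ 1 ∷ 6 ∷ 2 ∷ 1 ∷ 0 ∷ 6 ∷ 4 ∷ 4 ∷ 2 ∷ 5 ∷ 1 ∷ 1 ∷ 3 ∷ 5 ∷ 5 ∷ 4 ∷ 3 ∷ 0 ∷ 5 ∷ 6 ∷ 6 ∷ 3 ∷ 3 ∷ 2 ∷ 2 ∷ 0 ∷ []) ∷
  (27 , 20 , 0 ∷ 4 ∷ 1 ∷ 6 ∷ 2 ∷ 1 ∷ 0 ∷ 6 ∷ 4 ∷ 4 ∷ 2 ∷ 5 ∷ 1 ∷ 1 ∷ 3 ∷ 3 ∷ 6 ∷ 6 ∷ 5 ∷ 5 ∷ 0 ∷ 3 ∷ 5 ∷ 4 ∷ 3 ∷ 2 ∷ 2 ∷ 0 ∷ []) ∷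
  (27 , 21 , 0 ∷ 4 ∷ 1 ∷ 6 ∷ 2 ∷ 1 ∷ 0 ∷ 6 ∷ 4 ∷ 4 ∷ 2 ∷ 5 ∷ 1 ∷ 1 ∷ 3 ∷ 6 ∷ 6 ∷ 5 ∷ 5 ∷ 3 ∷ 3 ∷ 0 ∷ 5 ∷ 4 ∷ 3 ∷ 2 ∷ 2 ∷ 0 ∷ []) ∷
  (27 , 22 , 0 ∷ 4 ∷ 1 ∷ 6 ∷ 2 ∷ 1 ∷ 0 ∷ 6 ∷ 4 ∷ 4 ∷ 2 ∷ 5 ∷ 1 ∷ 1 ∷ 3 ∷ 3 ∷ 6 ∷ 6 ∷ 5 ∷ 5 ∷ 4 ∷ 3 ∷ 0 ∷ 2 ∷ 2 ∷ 3 ∷ 5 ∷ 0 ∷ []) ∷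
  (27 , 23 , 0 ∷ 4 ∷ 1 ∷ 6 ∷ 2 ∷ 1 ∷ 0 ∷ 6 ∷ 4 ∷ 4 ∷ 2 ∷ 5 ∷ 1 ∷ 1 ∷ 3 ∷ 5 ∷ 6 ∷ 6 ∷ 3 ∷ 3 ∷ 4 ∷ 5 ∷ 5 ∷ 0 ∷ 3 ∷ 2 ∷ 2 ∷ 0 ∷ []) ∷
  (27 , 24 , 0 ∷ 4 ∷ 1 ∷ 6 ∷ 2 ∷ 1 ∷ 0 ∷ 6 ∷ 4 ∷ 4 ∷ 2 ∷ 5 ∷ 1 ∷ 1 ∷ 3 ∷ 6 ∷ 6 ∷ 5 ∷ 5 ∷ 4 ∷ 3 ∷ 3 ∷ 2 ∷ 2 ∷ 0 ∷ 5 ∷ 3 ∷ 0 ∷ []) ∷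
  []

trailsIn5 : ChordTrails 5 × Chord2Trails 5
trailsIn5 = TableCoversChords⇒ChordTrails (toWitness {a? = tableCoversChords? 5 table₅} _)
          , TableCoversChord2⇒Chord2Trails (toWitness {a? = tableCoversChord2? 5 table₅} _)

trailsIn7 : ChordTrails 7 × Chord2Trails 7
trailsIn7 = TableCoversChords⇒ChordTrails (toWitness {a? = tableCoversChords? 7 table₇} _)
          , TableCoversChord2⇒Chord2Trails (toWitness {a? = tableCoversChord2? 7 table₇} _)

-- K_1^* and K_3^* have too few edges for any case of the theorem; K_5^* and K_7^* are tabulated.
trailsInOdd : ∀ m → ChordTrails (suc (2 * m)) × Chord2Trails (suc (2 * m))
trailsInOdd 0 = (λ p q 3≤p 3≤q p+q<1 → ⊥-elim (<⇒≱ p+q<1 (≤-trans (s≤s z≤n) (+-mono-≤ 3≤p 3≤q))))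
              , (λ n 4≤n n+3≤1 → ⊥-elim (<⇒≱ (s≤s (s≤s z≤n)) (≤-trans (m≤n+m 3 n) n+3≤1)))
trailsInOdd 1 = (λ p q 3≤p 3≤q p+q<6 → ⊥-elim (<⇒≱ p+q<6 (+-mono-≤ 3≤p 3≤q)))
              , (λ n 4≤n n+3≤6 → ⊥-elim (<⇒≱ (n<1+n 6) (≤-trans (+-monoˡ-≤ 3 4≤n) n+3≤6)))
trailsInOdd 2 = trailsIn5
trailsInOdd 3 = trailsIn7
trailsInOdd (suc m@(suc (suc (suc _)))) =
  subst (λ k → ChordTrails k × Chord2Trails k) (cong suc (sym (*-suc 2 m)))
    (chordTrails-step odd 7≤K (proj₁ (trailsInOdd m)) , chord2Trails-step odd 7≤K (proj₂ (trailsInOdd m)))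
  where
  odd : Odd (suc (2 * m))
  odd = m , refl
  7≤K : 7 ≤ suc (2 * m)
  7≤K = s≤s (*-monoʳ-≤ 2 (s≤s (s≤s (s≤s z≤n))))

chord2⇔ : ∀ m {n} (j : Fin n) → toℕ j ≡ 2 → 4 ≤ n →
          EmbedsInKStar j (suc (2 * m)) ⇔ n + 3 ≤ triangle (suc (2 * m))
chord2⇔ m {n} j j≡2 4≤n = mk⇔
  (λ emb → let U , T = trail emb in
     chord2Trail-bound m (subst (λ i → ChordedTrail _ n i U) j≡2 T) (≤-trans (s≤s (s≤s z≤n)) 4≤n))
  (λ n+3≤ → embedding (map₂ (λ {U} → subst (λ i → ChordedTrail _ n i U) (sym j≡2)) (proj₂ (trailsInOdd m) n 4≤n n+3≤)))
  where open Function.Bundles.Equivalence (embeds⇔chordedTrail j) renaming (to to trail; from to embedding)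

chord≥3⇔ : ∀ m {n} (j : Fin n) → 3 ≤ toℕ j → 2 * toℕ j ≤ n →
           EmbedsInKStar j (suc (2 * m)) ⇔ n + 1 ≤ triangle (suc (2 * m))
chord≥3⇔ m {n} j 3≤j 2j≤n = mk⇔
  (λ emb → chordedTrail-bound (proj₂ (trail emb)) j≤n)
  (λ n+1≤ → embedding (subst (λ n → ∃ (ChordedTrail _ n (toℕ j))) j+[n∸j]≡n
     (proj₁ (trailsInOdd m) (toℕ j) (n ∸ toℕ j) 3≤j (≤-trans 3≤j j≤n∸j)
       (subst (_< N) (sym j+[n∸j]≡n) (subst (_≤ N) (+-comm n 1) n+1≤)))))
  where
  open Function.Bundles.Equivalence (embeds⇔chordedTrail j) renaming (to to trail; from to embedding)
  j≤n : toℕ j ≤ n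
  j≤n = <⇒≤ (toℕ<n j)
  j+[n∸j]≡n : toℕ j + (n ∸ toℕ j) ≡ n
  j+[n∸j]≡n = m+[n∸m]≡n j≤n
  N = triangle (suc (2 * m))
  j≤n∸j : toℕ j ≤ n ∸ toℕ j
  j≤n∸j = +-cancelˡ-≤ (toℕ j) _ _
    (subst₂ _≤_ (cong (toℕ j +_) (+-identityʳ (toℕ j))) (sym j+[n∸j]≡n) 2j≤n)

theorem2p7 : (k : ℕ) → Odd k → (n : ℕ) (j : Fin n) → 2 ≤ toℕ j → 2 * toℕ j ≤ n →
    (toℕ j ≡ 2 → (EmbedsInKStar j k ⇔ n + 3 ≤ suc k C 2))
    × (3 ≤ toℕ j → (EmbedsInKStar j k ⇔ n + 1 ≤ suc k C 2))
theorem2p7 k (m , refl) n j _ 2j≤n rewrite suc[k]C2≡triangle k =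
  (λ j≡2 → chord2⇔ m j j≡2 (subst (λ i → 2 * i ≤ n) j≡2 2j≤n)) , (λ 3≤j → chord≥3⇔ m j 3≤j 2j≤n)
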